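{- (Disjunction property of $BT$.) Let $\varphi$ and $\psi$ be closed formulas of $BT$. If $BT\vdash \varphi\vee\psi$, then $BT\vdash\varphi$ or $BT\vdash\psi$.
   Context: The theory $BT$ is the following many-typed first-order theory with intuitionistic logic. Types: $\omega$ (natural numbers) and $k=0,1,2,\ldots$; $\omega$ is regarded as smaller than every other type. Variables: numerical variables $m,n,\ldots$ of type $\omega$, and variables $X^k,Y^k,Z^k,\ldots$ of type $k$ for each $k\geqslant 0$; variables of type $0$ (operation variables) are also written $x,y,z,f,g,u,v,\ldots$. Constants: the numerical constant $0$ and the type-$0$ constants $\underline{k},\underline{s},\underline{d},\underline{p},\underline{p}_1,\underline{p}_2$ and $\underline{c}_n$ $(n\geqslant 0)$ (comprehension constants). There are no function symbols. Predicate symbols: $Ap(f,x,y)$, $x=_{0\omega}m$, $x=_{0k}Y^k$, $X^k\in_k Y^{k+1}$ $(k\geqslant 0)$. Formulas are built from atomic formulas and $\bot$ with $\wedge,\vee,\supset$ and quantifiers over variables of any type; $\neg\varphi$ abbreviates $\varphi\supset\bot$. A formula is $n$-elementary if it contains only types $\leqslant n$, no quantifiers over variables of type $n$ and no symbol $=_{0n}$. External terms: constants and variables are external terms, and if $t,\tau$ are external terms then so is $t\tau$; $t_1t_2\ldots t_n$ means $(\ldots(t_1t_2)\ldots)t_n$. For an external term $t$, the formula $t\simeq x$ is $x=_{0s}t$ if $t$ is a constant or variable of type $s$, and is $\exists y,z(t_1\simeq y\wedge t_2\simeq z\wedge Ap(y,z,x))$ if $t$ is $t_1t_2$. Abbreviations: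 $t\downarrow:=\exists x(t\simeq x)$; $t\simeq\tau:=\exists x(t\simeq x\wedge\tau\simeq x)$; $t\cong\tau:=\forall x(t\simeq x\equiv\tau\simeq x)$; $\varphi(t):=\exists x(t\simeq x\wedge\varphi(x))$. $\langle x_1\rangle:=x_1$, $\langle x_1,\ldots,x_{n+1}\rangle:=\underline{p}\langle x_1,\ldots,x_n\rangle x_{n+1}$, and $\tau(t_1,\ldots,t_n)$ means $\tau\langle t_1,\ldots,t_n\rangle$. Axioms of $BT$: 1. Intuitionistic predicate logic. 2. Equality: $x=_{00}x$; $u=_{0k}X^k\wedge v=_{0k}X\wedge u=_{0n}Y^n\supset v=_{0n}Y$ $(k,n\geqslant 0)$; $u=_{0\omega}m\wedge v=_{0\omega}m\supset u=_{00}v$; $u=_{0\omega}m\wedge u=_{00}v\supset v=_{0\omega}m$; $Ap(f,x,y)\wedge f=_{00}g\wedge x=_{00}u\wedge y=_{00}v\supset Ap(g,u,v)$; $X^k\in_kY^{k+1}\wedge X^k=_kU^k\wedge Y^{k+1}=_{k+1}Z^{k+1}\supset U\in_kZ$ $(k\geqslant0)$. 3. Combinatorial: $Ap(f,x,y)\wedge Ap(f,x,z)\supset y=z$; $\underline{k}xy\simeq x$; $\underline{s}xy\downarrow$; $\underline{s}xyz\cong xz(yz)$; $\underline{p}xy\downarrow$; $\neg(\underline{p}xy\simeq 0)$; $\underline{p}_ix\downarrow$ and $\underline{p}_i(\underline{p}x_1x_2)\simeq x_i$ $(i=1,2)$; $\exists m(\underline{p}n0\simeq m)$; $\exists Z^k(\underline{p}xY^k\simeq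 Z)$; $n=m\supset\underline{d}xynm\simeq x$; $n\neq m\supset\underline{d}xynm\simeq y$; $\exists x(x=_{0\omega}n)$; $\exists x(x=_{0k}Y^k)$. 4. Induction rule: from $\varphi[n/0]$ and $\varphi\supset\exists m(\underline{p}n0\simeq m\wedge\varphi[n/m])$ infer $\varphi$, for any formula $\varphi$. 5. Comprehension: $\exists U^{k+1}[\underline{c}_n(\widetilde X)\simeq U\wedge\forall Z^k(Z\in_kU\equiv\varphi)]$, where $\widetilde X$ is a finite list of variables of types $\leqslant k+1$, $\varphi$ is a $(k+1)$-elementary formula with all parameters among $Z^k,\widetilde X$, and $n$ is the Gödel number (in a fixed Gödel numbering of $BT$) of the expression $Z^k.\widetilde X.\varphi$. -}

module Defs where

-- Variables are de Bruijn indices in a typed context (List Ty); the head of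
-- a context is the most recently bound / last listed variable.

open import Data.Nat using (ℕ; zero; suc; _+_; _<_; _≤_)
open import Data.List using (List; []; _∷_; map)
open import Data.List.Relation.Unary.All using (All)
open import Data.List.Membership.Propositional using (_∈_)
open import Data.Unit using (⊤)
open import Data.Product using (_×_)

-- Types: ω (numbers) and k = 0,1,2,...

data Ty : Set where
  ω  : Ty
  ty : ℕ → Ty

_≤ᵀ_ : Ty → ℕ → Set
ω    ≤ᵀ n = ⊤
ty k ≤ᵀ n = k ≤ n

_<ᵀ_ : Ty → ℕ → Set
ω    <ᵀ n = ⊤
ty k <ᵀ n = k < n

Ctx : Set
Ctx = List Ty

data Var : Ctx → Ty → Set where
  here  : ∀ {Γ s} → Var (s ∷ Γ) s
  there : ∀ {Γ s t} → Var Γ s → Var (t ∷ Γ) s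

data Const : Set where
  cK cS cD cP cP₁ cP₂ : Const
  cC : ℕ → Const

-- atomic arguments: variables and constants (there are no function symbols)
data Tm (Γ : Ctx) : Ty → Set where
  var  : ∀ {s} → Var Γ s → Tm Γ s
  zer  : Tm Γ ω
  cst  : Const → Tm Γ (ty 0)

infixr 6 _∧̇_
infixr 5 _∨̇_
infixr 4 _⊃̇_

data Fm (Γ : Ctx) : Set where
  Ap   : Tm Γ (ty 0) → Tm Γ (ty 0) → Tm Γ (ty 0) → Fm Γ
  EqO  : Tm Γ (ty 0) → Tm Γ ω → Fm Γ
  EqK  : (k : ℕ) → Tm Γ (ty 0) → Tm Γ (ty k) → Fm Γ
  Mem  : (k : ℕ) → Tm Γ (ty k) → Tm Γ (ty (suc k)) → Fm Γ
  ⊥̇    : Fm Γ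
  _∧̇_  : Fm Γ → Fm Γ → Fm Γ
  _∨̇_  : Fm Γ → Fm Γ → Fm Γ
  _⊃̇_  : Fm Γ → Fm Γ → Fm Γ
  All̇  : (s : Ty) → Fm (s ∷ Γ) → Fm Γ
  Eẋ   : (s : Ty) → Fm (s ∷ Γ) → Fm Γ

¬̇_ : ∀ {Γ} → Fm Γ → Fm Γ
¬̇ A = A ⊃̇ ⊥̇

_⇔̇_ : ∀ {Γ} → Fm Γ → Fm Γ → Fm Γ
A ⇔̇ B = (A ⊃̇ B) ∧̇ (B ⊃̇ A)

Ren : Ctx → Ctx → Set
Ren Γ Δ = ∀ {s} → Var Γ s → Var Δ s

liftR : ∀ {Γ Δ t} → Ren Γ Δ → Ren (t ∷ Γ) (t ∷ Δ)
liftR ρ here      = here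
liftR ρ (there v) = there (ρ v)

renTm : ∀ {Γ Δ s} → Ren Γ Δ → Tm Γ s → Tm Δ s
renTm ρ (var v) = var (ρ v)
renTm ρ zer     = zer
renTm ρ (cst c) = cst c

renFm : ∀ {Γ Δ} → Ren Γ Δ → Fm Γ → Fm Δ
renFm ρ (Ap f x y)  = Ap (renTm ρ f) (renTm ρ x) (renTm ρ y)
renFm ρ (EqO x m)   = EqO (renTm ρ x) (renTm ρ m)
renFm ρ (EqK k x y) = EqK k (renTm ρ x) (renTm ρ y)
renFm ρ (Mem k x y) = Mem k (renTm ρ x) (renTm ρ y)
renFm ρ ⊥̇           = ⊥̇
renFm ρ (A ∧̇ B)     = renFm ρ A ∧̇ renFm ρ B
renFm ρ (A ∨̇ B)     = renFm ρ A ∨̇ renFm ρ B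
renFm ρ (A ⊃̇ B)     = renFm ρ A ⊃̇ renFm ρ B
renFm ρ (All̇ s A)   = All̇ s (renFm (liftR ρ) A)
renFm ρ (Eẋ s A)    = Eẋ s (renFm (liftR ρ) A)

wkFm : ∀ {Γ t} → Fm Γ → Fm (t ∷ Γ)
wkFm = renFm there

wkTm : ∀ {Γ s t} → Tm Γ s → Tm (t ∷ Γ) s
wkTm = renTm there

Sub : Ctx → Ctx → Set
Sub Γ Δ = ∀ {s} → Var Γ s → Tm Δ s

liftS : ∀ {Γ Δ t} → Sub Γ Δ → Sub (t ∷ Γ) (t ∷ Δ)
liftS σ here      = var here
liftS σ (there v) = wkTm (σ v)

subTm : ∀ {Γ Δ s} → Sub Γ Δ → Tm Γ s → Tm Δ s
subTm σ (var v) = σ v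
subTm σ zer     = zer
subTm σ (cst c) = cst c

subFm : ∀ {Γ Δ} → Sub Γ Δ → Fm Γ → Fm Δ
subFm σ (Ap f x y)  = Ap (subTm σ f) (subTm σ x) (subTm σ y)
subFm σ (EqO x m)   = EqO (subTm σ x) (subTm σ m)
subFm σ (EqK k x y) = EqK k (subTm σ x) (subTm σ y)
subFm σ (Mem k x y) = Mem k (subTm σ x) (subTm σ y)
subFm σ ⊥̇           = ⊥̇
subFm σ (A ∧̇ B)     = subFm σ A ∧̇ subFm σ B
subFm σ (A ∨̇ B)     = subFm σ A ∨̇ subFm σ B
subFm σ (A ⊃̇ B)     = subFm σ A ⊃̇ subFm σ B
subFm σ (All̇ s A)   = All̇ s (subFm (liftS σ) A)
subFm σ (Eẋ s A)    = Eẋ s (subFm (liftS σ) A)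

sub1 : ∀ {Γ s} → Fm (s ∷ Γ) → Tm Γ s → Fm Γ
sub1 {Γ} {s} A t = subFm σ A
  where
  σ : Sub (s ∷ Γ) Γ
  σ here      = t
  σ (there v) = var v

Close : (Γ : Ctx) → Fm Γ → Fm []
Close []      A = A
Close (s ∷ Γ) A = Close Γ (All̇ s A)

emb : ∀ {Γ} → Fm [] → Fm Γ
emb = renFm (λ ())

data ET (Γ : Ctx) : Set where
  tm  : ∀ {s} → Tm Γ s → ET Γ
  _·_ : ET Γ → ET Γ → ET Γ

infixl 9 _·_

renET : ∀ {Γ Δ} → Ren Γ Δ → ET Γ → ET Δ
renET ρ (tm a)  = tm (renTm ρ a)
renET ρ (t · u) = renET ρ t · renET ρ u

wkET : ∀ {Γ t} → ET Γ → ET (t ∷ Γ)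
wkET = renET there

v0 : ∀ {Γ s} → Tm (s ∷ Γ) s
v0 = var here
v1 : ∀ {Γ s t} → Tm (t ∷ s ∷ Γ) s
v1 = var (there here)
v2 : ∀ {Γ s t u} → Tm (u ∷ t ∷ s ∷ Γ) s
v2 = var (there (there here))
v3 : ∀ {Γ s t u w} → Tm (w ∷ u ∷ t ∷ s ∷ Γ) s
v3 = var (there (there (there here)))
v4 : ∀ {Γ s t u w r} → Tm (r ∷ w ∷ u ∷ t ∷ s ∷ Γ) s
v4 = var (there (there (there (there here))))

-- t ≃ x  (x of type 0); defined for the renamed term ρ(t) to be structural
simR : ∀ {Γ Δ} → Ren Γ Δ → ET Γ → Tm Δ (ty 0) → Fm Δ
simR ρ (tm {ω} a)    x = EqO x (renTm ρ a)
simR ρ (tm {ty k} a) x = EqK k x (renTm ρ a)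
simR ρ (t₁ · t₂)     x =
  Eẋ (ty 0) (Eẋ (ty 0)
     (simR (λ v → there (there (ρ v))) t₁ v1
      ∧̇ simR (λ v → there (there (ρ v))) t₂ v0
      ∧̇ Ap v1 v0 (renTm (λ v → there (there v)) x)))

_≃₀_ : ∀ {Γ} → ET Γ → Tm Γ (ty 0) → Fm Γ
t ≃₀ x = simR (λ v → v) t x

_↓̇ : ∀ {Γ} → ET Γ → Fm Γ
t ↓̇ = Eẋ (ty 0) (wkET t ≃₀ v0)

_≃̇_ : ∀ {Γ} → ET Γ → ET Γ → Fm Γ
t ≃̇ τ = Eẋ (ty 0) ((wkET t ≃₀ v0) ∧̇ (wkET τ ≃₀ v0))

_≅̇_ : ∀ {Γ} → ET Γ → ET Γ → Fm Γ
t ≅̇ τ = All̇ (ty 0) ((wkET t ≃₀ v0) ⇔̇ (wkET τ ≃₀ v0))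

EqT : ∀ {Γ} (k : ℕ) → Tm Γ (ty k) → Tm Γ (ty k) → Fm Γ
EqT zero    a b = EqK 0 a b
EqT (suc k) a b = All̇ (ty k) (Mem k v0 (wkTm a) ⇔̇ Mem k v0 (wkTm b))

K S D P P₁ P₂ : ∀ {Γ} → ET Γ
K  = tm (cst cK)
S  = tm (cst cS)
D  = tm (cst cD)
P  = tm (cst cP)
P₁ = tm (cst cP₁)
P₂ = tm (cst cP₂)

-- τ(X₁,…,Xₙ) = τ⟨X₁,…,Xₙ⟩ for the variables of a context
-- (head of the context = last variable Xₙ);  τ() := τ for the empty list.
tuple : ∀ (Δ : Ctx) {s} → ET (s ∷ Δ)
tuple []      = tm v0
tuple (t ∷ Δ) = P · wkET (tuple Δ) · tm v0

applyTuple : ∀ {Δ} → ET Δ → ET Δ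
applyTuple {[]}    τ = τ
applyTuple {s ∷ Δ} τ = τ · tuple Δ

-- n-elementary formulas (all variable types ≤ n is imposed on the context
-- separately; here: no quantifier over type n, no =_{0n}, types ≤ n)

Elem : ∀ {Γ} → ℕ → Fm Γ → Set
Elem n (Ap _ _ _)  = ⊤
Elem n (EqO _ _)   = ⊤
Elem n (EqK k _ _) = k < n
Elem n (Mem k _ _) = suc k ≤ n
Elem n ⊥̇           = ⊤
Elem n (A ∧̇ B)     = Elem n A × Elem n B
Elem n (A ∨̇ B)     = Elem n A × Elem n B
Elem n (A ⊃̇ B)     = Elem n A × Elem n B
Elem n (All̇ s A)   = s <ᵀ n × Elem n A
Elem n (Eẋ s A)    = s <ᵀ n × Elem n A

tri : ℕ → ℕ
tri zero    = zero
tri (suc n) = suc n + tri n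

pair : ℕ → ℕ → ℕ
pair a b = tri (a + b) + b

codeTy : Ty → ℕ
codeTy ω      = 0
codeTy (ty k) = suc k

codeCtx : Ctx → ℕ
codeCtx []      = 0
codeCtx (s ∷ Γ) = suc (pair (codeTy s) (codeCtx Γ))

codeVar : ∀ {Γ s} → Var Γ s → ℕ
codeVar here      = 0
codeVar (there v) = suc (codeVar v)

codeConst : Const → ℕ
codeConst cK     = 0
codeConst cS     = 1
codeConst cD     = 2
codeConst cP     = 3
codeConst cP₁    = 4
codeConst cP₂    = 5
codeConst (cC n) = 6 + n

codeTm : ∀ {Γ s} → Tm Γ s → ℕ
codeTm (var v) = pair 0 (codeVar v)
codeTm zer     = pair 1 0
codeTm (cst c) = pair 2 (codeConst c)

codeFm : ∀ {Γ} → Fm Γ → ℕ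
codeFm (Ap f x y)  = pair 0 (pair (codeTm f) (pair (codeTm x) (codeTm y)))
codeFm (EqO x m)   = pair 1 (pair (codeTm x) (codeTm m))
codeFm (EqK k x y) = pair 2 (pair k (pair (codeTm x) (codeTm y)))
codeFm (Mem k x y) = pair 3 (pair k (pair (codeTm x) (codeTm y)))
codeFm ⊥̇           = pair 4 0
codeFm (A ∧̇ B)     = pair 5 (pair (codeFm A) (codeFm B))
codeFm (A ∨̇ B)     = pair 6 (pair (codeFm A) (codeFm B))
codeFm (A ⊃̇ B)     = pair 7 (pair (codeFm A) (codeFm B))
codeFm (All̇ s A)   = pair 8 (pair (codeTy s) (codeFm A))
codeFm (Eẋ s A)    = pair 9 (pair (codeTy s) (codeFm A))

codeComp : (k : ℕ) (Δ : Ctx) → Fm (ty k ∷ Δ) → ℕ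
codeComp k Δ φ = pair k (pair (codeCtx Δ) (codeFm φ))

compBody : (k : ℕ) (Δ : Ctx) → Fm (ty k ∷ Δ) → Fm Δ
compBody k Δ φ =
  Eẋ (ty (suc k))
    ((wkET (applyTuple {Δ} (tm (cst (cC (codeComp k Δ φ))))) ≃̇ tm v0)
     ∧̇ All̇ (ty k) (Mem k v0 v1 ⇔̇ renFm ρ φ))
  where
  ρ : Ren (ty k ∷ Δ) (ty k ∷ ty (suc k) ∷ Δ)
  ρ here      = here
  ρ (there v) = there (there v)

data Axiom : Fm [] → Set where
  eq-refl : Axiom (Close (ty 0 ∷ []) (EqK 0 v0 v0))
  eq-names : ∀ k n → Axiom (Close (ty n ∷ ty k ∷ ty 0 ∷ ty 0 ∷ [])
    -- u=v3, v=v2, X=v1, Y=v0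
    ((EqK k v3 v1 ∧̇ EqK k v2 v1 ∧̇ EqK n v3 v0) ⊃̇ EqK n v2 v0))
  eq-num1 : Axiom (Close (ty 0 ∷ ty 0 ∷ ω ∷ [])
    -- m=v2, u=v1, v=v0
    ((EqO v1 v2 ∧̇ EqO v0 v2) ⊃̇ EqK 0 v1 v0))
  eq-num2 : Axiom (Close (ty 0 ∷ ty 0 ∷ ω ∷ [])
    ((EqO v1 v2 ∧̇ EqK 0 v1 v0) ⊃̇ EqO v0 v2))
  eq-ap : Axiom (Close (ty 0 ∷ ty 0 ∷ ty 0 ∷ ty 0 ∷ ty 0 ∷ ty 0 ∷ [])
    -- f,x,y,g,u,v  (v = v0, u = v1, g = v2, y = v3, x = v4, f = v5)
    ((Ap (var (there (there (there (there (there here)))))) v4 v3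
      ∧̇ EqK 0 (var (there (there (there (there (there here)))))) v2
      ∧̇ EqK 0 v4 v1 ∧̇ EqK 0 v3 v0) ⊃̇ Ap v2 v1 v0))
  eq-mem : ∀ k → Axiom (Close (ty (suc k) ∷ ty k ∷ ty (suc k) ∷ ty k ∷ [])
    -- X=v3, Y=v2, U=v1, Z=v0
    ((Mem k v3 v2 ∧̇ EqT k v3 v1 ∧̇ EqT (suc k) v2 v0) ⊃̇ Mem k v1 v0))
  ap-fun : Axiom (Close (ty 0 ∷ ty 0 ∷ ty 0 ∷ ty 0 ∷ [])
    -- f=v3, x=v2, y=v1, z=v0
    ((Ap v3 v2 v1 ∧̇ Ap v3 v2 v0) ⊃̇ EqK 0 v1 v0))
  ax-k : Axiom (Close (ty 0 ∷ ty 0 ∷ []) ((K · tm v1 · tm v0) ≃̇ tm v1))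
  ax-s1 : Axiom (Close (ty 0 ∷ ty 0 ∷ []) ((S · tm v1 · tm v0) ↓̇))
  ax-s2 : Axiom (Close (ty 0 ∷ ty 0 ∷ ty 0 ∷ [])
    ((S · tm v2 · tm v1 · tm v0) ≅̇ (tm v2 · tm v0 · (tm v1 · tm v0))))
  ax-p1 : Axiom (Close (ty 0 ∷ ty 0 ∷ []) ((P · tm v1 · tm v0) ↓̇))
  ax-p2 : Axiom (Close (ty 0 ∷ ty 0 ∷ []) (¬̇ ((P · tm v1 · tm v0) ≃̇ tm zer)))
  ax-pi1 : Axiom (Close (ty 0 ∷ []) ((P₁ · tm v0) ↓̇))
  ax-pi2 : Axiom (Close (ty 0 ∷ []) ((P₂ · tm v0) ↓̇))
  ax-pi1' : Axiom (Close (ty 0 ∷ ty 0 ∷ []) ((P₁ · (P · tm v1 · tm v0)) ≃̇ tm v1))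
  ax-pi2' : Axiom (Close (ty 0 ∷ ty 0 ∷ []) ((P₂ · (P · tm v1 · tm v0)) ≃̇ tm v0))
  ax-suc : Axiom (Close (ω ∷ []) (Eẋ ω ((P · tm v1 · tm zer) ≃̇ tm v0)))
  ax-pk : ∀ k → Axiom (Close (ty k ∷ ty 0 ∷ [])
    (Eẋ (ty k) ((P · tm v2 · tm v1) ≃̇ tm v0)))
  -- d x y n m : context x=v3, y=v2, n=v1, m=v0 ;  n = m  is  n ≃ m
  ax-d1 : Axiom (Close (ω ∷ ω ∷ ty 0 ∷ ty 0 ∷ [])
    ((tm v1 ≃̇ tm v0) ⊃̇ ((D · tm v3 · tm v2 · tm v1 · tm v0) ≃̇ tm v3)))
  ax-d2 : Axiom (Close (ω ∷ ω ∷ ty 0 ∷ ty 0 ∷ [])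
    ((¬̇ (tm v1 ≃̇ tm v0)) ⊃̇ ((D · tm v3 · tm v2 · tm v1 · tm v0) ≃̇ tm v2)))
  name-ω : Axiom (Close (ω ∷ []) (Eẋ (ty 0) (EqO v0 v1)))
  name-k : ∀ k → Axiom (Close (ty k ∷ []) (Eẋ (ty 0) (EqK k v0 v1)))
  comp : ∀ k (Δ : Ctx) (φ : Fm (ty k ∷ Δ)) →
         All (λ s → s ≤ᵀ suc k) Δ → Elem (suc k) φ →
         Axiom (Close Δ (compBody k Δ φ))

infix 2 _∣_⊢_

data _∣_⊢_ : (Γ : Ctx) → List (Fm Γ) → Fm Γ → Set where
  hyp  : ∀ {Γ Hs A} → A ∈ Hs → Γ ∣ Hs ⊢ A
  ax   : ∀ {Γ Hs A} → Axiom A → Γ ∣ Hs ⊢ emb A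
  ⊥E   : ∀ {Γ Hs A} → Γ ∣ Hs ⊢ ⊥̇ → Γ ∣ Hs ⊢ A
  ∧I   : ∀ {Γ Hs A B} → Γ ∣ Hs ⊢ A → Γ ∣ Hs ⊢ B → Γ ∣ Hs ⊢ A ∧̇ B
  ∧E₁  : ∀ {Γ Hs A B} → Γ ∣ Hs ⊢ A ∧̇ B → Γ ∣ Hs ⊢ A
  ∧E₂  : ∀ {Γ Hs A B} → Γ ∣ Hs ⊢ A ∧̇ B → Γ ∣ Hs ⊢ B
  ∨I₁  : ∀ {Γ Hs A B} → Γ ∣ Hs ⊢ A → Γ ∣ Hs ⊢ A ∨̇ B
  ∨I₂  : ∀ {Γ Hs A B} → Γ ∣ Hs ⊢ B → Γ ∣ Hs ⊢ A ∨̇ B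
  ∨E   : ∀ {Γ Hs A B C} → Γ ∣ Hs ⊢ A ∨̇ B →
           Γ ∣ A ∷ Hs ⊢ C → Γ ∣ B ∷ Hs ⊢ C → Γ ∣ Hs ⊢ C
  ⊃I   : ∀ {Γ Hs A B} → Γ ∣ A ∷ Hs ⊢ B → Γ ∣ Hs ⊢ A ⊃̇ B
  ⊃E   : ∀ {Γ Hs A B} → Γ ∣ Hs ⊢ A ⊃̇ B → Γ ∣ Hs ⊢ A → Γ ∣ Hs ⊢ B
  ∀I   : ∀ {Γ Hs s A} → (s ∷ Γ) ∣ map wkFm Hs ⊢ A → Γ ∣ Hs ⊢ All̇ s A
  ∀E   : ∀ {Γ Hs s A} → Γ ∣ Hs ⊢ All̇ s A → (t : Tm Γ s) → Γ ∣ Hs ⊢ sub1 A t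
  ∃I   : ∀ {Γ Hs s A} → (t : Tm Γ s) → Γ ∣ Hs ⊢ sub1 A t → Γ ∣ Hs ⊢ Eẋ s A
  ∃E   : ∀ {Γ Hs s A B} → Γ ∣ Hs ⊢ Eẋ s A →
           (s ∷ Γ) ∣ A ∷ map wkFm Hs ⊢ wkFm B → Γ ∣ Hs ⊢ B
  ind  : ∀ {Γ Hs} (φ : Fm (ω ∷ Γ)) →
           Γ ∣ [] ⊢ sub1 φ zer →
           (ω ∷ Γ) ∣ [] ⊢ (φ ⊃̇ Eẋ ω (((P · tm v1 · tm zer) ≃̇ tm v0)
                                     ∧̇ renFm (liftR there) φ)) →
           (ω ∷ Γ) ∣ Hs ⊢ φ

BT⊢ : Fm [] → Set
BT⊢ A = [] ∣ [] ⊢ A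

-- The proof glues derivability onto a Kripke model, in the manner of the
-- Aczel slash.  A world is a context of fresh variables together with
-- hypotheses about them; it may be extended by renaming, and it is covered
-- by any chain of ∃-eliminations of existentials derivable in it.  A formula
-- is forced when it is derivable and, clause by clause, semantically true:
-- disjunctions and existentials must be witnessed after a cover, numbers
-- must be provably equal to numerals, and an object of type k+1 carries the
-- comprehension formula it was introduced by, membership in it being the
-- forcing of that formula.  A comprehension formula for type k+1 is
-- (k+1)-elementary, so membership at level k refers only to lower levels and
-- to the parameters of the formula; this stratification makes the model
-- well defined and validates the comprehension axioms.  Every theorem of BT
-- is forced in the empty world, and collapsing the cover that witnesses a
-- forced disjunction yields a derivation of one disjunct.

module Submission where

open import Defs
open import Data.Bool using (Bool; true; false; _∧_; T)
open import Data.Bool.Properties using (T-∧)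
open import Data.Empty using (⊥-elim)
open import Data.List using (List; []; _∷_; map)
open import Data.List.Membership.Propositional using (_∈_)
open import Data.List.Membership.Propositional.Properties using (∈-map⁺; ∈-map⁻)
open import Data.List.Relation.Binary.Subset.Propositional using (_⊆_)
open import Data.List.Relation.Binary.Subset.Propositional.Properties using (map⁺; ∷⁺ʳ)
open import Data.List.Relation.Unary.All using (All; []; _∷_)
open import Data.List.Relation.Unary.Any using (here; there)
open import Data.Nat using (ℕ; zero; suc; _≤_; _<_; _≤′_; ≤′-refl; ≤′-step; z≤n; _≟_; _<?_)
open import Data.Nat.Base using (s≤s⁻¹)
open import Data.Nat.Properties using (≤-refl; ≤⇒≤′; ≤∧≢⇒<; n<1+n)
open import Data.Product using (Σ; _×_; _,_; proj₁; proj₂)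
open import Data.Sum using (_⊎_; inj₁; inj₂)
open import Data.Unit using (⊤; tt)
open import Data.Unit.Polymorphic using () renaming (⊤ to ⊤₁; tt to tt₁)
open import Function.Base using (id)
open import Function.Bundles using (_⇔_; mk⇔; Equivalence)
open import Function.Construct.Composition using (_⇔-∘_)
open import Function.Construct.Symmetry using (⇔-sym)
open import Function.Related.Propositional using (≡⇒)
open import Relation.Nullary using (yes; no; Dec)
open import Relation.Binary.PropositionalEquality

open Equivalence using (to; from)

cong₃ : ∀ {A B C D : Set} (f : A → B → C → D) {a a' b b' c c'} → a ≡ a' → b ≡ b' → c ≡ c' → f a b c ≡ f a' b' c'
cong₃ f refl refl refl = refl

infix 4 _≗ˢ_
_≗ˢ_ : ∀ {Γ Δ} → Sub Γ Δ → Sub Γ Δ → Set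
σ ≗ˢ τ = ∀ {s} (v : Var _ s) → σ v ≡ τ v

_⊙_ : ∀ {Γ Δ Θ} → Sub Δ Θ → Sub Γ Δ → Sub Γ Θ
(σ ⊙ τ) v = subTm σ (τ v)

liftS-cong : ∀ {Γ Δ t} {σ τ : Sub Γ Δ} → σ ≗ˢ τ → liftS {t = t} σ ≗ˢ liftS τ
liftS-cong e here = refl
liftS-cong e (there v) = cong wkTm (e v)

subTm-cong : ∀ {Γ Δ s} {σ τ : Sub Γ Δ} → σ ≗ˢ τ → (t : Tm Γ s) → subTm σ t ≡ subTm τ t
subTm-cong e (var v) = e v
subTm-cong e zer = refl
subTm-cong e (cst c) = refl

subFm-cong : ∀ {Γ Δ} {σ τ : Sub Γ Δ} → σ ≗ˢ τ → (A : Fm Γ) → subFm σ A ≡ subFm τ A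
subFm-cong e (Ap f x y) = cong₃ Ap (subTm-cong e f) (subTm-cong e x) (subTm-cong e y)
subFm-cong e (EqO x m) = cong₂ EqO (subTm-cong e x) (subTm-cong e m)
subFm-cong e (EqK k x y) = cong₂ (EqK k) (subTm-cong e x) (subTm-cong e y)
subFm-cong e (Mem k x y) = cong₂ (Mem k) (subTm-cong e x) (subTm-cong e y)
subFm-cong e ⊥̇ = refl
subFm-cong e (A ∧̇ B) = cong₂ _∧̇_ (subFm-cong e A) (subFm-cong e B)
subFm-cong e (A ∨̇ B) = cong₂ _∨̇_ (subFm-cong e A) (subFm-cong e B)
subFm-cong e (A ⊃̇ B) = cong₂ _⊃̇_ (subFm-cong e A) (subFm-cong e B)
subFm-cong e (All̇ s A) = cong (All̇ s) (subFm-cong (liftS-cong e) A)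
subFm-cong e (Eẋ s A) = cong (Eẋ s) (subFm-cong (liftS-cong e) A)

subTm-wk : ∀ {Γ Δ s t} (σ : Sub Γ Δ) (a : Tm Γ s) → subTm (liftS {t = t} σ) (wkTm a) ≡ wkTm (subTm σ a)
subTm-wk σ (var v) = refl
subTm-wk σ zer = refl
subTm-wk σ (cst c) = refl

lift-comp : ∀ {Γ Δ Θ t} (σ : Sub Δ Θ) (τ : Sub Γ Δ) → (liftS {t = t} σ ⊙ liftS τ) ≗ˢ liftS (σ ⊙ τ)
lift-comp σ τ here = refl
lift-comp σ τ (there v) = subTm-wk σ (τ v)

subTm-comp : ∀ {Γ Δ Θ s} (σ : Sub Δ Θ) (τ : Sub Γ Δ) (a : Tm Γ s) → subTm σ (subTm τ a) ≡ subTm (σ ⊙ τ) a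
subTm-comp σ τ (var v) = refl
subTm-comp σ τ zer = refl
subTm-comp σ τ (cst c) = refl

subFm-comp : ∀ {Γ Δ Θ} (σ : Sub Δ Θ) (τ : Sub Γ Δ) (A : Fm Γ) → subFm σ (subFm τ A) ≡ subFm (σ ⊙ τ) A
subFm-comp σ τ (Ap f x y) = cong₃ Ap (subTm-comp σ τ f) (subTm-comp σ τ x) (subTm-comp σ τ y)
subFm-comp σ τ (EqO x m) = cong₂ EqO (subTm-comp σ τ x) (subTm-comp σ τ m)
subFm-comp σ τ (EqK k x y) = cong₂ (EqK k) (subTm-comp σ τ x) (subTm-comp σ τ y)
subFm-comp σ τ (Mem k x y) = cong₂ (Mem k) (subTm-comp σ τ x) (subTm-comp σ τ y)
subFm-comp σ τ ⊥̇ = refl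
subFm-comp σ τ (A ∧̇ B) = cong₂ _∧̇_ (subFm-comp σ τ A) (subFm-comp σ τ B)
subFm-comp σ τ (A ∨̇ B) = cong₂ _∨̇_ (subFm-comp σ τ A) (subFm-comp σ τ B)
subFm-comp σ τ (A ⊃̇ B) = cong₂ _⊃̇_ (subFm-comp σ τ A) (subFm-comp σ τ B)
subFm-comp σ τ (All̇ s A) = cong (All̇ s) (trans (subFm-comp (liftS σ) (liftS τ) A) (subFm-cong (lift-comp σ τ) A))
subFm-comp σ τ (Eẋ s A) = cong (Eẋ s) (trans (subFm-comp (liftS σ) (liftS τ) A) (subFm-cong (lift-comp σ τ) A))

_≗ᴿ_ : ∀ {Γ Δ} → Ren Γ Δ → Ren Γ Δ → Set
r ≗ᴿ r' = ∀ {s} (v : Var _ s) → r v ≡ r' v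

renTm-cong : ∀ {G G' s} {r r' : Ren G G'} → r ≗ᴿ r' → (t : Tm G s) → renTm r t ≡ renTm r' t
renTm-cong e (var v) = cong var (e v)
renTm-cong e zer = refl
renTm-cong e (cst c) = refl

renTm-comp : ∀ {G G' G'' s} (r2 : Ren G' G'') (r1 : Ren G G') (t : Tm G s) → renTm r2 (renTm r1 t) ≡ renTm (λ v → r2 (r1 v)) t
renTm-comp r2 r1 (var v) = refl
renTm-comp r2 r1 zer = refl
renTm-comp r2 r1 (cst c) = refl

renTm-id : ∀ {G s} (t : Tm G s) → renTm (λ v → v) t ≡ t
renTm-id (var v) = refl
renTm-id zer = refl
renTm-id (cst c) = refl

ren⇒sub : ∀ {Γ Δ} → Ren Γ Δ → Sub Γ Δ
ren⇒sub r v = var (r v)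

renTm-sub : ∀ {Γ Δ s} (r : Ren Γ Δ) (a : Tm Γ s) → renTm r a ≡ subTm (ren⇒sub r) a
renTm-sub r (var v) = refl
renTm-sub r zer = refl
renTm-sub r (cst c) = refl

liftR-sub : ∀ {Γ Δ t} (r : Ren Γ Δ) → ren⇒sub (liftR {t = t} r) ≗ˢ liftS (ren⇒sub r)
liftR-sub r here = refl
liftR-sub r (there v) = refl

renFm-sub : ∀ {Γ Δ} (r : Ren Γ Δ) (A : Fm Γ) → renFm r A ≡ subFm (ren⇒sub r) A
renFm-sub r (Ap f x y) = cong₃ Ap (renTm-sub r f) (renTm-sub r x) (renTm-sub r y)
renFm-sub r (EqO x m) = cong₂ EqO (renTm-sub r x) (renTm-sub r m)
renFm-sub r (EqK k x y) = cong₂ (EqK k) (renTm-sub r x) (renTm-sub r y)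
renFm-sub r (Mem k x y) = cong₂ (Mem k) (renTm-sub r x) (renTm-sub r y)
renFm-sub r ⊥̇ = refl
renFm-sub r (A ∧̇ B) = cong₂ _∧̇_ (renFm-sub r A) (renFm-sub r B)
renFm-sub r (A ∨̇ B) = cong₂ _∨̇_ (renFm-sub r A) (renFm-sub r B)
renFm-sub r (A ⊃̇ B) = cong₂ _⊃̇_ (renFm-sub r A) (renFm-sub r B)
renFm-sub r (All̇ s A) = cong (All̇ s) (trans (renFm-sub (liftR r) A) (subFm-cong (liftR-sub r) A))
renFm-sub r (Eẋ s A) = cong (Eẋ s) (trans (renFm-sub (liftR r) A) (subFm-cong (liftR-sub r) A))

idS : ∀ {Γ} → Sub Γ Γ
idS v = var v

liftS-id : ∀ {Γ t} → liftS {t = t} (idS {Γ}) ≗ˢ idS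
liftS-id here = refl
liftS-id (there v) = refl

subTm-id : ∀ {Γ s} (a : Tm Γ s) → subTm idS a ≡ a
subTm-id (var v) = refl
subTm-id zer = refl
subTm-id (cst c) = refl

subFm-id : ∀ {Γ} (A : Fm Γ) → subFm idS A ≡ A
subFm-id (Ap f x y) = cong₃ Ap (subTm-id f) (subTm-id x) (subTm-id y)
subFm-id (EqO x m) = cong₂ EqO (subTm-id x) (subTm-id m)
subFm-id (EqK k x y) = cong₂ (EqK k) (subTm-id x) (subTm-id y)
subFm-id (Mem k x y) = cong₂ (Mem k) (subTm-id x) (subTm-id y)
subFm-id ⊥̇ = refl
subFm-id (A ∧̇ B) = cong₂ _∧̇_ (subFm-id A) (subFm-id B)
subFm-id (A ∨̇ B) = cong₂ _∨̇_ (subFm-id A) (subFm-id B)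
subFm-id (A ⊃̇ B) = cong₂ _⊃̇_ (subFm-id A) (subFm-id B)
subFm-id (All̇ s A) = cong (All̇ s) (trans (subFm-cong liftS-id A) (subFm-id A))
subFm-id (Eẋ s A) = cong (Eẋ s) (trans (subFm-cong liftS-id A) (subFm-id A))

singleSub : ∀ {Γ s} → Tm Γ s → Sub (s ∷ Γ) Γ
singleSub t here = t
singleSub t (there v) = var v

sub1≡ : ∀ {Γ s} (A : Fm (s ∷ Γ)) (t : Tm Γ s) → sub1 A t ≡ subFm (singleSub t) A
sub1≡ A t = subFm-cong (λ { here → refl ; (there v) → refl }) A

subFm-subFm : ∀ {Γ Δ Θ} {σ : Sub Δ Θ} {τ : Sub Γ Δ} {σ' : Sub Γ Θ} → (σ ⊙ τ) ≗ˢ σ' → (A : Fm Γ) → subFm σ (subFm τ A) ≡ subFm σ' A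
subFm-subFm e A = trans (subFm-comp _ _ A) (subFm-cong e A)

subTm-wkTm : ∀ {Γ Δ s t} {σ' : Sub (t ∷ Γ) Δ} {σ : Sub Γ Δ} → (∀ {s'} (v : Var Γ s') → σ' (there v) ≡ σ v) → (a : Tm Γ s) → subTm σ' (wkTm a) ≡ subTm σ a
subTm-wkTm e (var v) = e v
subTm-wkTm e zer = refl
subTm-wkTm e (cst c) = refl

wk-sub : ∀ {Γ Δ t} (σ : Sub Γ Δ) (A : Fm Γ) → subFm (liftS {t = t} σ) (wkFm A) ≡ wkFm (subFm σ A)
wk-sub σ A = trans (cong (subFm (liftS σ)) (renFm-sub there A))
             (trans (subFm-subFm (λ v → refl) A)
             (sym (trans (renFm-sub there (subFm σ A)) (subFm-subFm (λ v → sym (renTm-sub there (σ v))) A))))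

sub1-sub : ∀ {Γ Δ s} (σ : Sub Γ Δ) (A : Fm (s ∷ Γ)) (t : Tm Γ s) → subFm σ (sub1 A t) ≡ sub1 (subFm (liftS σ) A) (subTm σ t)
sub1-sub σ A t = trans (cong (subFm σ) (sub1≡ A t))
  (trans (subFm-subFm {σ' = λ v → subTm σ (singleSub t v)} (λ v → refl) A)
  (sym (trans (sub1≡ _ (subTm σ t)) (subFm-subFm (λ { here → refl ; (there v) → trans (subTm-wkTm {σ = idS} (λ _ → refl) (σ v)) (subTm-id (σ v)) }) A))))

renFm-comp : ∀ {Γ Δ Θ} (r : Ren Δ Θ) (r' : Ren Γ Δ) (A : Fm Γ) → renFm r (renFm r' A) ≡ renFm (λ v → r (r' v)) A
renFm-comp r r' A = trans (renFm-sub r _) (trans (cong (subFm _) (renFm-sub r' A))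
  (trans (subFm-subFm (λ v → refl) A) (sym (renFm-sub _ A))))

castH : ∀ {Γ Hs Hs' A} → Hs ≡ Hs' → Γ ∣ Hs ⊢ A → Γ ∣ Hs' ⊢ A
castH refl d = d

castF : ∀ {Γ Hs A A'} → A ≡ A' → Γ ∣ Hs ⊢ A → Γ ∣ Hs ⊢ A'
castF refl d = d

map-wk-sub : ∀ {Γ Δ t} (σ : Sub Γ Δ) (Hs : List (Fm Γ)) → map (subFm (liftS {t = t} σ)) (map wkFm Hs) ≡ map wkFm (map (subFm σ) Hs)
map-wk-sub σ [] = refl
map-wk-sub σ (H ∷ Hs) = cong₂ _∷_ (wk-sub σ H) (map-wk-sub σ Hs)

emb-sub : ∀ {Γ Δ} (σ : Sub Γ Δ) (A : Fm []) → subFm σ (emb A) ≡ emb A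
emb-sub σ A = trans (cong (subFm σ) (renFm-sub (λ ()) A)) (trans (subFm-subFm (λ ()) A) (sym (renFm-sub (λ ()) A)))

subFm-liftR-there : ∀ {Γ Δ} (σ : Sub Γ Δ) (φ : Fm (ω ∷ Γ)) →
  subFm (liftS (liftS σ)) (renFm (liftR there) φ) ≡ renFm (liftR there) (subFm (liftS σ) φ)
subFm-liftR-there σ φ = trans (cong (subFm _) (renFm-sub (liftR there) φ))
  (trans (subFm-subFm {σ' = f} e1 φ)
  (sym (trans (renFm-sub (liftR there) _) (subFm-subFm e2 φ))))
  where
  f : Sub (ω ∷ _) (ω ∷ ω ∷ _)
  f here = var here
  f (there v) = wkTm (wkTm (σ v))
  e1 : (liftS (liftS σ) ⊙ ren⇒sub (liftR there)) ≗ˢ f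
  e1 here = refl
  e1 (there v) = refl
  e2 : (ren⇒sub (liftR there) ⊙ liftS σ) ≗ˢ f
  e2 here = refl
  e2 (there v) with σ v
  ... | var u = refl
  ... | zer = refl
  ... | cst c = refl

⊢-sub : ∀ {Γ Δ Hs A} → Γ ∣ Hs ⊢ A → (σ : Sub Γ Δ) → Δ ∣ map (subFm σ) Hs ⊢ subFm σ A
⊢-sub (hyp p) σ = hyp (∈-map⁺ (subFm σ) p)
⊢-sub (ax {A = A} a) σ = castF (sym (emb-sub σ A)) (ax a)
⊢-sub (⊥E d) σ = ⊥E (⊢-sub d σ)
⊢-sub (∧I d e) σ = ∧I (⊢-sub d σ) (⊢-sub e σ)
⊢-sub (∧E₁ d) σ = ∧E₁ (⊢-sub d σ)
⊢-sub (∧E₂ d) σ = ∧E₂ (⊢-sub d σ)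
⊢-sub (∨I₁ d) σ = ∨I₁ (⊢-sub d σ)
⊢-sub (∨I₂ d) σ = ∨I₂ (⊢-sub d σ)
⊢-sub (∨E d e f) σ = ∨E (⊢-sub d σ) (⊢-sub e σ) (⊢-sub f σ)
⊢-sub (⊃I d) σ = ⊃I (⊢-sub d σ)
⊢-sub (⊃E d e) σ = ⊃E (⊢-sub d σ) (⊢-sub e σ)
⊢-sub {Hs = Hs} (∀I d) σ = ∀I (castH (map-wk-sub σ Hs) (⊢-sub d (liftS σ)))
⊢-sub (∀E {A = A} d t) σ = castF (sym (sub1-sub σ A t)) (∀E (⊢-sub d σ) (subTm σ t))
⊢-sub (∃I {A = A} t d) σ = ∃I (subTm σ t) (castF (sub1-sub σ A t) (⊢-sub d σ))
⊢-sub {Hs = Hs} (∃E {B = B} d e) σ = ∃E (⊢-sub d σ) (castF (wk-sub σ B) (castH (cong (_ ∷_) (map-wk-sub σ Hs)) (⊢-sub e (liftS σ))))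
⊢-sub {Γ = .(ω ∷ Γ)} {Hs = Hs} (ind {Γ} φ d e) σ =
  castF eq (∀E (∀I (ind (subFm (liftS σ') φ) d' e')) (σ here))
  where
  σ' : Sub Γ _
  σ' v = σ (there v)
  d' = castF (sub1-sub σ' φ zer) (⊢-sub d σ')
  e' = castF (cong (λ z → subFm (liftS σ') φ ⊃̇ Eẋ ω (((P · tm v1 · tm zer) ≃̇ tm v0) ∧̇ z)) (subFm-liftR-there σ' φ)) (⊢-sub e (liftS σ'))
  eq : sub1 (subFm (liftS σ') φ) (σ here) ≡ subFm σ φ
  eq = trans (sub1≡ _ _) (subFm-subFm (λ { here → refl ; (there v) → trans (subTm-wkTm {σ = idS} (λ _ → refl) (σ' v)) (subTm-id (σ' v)) }) φ)

⊢-⊆ : ∀ {Γ Hs Hs' A} → Γ ∣ Hs ⊢ A → Hs ⊆ Hs' → Γ ∣ Hs' ⊢ A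
⊢-⊆ (hyp p) s = hyp (s p)
⊢-⊆ (ax a) s = ax a
⊢-⊆ (⊥E d) s = ⊥E (⊢-⊆ d s)
⊢-⊆ (∧I d e) s = ∧I (⊢-⊆ d s) (⊢-⊆ e s)
⊢-⊆ (∧E₁ d) s = ∧E₁ (⊢-⊆ d s)
⊢-⊆ (∧E₂ d) s = ∧E₂ (⊢-⊆ d s)
⊢-⊆ (∨I₁ d) s = ∨I₁ (⊢-⊆ d s)
⊢-⊆ (∨I₂ d) s = ∨I₂ (⊢-⊆ d s)
⊢-⊆ (∨E d e f) s = ∨E (⊢-⊆ d s) (⊢-⊆ e (∷⁺ʳ _ s)) (⊢-⊆ f (∷⁺ʳ _ s))
⊢-⊆ (⊃I d) s = ⊃I (⊢-⊆ d (∷⁺ʳ _ s))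
⊢-⊆ (⊃E d e) s = ⊃E (⊢-⊆ d s) (⊢-⊆ e s)
⊢-⊆ (∀I d) s = ∀I (⊢-⊆ d (map⁺ wkFm s))
⊢-⊆ (∀E d t) s = ∀E (⊢-⊆ d s) t
⊢-⊆ (∃I t d) s = ∃I t (⊢-⊆ d s)
⊢-⊆ (∃E d e) s = ∃E (⊢-⊆ d s) (⊢-⊆ e (∷⁺ʳ _ (map⁺ wkFm s)))
⊢-⊆ (ind φ d e) s = ind φ d e

map-ren-sub : ∀ {Γ Δ} (r : Ren Γ Δ) (Hs : List (Fm Γ)) → map (subFm (ren⇒sub r)) Hs ≡ map (renFm r) Hs
map-ren-sub r [] = refl
map-ren-sub r (H ∷ Hs) = cong₂ _∷_ (sym (renFm-sub r H)) (map-ren-sub r Hs)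

⊢-ren : ∀ {Γ Δ Hs A} → Γ ∣ Hs ⊢ A → (r : Ren Γ Δ) → Δ ∣ map (renFm r) Hs ⊢ renFm r A
⊢-ren {Hs = Hs} {A} d r = castF (sym (renFm-sub r A)) (castH (map-ren-sub r Hs) (⊢-sub d (ren⇒sub r)))

⊢-wk : ∀ {Γ Hs A t} → Γ ∣ Hs ⊢ A → (t ∷ Γ) ∣ map wkFm Hs ⊢ wkFm A
⊢-wk d = ⊢-ren d there

cut-∷ : ∀ {Γ Hs Hs' C} → (∀ {B} → B ∈ Hs → Γ ∣ Hs' ⊢ B) → ∀ {B} → B ∈ C ∷ Hs → Γ ∣ C ∷ Hs' ⊢ B
cut-∷ f (here refl) = hyp (here refl)
cut-∷ f (there p) = ⊢-⊆ (f p) there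

cut-wk : ∀ {Γ Hs Hs' t} → (∀ {B} → B ∈ Hs → Γ ∣ Hs' ⊢ B) → ∀ {B} → B ∈ map wkFm Hs → (t ∷ Γ) ∣ map wkFm Hs' ⊢ B
cut-wk f p with ∈-map⁻ wkFm p
... | _ , q , refl = ⊢-wk (f q)

⊢-cut : ∀ {Γ Hs Hs' A} → Γ ∣ Hs ⊢ A → (∀ {B} → B ∈ Hs → Γ ∣ Hs' ⊢ B) → Γ ∣ Hs' ⊢ A
⊢-cut (hyp p) f = f p
⊢-cut (ax a) f = ax a
⊢-cut (⊥E d) f = ⊥E (⊢-cut d f)
⊢-cut (∧I d e) f = ∧I (⊢-cut d f) (⊢-cut e f)
⊢-cut (∧E₁ d) f = ∧E₁ (⊢-cut d f)
⊢-cut (∧E₂ d) f = ∧E₂ (⊢-cut d f)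
⊢-cut (∨I₁ d) f = ∨I₁ (⊢-cut d f)
⊢-cut (∨I₂ d) f = ∨I₂ (⊢-cut d f)
⊢-cut (∨E d e g) f = ∨E (⊢-cut d f) (⊢-cut e (cut-∷ f)) (⊢-cut g (cut-∷ f))
⊢-cut (⊃I d) f = ⊃I (⊢-cut d (cut-∷ f))
⊢-cut (⊃E d e) f = ⊃E (⊢-cut d f) (⊢-cut e f)
⊢-cut (∀I d) f = ∀I (⊢-cut d (cut-wk f))
⊢-cut (∀E d t) f = ∀E (⊢-cut d f) t
⊢-cut (∃I t d) f = ∃I t (⊢-cut d f)
⊢-cut (∃E d e) f = ∃E (⊢-cut d f) (⊢-cut e (cut-∷ (cut-wk f)))
⊢-cut (ind φ d e) f = ind φ d e

∀E-Close : ∀ {Δ Hs} (Γ : Ctx) (A : Fm Γ) → Δ ∣ Hs ⊢ emb (Close Γ A) → (τ : Sub Γ Δ) → Δ ∣ Hs ⊢ subFm τ A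
∀E-Close [] A d τ = castF (trans (renFm-sub (λ ()) A) (subFm-cong (λ ()) A)) d
∀E-Close (s ∷ Γ) A d τ = castF eq (∀E (∀E-Close Γ (All̇ s A) d (λ v → τ (there v))) (τ here))
  where
  eq : sub1 (subFm (liftS (λ v → τ (there v))) A) (τ here) ≡ subFm τ A
  eq = trans (sub1≡ _ _) (subFm-subFm (λ { here → refl ; (there v) → trans (subTm-wkTm {σ = idS} (λ _ → refl) (τ (there v))) (subTm-id _) }) A)

axiomSub : ∀ {Δ Hs} {Γ : Ctx} {A : Fm Γ} → Axiom (Close Γ A) → (τ : Sub Γ Δ) → Δ ∣ Hs ⊢ subFm τ A
axiomSub {Γ = Γ} {A} a τ = ∀E-Close Γ A (ax a) τ

infixr 5 _∷ₜ_
data Tms (Δ : Ctx) : Ctx → Set where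
  []ₜ : Tms Δ []
  _∷ₜ_ : ∀ {s Γ} → Tm Δ s → Tms Δ Γ → Tms Δ (s ∷ Γ)

toSub : ∀ {Δ Γ} → Tms Δ Γ → Sub Γ Δ
toSub (t ∷ₜ ts) here = t
toSub (t ∷ₜ ts) (there v) = toSub ts v

⊢-inst : ∀ {Γ Δ Hs A} → Γ ∣ [] ⊢ A → (ts : Tms Δ Γ) → Δ ∣ Hs ⊢ subFm (toSub ts) A
⊢-inst d ts = ⊢-⊆ (⊢-sub d (toSub ts)) (λ ())

axiom : ∀ {Δ Hs} {Γ : Ctx} {A : Fm Γ} → Axiom (Close Γ A) → (ts : Tms Δ Γ) → Δ ∣ Hs ⊢ subFm (toSub ts) A
axiom a ts = axiomSub a (toSub ts)

h0 : ∀ {Γ A Hs} → Γ ∣ A ∷ Hs ⊢ A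
h0 = hyp (here refl)
h1 : ∀ {Γ A B Hs} → Γ ∣ B ∷ A ∷ Hs ⊢ A
h1 = hyp (there (here refl))
h2 : ∀ {Γ A B C Hs} → Γ ∣ C ∷ B ∷ A ∷ Hs ⊢ A
h2 = hyp (there (there (here refl)))

wk∃ : ∀ {Γ Hs s A B} → Γ ∣ Hs ⊢ B → (s ∷ Γ) ∣ A ∷ map wkFm Hs ⊢ wkFm B
wk∃ d = ⊢-⊆ (⊢-wk d) there

module _ {Δ : Ctx} {Hs : List (Fm Δ)} where
  EqK₀-refl : (a : Tm Δ (ty 0)) → Δ ∣ Hs ⊢ EqK 0 a a
  EqK₀-refl a = axiom eq-refl (a ∷ₜ []ₜ)

  EqK₀-sym : {a b : Tm Δ (ty 0)} → Δ ∣ Hs ⊢ EqK 0 a b → Δ ∣ Hs ⊢ EqK 0 b a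
  EqK₀-sym {a} {b} d = ⊃E (axiom (eq-names 0 0) (a ∷ₜ b ∷ₜ b ∷ₜ a ∷ₜ []ₜ)) (∧I d (∧I (EqK₀-refl b) (EqK₀-refl a)))

  EqK₀-trans : {a b c : Tm Δ (ty 0)} → Δ ∣ Hs ⊢ EqK 0 a b → Δ ∣ Hs ⊢ EqK 0 b c → Δ ∣ Hs ⊢ EqK 0 a c
  EqK₀-trans {a} {b} {c} d e = ⊃E (axiom (eq-names 0 0) (c ∷ₜ b ∷ₜ a ∷ₜ b ∷ₜ []ₜ)) (∧I (EqK₀-refl b) (∧I d e))

  EqO-respˡ : {x x' : Tm Δ (ty 0)} {m : Tm Δ ω} → Δ ∣ Hs ⊢ EqO x m → Δ ∣ Hs ⊢ EqK 0 x x' → Δ ∣ Hs ⊢ EqO x' m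
  EqO-respˡ {x} {x'} {m} d e = ⊃E (axiom eq-num2 (x' ∷ₜ x ∷ₜ m ∷ₜ []ₜ)) (∧I d e)

  EqO-unique : {x y : Tm Δ (ty 0)} {m : Tm Δ ω} → Δ ∣ Hs ⊢ EqO x m → Δ ∣ Hs ⊢ EqO y m → Δ ∣ Hs ⊢ EqK 0 x y
  EqO-unique {x} {y} {m} d e = ⊃E (axiom eq-num1 (y ∷ₜ x ∷ₜ m ∷ₜ []ₜ)) (∧I d e)

EqN : ∀ {Δ} → Tm Δ ω → Tm Δ ω → Fm Δ
EqN a b = Eẋ (ty 0) (EqO v0 (wkTm a) ∧̇ EqO v0 (wkTm b))

EqS : ∀ {Δ} (s : Ty) → Tm Δ s → Tm Δ s → Fm Δ
EqS ω a b = EqN a b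
EqS (ty k) a b = EqT k a b

private
  EqN-refl₀ : (ω ∷ []) ∣ [] ⊢ EqN v0 v0
  EqN-refl₀ = ∃E (axiom name-ω (v0 ∷ₜ []ₜ)) (∃I v0 (∧I h0 h0))

  EqN-sym₀ : (ω ∷ ω ∷ []) ∣ [] ⊢ EqN v1 v0 ⊃̇ EqN v0 v1
  EqN-sym₀ = ⊃I (∃E h0 (∃I v0 (∧I (∧E₂ h0) (∧E₁ h0))))

  EqN-trans₀ : (ω ∷ ω ∷ ω ∷ []) ∣ [] ⊢ EqN v2 v1 ⊃̇ EqN v1 v0 ⊃̇ EqN v2 v0
  EqN-trans₀ = ⊃I (⊃I (∃E h1 (∃E h1 (∃I v1 (∧I (∧E₁ h1) (EqO-respˡ (∧E₂ h0) (EqO-unique (∧E₁ h0) (∧E₂ h1))))))))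

  EqT-refl₀ : ∀ k → (ty (suc k) ∷ []) ∣ [] ⊢ EqT (suc k) v0 v0
  EqT-refl₀ k = ∀I (∧I (⊃I h0) (⊃I h0))

  EqT-sym₀ : ∀ k → (ty (suc k) ∷ ty (suc k) ∷ []) ∣ [] ⊢ EqT (suc k) v1 v0 ⊃̇ EqT (suc k) v0 v1
  EqT-sym₀ k = ⊃I (∀I (∧I (∧E₂ (∀E h0 v0)) (∧E₁ (∀E h0 v0))))

module _ {Δ : Ctx} {Hs : List (Fm Δ)} where
  EqN-refl : (a : Tm Δ ω) → Δ ∣ Hs ⊢ EqN a a
  EqN-refl a = ⊢-inst EqN-refl₀ (a ∷ₜ []ₜ)

  EqN-sym : {a b : Tm Δ ω} → Δ ∣ Hs ⊢ EqN a b → Δ ∣ Hs ⊢ EqN b a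
  EqN-sym {a} {b} d = ⊃E (⊢-inst EqN-sym₀ (b ∷ₜ a ∷ₜ []ₜ)) d

  EqN-trans : {a b c : Tm Δ ω} → Δ ∣ Hs ⊢ EqN a b → Δ ∣ Hs ⊢ EqN b c → Δ ∣ Hs ⊢ EqN a c
  EqN-trans {a} {b} {c} d e = ⊃E (⊃E (⊢-inst EqN-trans₀ (c ∷ₜ b ∷ₜ a ∷ₜ []ₜ)) d) e

  EqT-refl : ∀ k (a : Tm Δ (ty k)) → Δ ∣ Hs ⊢ EqT k a a
  EqT-refl zero a = EqK₀-refl a
  EqT-refl (suc k) a = ⊢-inst (EqT-refl₀ k) (a ∷ₜ []ₜ)

  EqT-sym : ∀ k {a b : Tm Δ (ty k)} → Δ ∣ Hs ⊢ EqT k a b → Δ ∣ Hs ⊢ EqT k b a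
  EqT-sym zero d = EqK₀-sym d
  EqT-sym (suc k) {a} {b} d = ⊃E (⊢-inst (EqT-sym₀ k) (b ∷ₜ a ∷ₜ []ₜ)) d

  EqS-refl : ∀ s (a : Tm Δ s) → Δ ∣ Hs ⊢ EqS s a a
  EqS-refl ω a = EqN-refl a
  EqS-refl (ty k) a = EqT-refl k a

  EqS-sym : ∀ s {a b : Tm Δ s} → Δ ∣ Hs ⊢ EqS s a b → Δ ∣ Hs ⊢ EqS s b a
  EqS-sym ω d = EqN-sym d
  EqS-sym (ty k) d = EqT-sym k d

-- Y' has the name x because it joins Y in the comprehension set {Z | x names Z}.
private
  EqK-respʳ₀ : ∀ j → (ty (suc j) ∷ ty (suc j) ∷ ty 0 ∷ []) ∣ [] ⊢ (EqK (suc j) v2 v1 ∧̇ EqT (suc j) v1 v0) ⊃̇ EqK (suc j) v2 v0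
  EqK-respʳ₀ j = ⊃I (∃E (axiom (comp (suc j) (ty 0 ∷ []) (EqK (suc j) v1 v0) (z≤n ∷ []) ≤-refl) (v2 ∷ₜ []ₜ))
            (⊃E (∧E₁ (∀E (∧E₂ h0) v1))
              (⊃E (axiom (eq-mem (suc j)) (v0 ∷ₜ v1 ∷ₜ v0 ∷ₜ v2 ∷ₜ []ₜ))
                 (∧I (⊃E (∧E₂ (∀E (∧E₂ h0) v2)) (∧E₁ h1)) (∧I (∧E₂ h1) (EqT-refl (suc (suc j)) v0))))))

EqT-sub : ∀ {Γ Δ} k (σ : Sub Γ Δ) (a b : Tm Γ (ty k)) → subFm σ (EqT k a b) ≡ EqT k (subTm σ a) (subTm σ b)
EqT-sub zero σ a b = refl
EqT-sub (suc k) σ a b = cong₂ (λ p q → All̇ (ty k) ((Mem k v0 p ⊃̇ Mem k v0 q) ∧̇ (Mem k v0 q ⊃̇ Mem k v0 p))) (subTm-wk σ a) (subTm-wk σ b)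

module _ {Δ : Ctx} {Hs : List (Fm Δ)} where
  EqK-respʳ : ∀ k {x : Tm Δ (ty 0)} {Y Y' : Tm Δ (ty k)} → Δ ∣ Hs ⊢ EqK k x Y → Δ ∣ Hs ⊢ EqT k Y Y' → Δ ∣ Hs ⊢ EqK k x Y'
  EqK-respʳ zero d e = EqK₀-trans d e
  EqK-respʳ (suc j) {x} {Y} {Y'} d e = ⊃E (⊢-inst (EqK-respʳ₀ j) (Y' ∷ₜ Y ∷ₜ x ∷ₜ []ₜ)) (∧I d e)

  EqK-respˡ : ∀ k {x x' : Tm Δ (ty 0)} {Y : Tm Δ (ty k)} → Δ ∣ Hs ⊢ EqK k x Y → Δ ∣ Hs ⊢ EqK 0 x x' → Δ ∣ Hs ⊢ EqK k x' Y
  EqK-respˡ k {x} {x'} {Y} d e = ⊃E (axiom (eq-names 0 k) (Y ∷ₜ x ∷ₜ x' ∷ₜ x ∷ₜ []ₜ)) (∧I (EqK₀-refl x) (∧I (EqK₀-sym e) d))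

  Mem-resp : ∀ k {X X' : Tm Δ (ty k)} {Y Y' : Tm Δ (ty (suc k))} → Δ ∣ Hs ⊢ Mem k X Y → Δ ∣ Hs ⊢ EqT k X X' → Δ ∣ Hs ⊢ EqT (suc k) Y Y' → Δ ∣ Hs ⊢ Mem k X' Y'
  Mem-resp k {X} {X'} {Y} {Y'} d e f =
    ⊃E (axiom (eq-mem k) (Y' ∷ₜ X' ∷ₜ Y ∷ₜ X ∷ₜ []ₜ))
       (∧I d (∧I (castF (sym (EqT-sub k (toSub (Y' ∷ₜ X' ∷ₜ Y ∷ₜ X ∷ₜ []ₜ)) v3 v1)) e) f))

  Ap-resp : ∀ {f x y g u v : Tm Δ (ty 0)} → Δ ∣ Hs ⊢ Ap f x y → Δ ∣ Hs ⊢ EqK 0 f g → Δ ∣ Hs ⊢ EqK 0 x u → Δ ∣ Hs ⊢ EqK 0 y v → Δ ∣ Hs ⊢ Ap g u v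
  Ap-resp {f} {x} {y} {g} {u} {v} d e1 e2 e3 = ⊃E (axiom eq-ap (v ∷ₜ u ∷ₜ g ∷ₜ y ∷ₜ x ∷ₜ f ∷ₜ []ₜ)) (∧I d (∧I e1 (∧I e2 e3)))

  EqO-resp : ∀ {x x' : Tm Δ (ty 0)} {m m' : Tm Δ ω} → Δ ∣ Hs ⊢ EqO x m → Δ ∣ Hs ⊢ EqK 0 x x' → Δ ∣ Hs ⊢ EqN m m' → Δ ∣ Hs ⊢ EqO x' m'
  EqO-resp d e f = ∃E f (EqO-respˡ (∧E₂ h0) (EqO-unique (∧E₁ h0) (wk∃ (EqO-respˡ d e))))

renFm-simR : ∀ {Γ Δ Θ} (r : Ren Δ Θ) (ρ : Ren Γ Δ) (t : ET Γ) (x : Tm Δ (ty 0)) →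
  renFm r (simR ρ t x) ≡ simR (λ v → r (ρ v)) t (renTm r x)
renFm-simR r ρ (tm {ω} a) x = cong (EqO (renTm r x)) (renTm-comp r ρ a)
renFm-simR r ρ (tm {ty k} a) x = cong (EqK k (renTm r x)) (renTm-comp r ρ a)
renFm-simR r ρ (t₁ · t₂) x = cong (λ A → Eẋ (ty 0) (Eẋ (ty 0) A)) (cong₂ _∧̇_ (renFm-simR r' _ t₁ v1)
  (cong₂ _∧̇_ (renFm-simR r' _ t₂ v0) (cong (Ap v1 v0) (trans (renTm-comp r' _ x) (sym (renTm-comp _ r x))))))
  where
  r' = liftR (liftR r)

ren²-simR : ∀ {Γ Δ Θ Θ' Hs} (r : Ren Θ Θ') (r' : Ren Δ Θ) {ρ : Ren Γ Δ} {u : ET Γ} {z : Tm Δ (ty 0)} →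
  Θ' ∣ Hs ⊢ renFm r (renFm r' (simR ρ u z)) → Θ' ∣ Hs ⊢ simR (λ v → r (r' (ρ v))) u (renTm r (renTm r' z))
ren²-simR r r' {ρ} {u} {z} = castF (trans (cong (renFm r) (renFm-simR r' ρ u z)) (renFm-simR r _ u _))

≃₀-functional : ∀ {Γ Δ Hs} (ρ : Ren Γ Δ) (t : ET Γ) {x y : Tm Δ (ty 0)} →
  Δ ∣ Hs ⊢ simR ρ t x → Δ ∣ Hs ⊢ simR ρ t y → Δ ∣ Hs ⊢ EqK 0 x y
≃₀-functional ρ (tm {ω} a) dx dy = EqO-unique dx dy
≃₀-functional ρ (tm {ty k} a) {x} {y} dx dy =
  EqK₀-sym (⊃E (axiom (eq-names k 0) (x ∷ₜ renTm ρ a ∷ₜ y ∷ₜ x ∷ₜ []ₜ)) (∧I dx (∧I dy (EqK₀-refl x))))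
≃₀-functional ρ (t₁ · t₂) {x} {y} dx dy =
  ∃E dx (∃E h0 (∃E (wk∃ (wk∃ dy)) (∃E h0
    (castF (cong₂ (EqK 0) (wk⁴ x) (wk⁴' y))
      (⊃E (axiom ap-fun (_ ∷ₜ _ ∷ₜ v0 ∷ₜ v1 ∷ₜ []ₜ)) (∧I (Ap-resp (∧E₂ (∧E₂ h2)) e₁ e₂ (EqK₀-refl _)) (∧E₂ (∧E₂ h0))))))))
  where
  e₁ = ≃₀-functional _ t₁ (ren²-simR there there (∧E₁ h2)) (ren²-simR (liftR (liftR there)) (liftR (liftR there)) (∧E₁ h0))
  e₂ = ≃₀-functional _ t₂ (ren²-simR there there (∧E₁ (∧E₂ h2))) (ren²-simR (liftR (liftR there)) (liftR (liftR there)) (∧E₁ (∧E₂ h0)))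
  wk⁴ : ∀ {Θ} (z : Tm Θ (ty 0)) →
    renTm {Δ = ty 0 ∷ ty 0 ∷ ty 0 ∷ ty 0 ∷ Θ} there (renTm there (renTm (λ v → there (there v)) z)) ≡ wkTm (wkTm (wkTm (wkTm z)))
  wk⁴ (var v) = refl
  wk⁴ (cst c) = refl
  wk⁴' : ∀ {Θ} (z : Tm Θ (ty 0)) →
    renTm {Δ = ty 0 ∷ ty 0 ∷ ty 0 ∷ ty 0 ∷ Θ} (liftR (liftR there)) (renTm (liftR (liftR there)) (renTm (λ v → there (there v)) z))
    ≡ wkTm (wkTm (wkTm (wkTm z)))
  wk⁴' (var v) = refl
  wk⁴' (cst c) = refl

wkTm-lift : ∀ {Δ s t t'} (a : Tm Δ s) → renTm (liftR {t = t'} (there {t = t})) (wkTm a) ≡ wkTm (wkTm a)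
wkTm-lift (var v) = refl
wkTm-lift zer = refl
wkTm-lift (cst c) = refl

EqS-wk : ∀ {Δ t} s (a b : Tm Δ s) → wkFm {t = t} (EqS s a b) ≡ EqS s (wkTm a) (wkTm b)
EqS-wk ω a b = cong₂ (λ p q → Eẋ (ty 0) (EqO v0 p ∧̇ EqO v0 q)) (wkTm-lift a) (wkTm-lift b)
EqS-wk (ty zero) a b = refl
EqS-wk (ty (suc k)) a b = cong₂ (λ p q → All̇ (ty k) ((Mem k v0 p ⊃̇ Mem k v0 q) ∧̇ (Mem k v0 q ⊃̇ Mem k v0 p))) (wkTm-lift a) (wkTm-lift b)

inst-here : ∀ {Δ s} (B : Fm (s ∷ Δ)) → sub1 (renFm (liftR there) B) (var here) ≡ B
inst-here B = trans (sub1≡ _ _) (trans (cong (subFm _) (renFm-sub _ B)) (trans (subFm-subFm {σ' = idS} (λ { here → refl ; (there v) → refl }) B) (subFm-id B)))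

EqSubs : ∀ {Γ Δ} → List (Fm Δ) → Sub Γ Δ → Sub Γ Δ → Set
EqSubs {Γ} {Δ} Hs σ σ' = ∀ {s} (v : Var Γ s) → Δ ∣ Hs ⊢ EqS s (σ v) (σ' v)

EqSubs-sym : ∀ {Γ Δ Hs} {σ σ' : Sub Γ Δ} → EqSubs Hs σ σ' → EqSubs Hs σ' σ
EqSubs-sym e {s} v = EqS-sym s (e v)

EqSubs-∷ : ∀ {Γ Δ Hs A} {σ σ' : Sub Γ Δ} → EqSubs Hs σ σ' → EqSubs (A ∷ Hs) σ σ'
EqSubs-∷ e v = ⊢-⊆ (e v) there

EqSubs-lift : ∀ {Γ Δ Hs t} {σ σ' : Sub Γ Δ} → EqSubs Hs σ σ' → EqSubs (map wkFm Hs) (liftS {t = t} σ) (liftS σ')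
EqSubs-lift {t = t} e here = EqS-refl t v0
EqSubs-lift e {s} (there v) = castF (EqS-wk s _ _) (⊢-wk (e v))

EqSubs-tm : ∀ {Γ Δ Hs s} {σ σ' : Sub Γ Δ} → EqSubs Hs σ σ' → (a : Tm Γ s) → Δ ∣ Hs ⊢ EqS s (subTm σ a) (subTm σ' a)
EqSubs-tm e (var v) = e v
EqSubs-tm e zer = EqS-refl ω zer
EqSubs-tm e (cst c) = EqS-refl (ty 0) (cst c)

leibniz : ∀ {Γ Δ Hs} (A : Fm Γ) {σ σ' : Sub Γ Δ} → EqSubs Hs σ σ' → Δ ∣ Hs ⊢ subFm σ A → Δ ∣ Hs ⊢ subFm σ' A
leibniz (Ap f x y) e d = Ap-resp d (EqSubs-tm e f) (EqSubs-tm e x) (EqSubs-tm e y)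
leibniz (EqO x m) e d = EqO-resp d (EqSubs-tm e x) (EqSubs-tm e m)
leibniz (EqK k x Y) e d = EqK-respʳ k (EqK-respˡ k d (EqSubs-tm e x)) (EqSubs-tm e Y)
leibniz (Mem k X Y) e d = Mem-resp k d (EqSubs-tm e X) (EqSubs-tm e Y)
leibniz ⊥̇ e d = d
leibniz (A ∧̇ B) e d = ∧I (leibniz A e (∧E₁ d)) (leibniz B e (∧E₂ d))
leibniz (A ∨̇ B) e d = ∨E d (∨I₁ (leibniz A (EqSubs-∷ e) h0)) (∨I₂ (leibniz B (EqSubs-∷ e) h0))
leibniz (A ⊃̇ B) e d = ⊃I (leibniz B (EqSubs-∷ e) (⊃E (⊢-⊆ d there) (leibniz A (EqSubs-sym (EqSubs-∷ e)) h0)))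
leibniz (All̇ s A) e d = ∀I (leibniz A (EqSubs-lift e) (castF (inst-here _) (∀E (⊢-wk d) (var here))))
leibniz (Eẋ s A) e d = ∃E d (∃I (var here) (castF (sym (inst-here _)) (leibniz A (EqSubs-∷ (EqSubs-lift e)) h0)))

Succ₀ : Fm (ω ∷ ω ∷ [])
Succ₀ = (P · tm v1 · tm zer) ≃̇ tm v0

Succ : ∀ {Δ} → Tm Δ ω → Tm Δ ω → Fm Δ
Succ a b = subFm (toSub (b ∷ₜ a ∷ₜ []ₜ)) Succ₀

Succ-sub : ∀ {Γ Δ} (σ : Sub Γ Δ) (a b : Tm Γ ω) → subFm σ (Succ a b) ≡ Succ (subTm σ a) (subTm σ b)
Succ-sub σ a b = trans (subFm-subFm {σ = σ} {τ = toSub (b ∷ₜ a ∷ₜ []ₜ)} {σ' = toSub (subTm σ b ∷ₜ subTm σ a ∷ₜ []ₜ)} (λ { here → refl ; (there here) → refl }) Succ₀)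
                       refl

Succ-functional₀ : (ω ∷ ω ∷ ω ∷ []) ∣ [] ⊢ Succ v2 v1 ⊃̇ Succ v2 v0 ⊃̇ EqN v1 v0
Succ-functional₀ = ⊃I (⊃I (∃E h1 (∃E h1 (∃I v1 (∧I (∧E₂ h1)
  (EqO-respˡ (∧E₂ h0) (EqK₀-sym (≃₀-functional (λ v → v) (P · tm v4 · tm zer) (∧E₁ h1) (∧E₁ h0)))))))))

Succ-functional : ∀ {Δ Hs} {c a b : Tm Δ ω} → Δ ∣ Hs ⊢ Succ c a → Δ ∣ Hs ⊢ Succ c b → Δ ∣ Hs ⊢ EqN a b
Succ-functional {c = c} {a} {b} d e = ⊃E (⊃E (castF eq (⊢-inst Succ-functional₀ (b ∷ₜ a ∷ₜ c ∷ₜ []ₜ))) d) e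
  where
  σ = toSub (b ∷ₜ a ∷ₜ c ∷ₜ []ₜ)
  eq = cong₂ _⊃̇_ (Succ-sub σ v2 v1) (cong₂ _⊃̇_ (Succ-sub σ v2 v0) refl)

Num₀ : ℕ → Fm (ω ∷ [])
Num₀ zero = EqN v0 zer
Num₀ (suc n) = Eẋ ω (subFm (toSub (v0 ∷ₜ []ₜ)) (Num₀ n) ∧̇ Succ v0 v1)

Num : ∀ {Δ} → ℕ → Tm Δ ω → Fm Δ
Num n t = subFm (toSub (t ∷ₜ []ₜ)) (Num₀ n)

Num-sub : ∀ {Γ Δ} (σ : Sub Γ Δ) n (t : Tm Γ ω) → subFm σ (Num n t) ≡ Num n (subTm σ t)
Num-sub σ n t = subFm-subFm {σ = σ} {τ = toSub (t ∷ₜ []ₜ)} {σ' = toSub (subTm σ t ∷ₜ []ₜ)} (λ { here → refl }) (Num₀ n)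

Num-wk : ∀ {Γ t'} n (t : Tm Γ ω) → wkFm {t = t'} (Num n t) ≡ Num n (wkTm t)
Num-wk n t = trans (renFm-sub there _) (trans (Num-sub (ren⇒sub there) n t) (cong (Num n) (sym (renTm-sub there t))))

NumS : ∀ {Δ} n (t : Tm Δ ω) → Num (suc n) t ≡ Eẋ ω (Num n v0 ∧̇ Succ v0 (wkTm t))
NumS n t = cong (Eẋ ω) (cong₂ _∧̇_ (subFm-subFm {σ = liftS (toSub (t ∷ₜ []ₜ))} {τ = toSub (v0 ∷ₜ []ₜ)} {σ' = toSub (v0 ∷ₜ []ₜ)} (λ { here → refl }) (Num₀ n))
   (trans (Succ-sub (liftS (toSub (t ∷ₜ []ₜ))) v0 v1) (cong (Succ v0) (subTm-wk (toSub (t ∷ₜ []ₜ)) v0))))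

Num-zero : ∀ {Δ Hs} → Δ ∣ Hs ⊢ Num 0 zer
Num-zero = EqN-refl zer

Num-suc : ∀ {Δ Hs} n {a b : Tm Δ ω} → Δ ∣ Hs ⊢ Num n a → Δ ∣ Hs ⊢ Succ a b → Δ ∣ Hs ⊢ Num (suc n) b
Num-suc n {a} {b} d e = castF (sym (NumS n b)) (∃I a (castF (sym eq) (∧I d e)))
  where
  eq : sub1 (Num n v0 ∧̇ Succ v0 (wkTm b)) a ≡ Num n a ∧̇ Succ a b
  eq = trans (sub1≡ (Num n v0 ∧̇ Succ v0 (wkTm b)) a)
             (cong₂ _∧̇_ (Num-sub (singleSub a) n v0)
                        (trans (Succ-sub (singleSub a) v0 (wkTm b))
                               (cong (Succ a) (trans (subTm-wkTm {σ' = singleSub a} {σ = idS} (λ _ → refl) b) (subTm-id b)))))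

Succ-wk : ∀ {Γ t'} (a b : Tm Γ ω) → wkFm {t = t'} (Succ a b) ≡ Succ (wkTm a) (wkTm b)
Succ-wk a b = trans (renFm-sub there _) (trans (Succ-sub (ren⇒sub there) a b) (cong₂ Succ (sym (renTm-sub there a)) (sym (renTm-sub there b))))

Num-functional : ∀ {Δ Hs} n {a b : Tm Δ ω} → Δ ∣ Hs ⊢ Num n a → Δ ∣ Hs ⊢ Num n b → Δ ∣ Hs ⊢ EqN a b
Num-functional zero d e = EqN-trans d (EqN-sym e)
Num-functional {Δ} (suc n) {a} {b} d e =
  ∃E (castF (NumS n a) d)
   (∃E (castF (trans (Num-wk (suc n) b) (NumS n (wkTm b))) (wk∃ e))
     (castF (trans (sym (EqS-wk ω _ _)) (cong wkFm (sym (EqS-wk ω a b))))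
       (Succ-functional (leibniz Succ₀ {σ = toSub (_ ∷ₜ v1 ∷ₜ []ₜ)} {σ' = toSub (_ ∷ₜ v0 ∷ₜ []ₜ)} rr
          (castF (trans (Succ-wk v0 _) refl) (∧E₂ h1))) (∧E₂ h0))))
  where
  ih : _ ∣ _ ⊢ EqN v1 v0
  ih = Num-functional n (castF (Num-wk n v0) (∧E₁ h1)) (∧E₁ h0)
  rr : EqSubs _ (toSub (wkTm (wkTm a) ∷ₜ v1 ∷ₜ []ₜ)) (toSub (wkTm (wkTm a) ∷ₜ v0 ∷ₜ []ₜ))
  rr here = EqS-refl ω _
  rr (there here) = ih

record World : Set where
  constructor ⟨_,_⟩
  field
    ctx : Ctx
    hyps : List (Fm ctx)
open World public

_⊢ʷ_ : (w : World) → Fm (ctx w) → Set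
w ⊢ʷ A = ctx w ∣ hyps w ⊢ A

record Ext (w w' : World) : Set where
  constructor mkExt
  field
    ren : Ren (ctx w) (ctx w')
    hyp-transport : ∀ {A} → A ∈ hyps w → w' ⊢ʷ renFm ren A
open Ext public

transport : ∀ {w w' A} → w ⊢ʷ A → (e : Ext w w') → w' ⊢ʷ renFm (ren e) A
transport {w} d e = ⊢-cut (⊢-ren d (ren e)) f
  where
  f : ∀ {B} → B ∈ map (renFm (ren e)) (hyps w) → _ ⊢ʷ B
  f p with ∈-map⁻ (renFm (ren e)) p
  ... | x , q , refl = hyp-transport e q

Ext-refl : ∀ {w} → Ext w w
Ext-refl {w} = mkExt (λ v → v) (λ {A} p → castF (sym (trans (renFm-sub (λ v → v) A) (subFm-id A))) (hyp p))

_⨾_ : ∀ {w1 w2 w3} → Ext w1 w2 → Ext w2 w3 → Ext w1 w3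
e1 ⨾ e2 = mkExt (λ v → ren e2 (ren e1 v)) (λ {A} p → castF (renFm-comp (ren e2) (ren e1) A) (transport (hyp-transport e1 p) e2))

data Chain (w : World) : World → Set where
  nil : Chain w w
  step : ∀ {s A w'} → w ⊢ʷ Eẋ s A → Chain ⟨ s ∷ ctx w , A ∷ map wkFm (hyps w) ⟩ w' → Chain w w'

stepExt : ∀ {w s A} → Ext w ⟨ s ∷ ctx w , A ∷ map wkFm (hyps w) ⟩
stepExt {w} = mkExt there (λ {A} p → hyp (there (∈-map⁺ wkFm p)))

chExt : ∀ {w w'} → Chain w w' → Ext w w'
chExt nil = Ext-refl
chExt (step d ch) = stepExt ⨾ chExt ch

collapse : ∀ {w w'} (ch : Chain w w') {C : Fm (ctx w)} → w' ⊢ʷ renFm (ren (chExt ch)) C → w ⊢ʷ C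
collapse nil {C} d = castF (trans (renFm-sub (λ v → v) C) (subFm-id C)) d
collapse (step e ch) {C} d = ∃E e (collapse ch (castF (sym (renFm-comp _ there C)) d))

Cover : (w : World) → ((w' : World) → Ext w w' → Set) → Set
Cover w Q = Σ World λ w' → Σ (Chain w w') λ ch → Q w' (chExt ch)

-- A set value remembers the comprehension instance that introduced it:
-- its defining formula φ together with the values of its parameters.
mutual
  data Val : Ty → Ctx → Set where
    vω : ∀ {G} → Tm G ω → Val ω G
    vO : ∀ {G} → Tm G (ty 0) → Val (ty 0) G
    vS : ∀ {G k} → Tm G (ty (suc k)) → (Δ : Ctx) → (φ : Fm (ty k ∷ Δ)) → Elem (suc k) φ → Env G Δ → Val (ty (suc k)) G

  data Env (G : Ctx) : Ctx → Set where
    [] : Env G []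
    _∷_ : ∀ {s Δ} → Val s G → Env G Δ → Env G (s ∷ Δ)

mutual
  renV : ∀ {G G' s} → Ren G G' → Val s G → Val s G'
  renV r (vω t) = vω (renTm r t)
  renV r (vO t) = vO (renTm r t)
  renV r (vS t Δ φ el e) = vS (renTm r t) Δ φ el (renE r e)

  renE : ∀ {G G' Δ} → Ren G G' → Env G Δ → Env G' Δ
  renE r [] = []
  renE r (v ∷ e) = renV r v ∷ renE r e

termV : ∀ {G s} → Val s G → Tm G s
termV (vω t) = t
termV (vO t) = t
termV (vS t _ _ _ _) = t

lookE : ∀ {G Δ s} → Env G Δ → Var Δ s → Val s G
lookE (v ∷ e) here = v
lookE (v ∷ e) (there x) = lookE e x

-- Numbers must be provably numerals; this is what validates the induction rule.
Standard : ∀ {s} (w : World) → Val s (ctx w) → Set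
Standard w (vω t) = Σ ℕ λ n → w ⊢ʷ Num n t
Standard w (vO t) = ⊤
Standard w (vS _ _ _ _ _) = ⊤

MemPred : ℕ → Ctx → Set₁
MemPred j G = (w : World) → Ren G (ctx w) → Val (ty j) (ctx w) → Set

MemInterp : ℕ → Set₁
MemInterp j = ∀ {G} → Val (ty (suc j)) G → MemPred j G

record SEnv (Γ G : Ctx) : Set₁ where
  field
    look : ∀ {s} → Var Γ s → Val s G
    mem  : ∀ {j} → Var Γ (ty (suc j)) → MemPred j G
open SEnv public

MemPredFor : Ty → Ctx → Set₁
MemPredFor ω G = ⊤₁
MemPredFor (ty zero) G = ⊤₁
MemPredFor (ty (suc j)) G = MemPred j G

renMemPred : ∀ {j G G'} → Ren G G' → MemPred j G → MemPred j G'
renMemPred r h w r' x = h w (λ v → r' (r v)) x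

renSE : ∀ {Γ G G'} → Ren G G' → SEnv Γ G → SEnv Γ G'
look (renSE r η) v = renV r (look η v)
mem (renSE r η) v = renMemPred r (mem η v)

extSE : ∀ {Γ G s} → SEnv Γ G → Val s G → MemPredFor s G → SEnv (s ∷ Γ) G
look (extSE η v h) here = v
look (extSE η v h) (there x) = look η x
mem (extSE η v h) here = h
mem (extSE η v h) (there x) = mem η x

memPredOf : (∀ j → MemInterp j) → ∀ {s G} → Val s G → MemPredFor s G
memPredOf bnd {ω} v = tt₁
memPredOf bnd {ty zero} v = tt₁
memPredOf bnd {ty (suc j)} v = bnd j v

subOf : ∀ {Γ G} → SEnv Γ G → Sub Γ G
subOf η v = termV (look η v)

valOf : ∀ {Γ G s} → SEnv Γ G → Tm Γ s → Val s G
valOf η (var v) = look η v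
valOf η zer = vω zer
valOf η (cst c) = vO (cst c)

memOf : ∀ {Γ G j} → SEnv Γ G → Tm Γ (ty (suc j)) → MemPred j G
memOf η (var v) = mem η v

Sat : (bnd : ∀ j → MemInterp j) → ∀ {Γ} → Fm Γ → (w : World) → SEnv Γ (ctx w) → Set
Sat bnd (Ap _ _ _) w η = ⊤
Sat bnd (EqO _ _) w η = ⊤
Sat bnd (EqK _ _ _) w η = ⊤
Sat bnd (Mem j a b) w η = (w ⊢ʷ subFm (subOf η) (Mem j a b)) × memOf η b w (λ v → v) (valOf η a)
Sat bnd ⊥̇ w η = w ⊢ʷ ⊥̇
Sat bnd (A ∧̇ B) w η = Sat bnd A w η × Sat bnd B w η
Sat bnd (A ∨̇ B) w η = Cover w λ w' e →
  ((w' ⊢ʷ subFm (subOf (renSE (ren e) η)) A) × Sat bnd A w' (renSE (ren e) η)) ⊎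
  ((w' ⊢ʷ subFm (subOf (renSE (ren e) η)) B) × Sat bnd B w' (renSE (ren e) η))
Sat bnd (A ⊃̇ B) w η = ∀ w' (e : Ext w w') → w' ⊢ʷ subFm (subOf (renSE (ren e) η)) A →
  Sat bnd A w' (renSE (ren e) η) → Sat bnd B w' (renSE (ren e) η)
Sat bnd (All̇ s A) w η = ∀ w' (e : Ext w w') (v : Val s (ctx w')) → Standard w' v →
  Sat bnd A w' (extSE (renSE (ren e) η) v (memPredOf bnd v))
Sat bnd (Eẋ s A) w η = Cover w λ w' e → Σ (Val s (ctx w')) λ v → Standard w' v ×
  (w' ⊢ʷ subFm (subOf (extSE (renSE (ren e) η) v (memPredOf bnd v))) A) ×
  Sat bnd A w' (extSE (renSE (ren e) η) v (memPredOf bnd v))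

memTrivial : ∀ {j} → MemInterp j
memTrivial _ _ _ _ = ⊤

-- Membership at level k, given the lower levels L: a value belongs to a set
-- when the set's defining formula is forced.  Being (k+1)-elementary, that
-- formula meets level k only in its parameters, which are structurally smaller
-- values, and never meets the levels above k, which memTrivial fills.
module Stratum (k : ℕ) (L : ∀ j → j < k → MemInterp j) where
  interpBelowDec : ∀ j → Dec (j < k) → MemInterp j
  interpBelowDec j (yes p) = L j p
  interpBelowDec j (no _) = memTrivial

  interpBelow : ∀ j → MemInterp j
  interpBelow j = interpBelowDec j (j <? k)

  mutual
    memAt : MemInterp k
    memAt (vS t Δ φ el e) w r x = Sat interpBelow φ w (extSE (renSE r (envSE e)) x (memPredOf interpBelow x))

    envSE : ∀ {G Δ} → Env G Δ → SEnv Δ G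
    look (envSE e) v = lookE e v
    mem (envSE e) v = envMem e v

    envMem : ∀ {G Δ j} → Env G Δ → Var Δ (ty (suc j)) → MemPred j G
    envMem {j = j} (B ∷ e) here = memDispatch (j ≟ k) B
    envMem (B ∷ e) (there v) = envMem e v

    memDispatch : ∀ {G j} → Dec (j ≡ k) → Val (ty (suc j)) G → MemPred j G
    memDispatch (yes refl) B = memAt B
    memDispatch {j = j} (no _) B = interpBelow j B

mutual
  memUpTo : (k j : ℕ) → j ≤′ k → MemInterp j
  memUpTo k .k ≤′-refl = Stratum.memAt k (memBelow k)
  memUpTo (suc k) j (≤′-step p) = memUpTo k j p

  memBelow : (k : ℕ) → ∀ j → j < k → MemInterp j
  memBelow zero j ()
  memBelow (suc k) j p = memUpTo k j (≤⇒≤′ (s≤s⁻¹ p))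

memSem : ∀ j → MemInterp j
memSem j = memUpTo j j ≤′-refl

mutual
  renV-cong : ∀ {G G' s} {r r' : Ren G G'} → r ≗ᴿ r' → (x : Val s G) → renV r x ≡ renV r' x
  renV-cong e (vω t) = cong vω (renTm-cong e t)
  renV-cong e (vO t) = cong vO (renTm-cong e t)
  renV-cong e (vS t Δ φ el en) = cong₂ (λ a b → vS a Δ φ el b) (renTm-cong e t) (renE-cong e en)

  renE-cong : ∀ {G G' Δ} {r r' : Ren G G'} → r ≗ᴿ r' → (en : Env G Δ) → renE r en ≡ renE r' en
  renE-cong e [] = refl
  renE-cong e (x ∷ en) = cong₂ _∷_ (renV-cong e x) (renE-cong e en)

mutual
  renV-comp : ∀ {G G' G'' s} (r2 : Ren G' G'') (r1 : Ren G G') (x : Val s G) → renV r2 (renV r1 x) ≡ renV (λ v → r2 (r1 v)) x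
  renV-comp r2 r1 (vω t) = cong vω (renTm-comp r2 r1 t)
  renV-comp r2 r1 (vO t) = cong vO (renTm-comp r2 r1 t)
  renV-comp r2 r1 (vS t Δ φ el en) = cong₂ (λ a b → vS a Δ φ el b) (renTm-comp r2 r1 t) (renE-comp r2 r1 en)

  renE-comp : ∀ {G G' G'' Δ} (r2 : Ren G' G'') (r1 : Ren G G') (en : Env G Δ) → renE r2 (renE r1 en) ≡ renE (λ v → r2 (r1 v)) en
  renE-comp r2 r1 [] = refl
  renE-comp r2 r1 (x ∷ en) = cong₂ _∷_ (renV-comp r2 r1 x) (renE-comp r2 r1 en)

mutual
  renV-id : ∀ {G s} (x : Val s G) → renV (λ v → v) x ≡ x
  renV-id (vω t) = cong vω (renTm-id t)
  renV-id (vO t) = cong vO (renTm-id t)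
  renV-id (vS t Δ φ el en) = cong₂ (λ a b → vS a Δ φ el b) (renTm-id t) (renE-id en)

  renE-id : ∀ {G Δ} (en : Env G Δ) → renE (λ v → v) en ≡ en
  renE-id [] = refl
  renE-id (x ∷ en) = cong₂ _∷_ (renV-id x) (renE-id en)

termV-ren : ∀ {G G' s} (r : Ren G G') (x : Val s G) → termV (renV r x) ≡ renTm r (termV x)
termV-ren r (vω t) = refl
termV-ren r (vO t) = refl
termV-ren r (vS t _ _ _ _) = refl

lookE-ren : ∀ {G G' Δ s} (r : Ren G G') (en : Env G Δ) (v : Var Δ s) → lookE (renE r en) v ≡ renV r (lookE en v)
lookE-ren r (x ∷ en) here = refl
lookE-ren r (x ∷ en) (there v) = lookE-ren r en v

valOf-ren : ∀ {Γ G G' s} (r : Ren G G') (η : SEnv Γ G) (a : Tm Γ s) → valOf (renSE r η) a ≡ renV r (valOf η a)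
valOf-ren r η (var v) = refl
valOf-ren r η zer = refl
valOf-ren r η (cst c) = refl

subOf-ren : ∀ {Γ G G'} (r : Ren G G') (η : SEnv Γ G) (A : Fm Γ) → renFm r (subFm (subOf η) A) ≡ subFm (subOf (renSE r η)) A
subOf-ren r η A = trans (renFm-sub r _) (subFm-subFm (λ v → trans (sym (renTm-sub r (termV (look η v)))) (sym (termV-ren r (look η v)))) A)

record EqSE {Γ G} (η η' : SEnv Γ G) : Set₁ where
  field
    elook : ∀ {s} (v : Var Γ s) → look η v ≡ look η' v
    emem  : ∀ {j} (v : Var Γ (ty (suc j))) (w : World) (r : Ren G (ctx w)) (x : Val (ty j) (ctx w)) → mem η v w r x → mem η' v w r x
    emem' : ∀ {j} (v : Var Γ (ty (suc j))) (w : World) (r : Ren G (ctx w)) (x : Val (ty j) (ctx w)) → mem η' v w r x → mem η v w r x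
open EqSE public

EqSE-sym : ∀ {Γ G} {η η' : SEnv Γ G} → EqSE η η' → EqSE η' η
elook (EqSE-sym q) v = sym (elook q v)
emem (EqSE-sym q) = emem' q
emem' (EqSE-sym q) = emem q

EqSE-refl : ∀ {Γ G} {η : SEnv Γ G} → EqSE η η
elook EqSE-refl v = refl
emem EqSE-refl v w r x p = p
emem' EqSE-refl v w r x p = p

EqSE-trans : ∀ {Γ G} {η η' η'' : SEnv Γ G} → EqSE η η' → EqSE η' η'' → EqSE η η''
elook (EqSE-trans p q) v = trans (elook p v) (elook q v)
emem (EqSE-trans p q) v w r x z = emem q v w r x (emem p v w r x z)
emem' (EqSE-trans p q) v w r x z = emem' p v w r x (emem' q v w r x z)

EqSE-ren : ∀ {Γ G G'} {η η' : SEnv Γ G} (r : Ren G G') → EqSE η η' → EqSE (renSE r η) (renSE r η')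
elook (EqSE-ren r q) v = cong (renV r) (elook q v)
emem (EqSE-ren r q) v w r' x = emem q v w _ x
emem' (EqSE-ren r q) v w r' x = emem' q v w _ x

EqSE-ren-cong : ∀ {Γ G G'} (η : SEnv Γ G) {r r' : Ren G G'} → r ≗ᴿ r' →
  (∀ {j} (v : Var Γ (ty (suc j))) w {r1 r2 : Ren G (ctx w)} x → r1 ≗ᴿ r2 → mem η v w r1 x → mem η v w r2 x) →
  EqSE (renSE r η) (renSE r' η)
elook (EqSE-ren-cong η e hc) v = renV-cong e (look η v)
emem (EqSE-ren-cong η e hc) v w r'' x = hc v w x (λ u → cong r'' (e u))
emem' (EqSE-ren-cong η e hc) v w r'' x = hc v w x (λ u → sym (cong r'' (e u)))

EqSE-ren-comp : ∀ {Γ G G' G''} (η : SEnv Γ G) (r1 : Ren G G') (r2 : Ren G' G'') →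
  EqSE (renSE r2 (renSE r1 η)) (renSE (λ v → r2 (r1 v)) η)
elook (EqSE-ren-comp η r1 r2) v = renV-comp r2 r1 (look η v)
emem (EqSE-ren-comp η r1 r2) v w r x p = p
emem' (EqSE-ren-comp η r1 r2) v w r x p = p

EqSE-ext : ∀ {Γ G s} {η η' : SEnv Γ G} (v : Val s G) (h : MemPredFor s G) → EqSE η η' → EqSE (extSE η v h) (extSE η' v h)
elook (EqSE-ext v h q) here = refl
elook (EqSE-ext v h q) (there x) = elook q x
emem (EqSE-ext v h q) here w r x p = p
emem (EqSE-ext v h q) (there y) = emem q y
emem' (EqSE-ext v h q) here w r x p = p
emem' (EqSE-ext v h q) (there y) = emem' q y

subOf-EqSE : ∀ {Γ G} {η η' : SEnv Γ G} → EqSE η η' → subOf η ≗ˢ subOf η'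
subOf-EqSE q v = cong termV (elook q v)

valOf-eq : ∀ {Γ G s} {η η' : SEnv Γ G} → EqSE η η' → (a : Tm Γ s) → valOf η a ≡ valOf η' a
valOf-eq q (var v) = elook q v
valOf-eq q zer = refl
valOf-eq q (cst c) = refl

module _ (bnd : ∀ j → MemInterp j) where
  Sat-EqSE : ∀ {Γ} (A : Fm Γ) {w : World} {η η' : SEnv Γ (ctx w)} → EqSE η η' → Sat bnd A w η → Sat bnd A w η'
  Sat-EqSE (Ap _ _ _) q p = tt
  Sat-EqSE (EqO _ _) q p = tt
  Sat-EqSE (EqK _ _ _) q p = tt
  Sat-EqSE (Mem j a (var v)) {w} {η} q (d , m) = castF (subFm-cong (subOf-EqSE q) (Mem j a (var v))) d ,
    emem q v w (λ u → u) _ (subst (mem η v w (λ u → u)) (valOf-eq q a) m)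
  Sat-EqSE ⊥̇ q p = p
  Sat-EqSE (A ∧̇ B) q (p , p') = Sat-EqSE A q p , Sat-EqSE B q p'
  Sat-EqSE (A ∨̇ B) q (w' , ch , inj₁ (d , p)) = w' , ch , inj₁ (castF (subFm-cong (subOf-EqSE (EqSE-ren _ q)) A) d , Sat-EqSE A (EqSE-ren _ q) p)
  Sat-EqSE (A ∨̇ B) q (w' , ch , inj₂ (d , p)) = w' , ch , inj₂ (castF (subFm-cong (subOf-EqSE (EqSE-ren _ q)) B) d , Sat-EqSE B (EqSE-ren _ q) p)
  Sat-EqSE (A ⊃̇ B) q f w' e d p =
    Sat-EqSE B (EqSE-ren _ q) (f w' e (castF (subFm-cong (subOf-EqSE (EqSE-sym (EqSE-ren _ q))) A) d) (Sat-EqSE A (EqSE-sym (EqSE-ren _ q)) p))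
  Sat-EqSE (All̇ s A) q f w' e v ok = Sat-EqSE A (EqSE-ext v _ (EqSE-ren _ q)) (f w' e v ok)
  Sat-EqSE (Eẋ s A) q (w' , ch , v , ok , d , p) =
    w' , ch , v , ok , castF (subFm-cong (subOf-EqSE (EqSE-ext v _ (EqSE-ren _ q))) A) d , Sat-EqSE A (EqSE-ext v _ (EqSE-ren _ q)) p

MemSim : ∀ j (w : World) → Val (ty (suc j)) (ctx w) → Val (ty (suc j)) (ctx w) → Set
MemSim j w x x' = ∀ w' (e : Ext w w') (y : Val (ty j) (ctx w')) → w' ⊢ʷ Mem j (termV y) (renTm (ren e) (termV x)) →
  memSem j x w' (ren e) y → memSem j x' w' (ren e) y

ValEq : ∀ s (w : World) → Val s (ctx w) → Val s (ctx w) → Set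
ValEq ω w x x' = w ⊢ʷ EqN (termV x) (termV x')
ValEq (ty zero) w x x' = w ⊢ʷ EqK 0 (termV x) (termV x')
ValEq (ty (suc j)) w x x' = (w ⊢ʷ EqT (suc j) (termV x) (termV x')) × MemSim j w x x' × MemSim j w x' x

-- The properties of forcing that membership predicates must share for Sat (Mem …) to inherit them.
record Regular {j G} (h : MemPred j G) : Set where
  field
    gcong : ∀ {w} {r r' : Ren G (ctx w)} {x} → r ≗ᴿ r' → h w r x → h w r' x
    gmono : ∀ {w w'} {r : Ren G (ctx w)} {x} → h w r x → (e : Ext w w') → h w' (λ v → ren e (r v)) (renV (ren e) x)
    gloc  : ∀ {w} {r : Ren G (ctx w)} {x} → Cover w (λ w' e → h w' (λ v → ren e (r v)) (renV (ren e) x)) → h w r x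
    gexp  : ∀ {w} {r : Ren G (ctx w)} {x} → w ⊢ʷ ⊥̇ → h w r x
    gleib : ∀ {w} {r : Ren G (ctx w)} {x x'} → ValEq (ty j) w x x' → h w r x → h w r x'
open Regular public

RegularEnv : ∀ {Γ G} → SEnv Γ G → Set
RegularEnv {Γ} η = ∀ {j} (v : Var Γ (ty (suc j))) → Regular (mem η v)

RegularInterp : (∀ j → MemInterp j) → Set
RegularInterp bnd = ∀ j {G} (B : Val (ty (suc j)) G) → Regular (bnd j B)

Regular-ren : ∀ {j G G'} {h : MemPred j G} (r : Ren G G') → Regular h → Regular (renMemPred r h)
gcong (Regular-ren r g) e p = gcong g (λ v → e (r v)) p
gmono (Regular-ren r g) p e = gmono g p e
gloc (Regular-ren r g) c = gloc g c
gexp (Regular-ren r g) d = gexp g d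
gleib (Regular-ren r g) q p = gleib g q p

RegularEnv-ren : ∀ {Γ G G'} {η : SEnv Γ G} (r : Ren G G') → RegularEnv η → RegularEnv (renSE r η)
RegularEnv-ren r g v = Regular-ren r (g v)

RegularEnv-ext : ∀ {Γ G s} {η : SEnv Γ G} (bnd : ∀ j → MemInterp j) → RegularInterp bnd → RegularEnv η → (x : Val s G) → RegularEnv (extSE η x (memPredOf bnd x))
RegularEnv-ext {s = ty (suc j)} bnd gb g x here = gb j x
RegularEnv-ext bnd gb g x (there v) = g v

-- A cover pulled back along an extension.
record Push {w w1 w' : World} (ch : Chain w w1) (e : Ext w w') : Set where
  constructor mkPush
  field
    pw : World
    pch : Chain w' pw
    pe : Ext w1 pw
    pcomm : ∀ {s} (v : Var (ctx w) s) → ren pe (ren (chExt ch) v) ≡ ren (chExt pch) (ren e v)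
open Push public

stepPush : ∀ {w w' s A} (d : w ⊢ʷ Eẋ s A) (e : Ext w w') →
  Ext ⟨ s ∷ ctx w , A ∷ map wkFm (hyps w) ⟩ ⟨ s ∷ ctx w' , renFm (liftR (ren e)) A ∷ map wkFm (hyps w') ⟩
stepPush {w} {w'} {s} {A} d e = mkExt (liftR (ren e)) f
  where
  f : ∀ {B} → B ∈ (A ∷ map wkFm (hyps w)) → _ ⊢ʷ renFm (liftR (ren e)) B
  f (here refl) = hyp (here refl)
  f (there p) with ∈-map⁻ wkFm p
  ... | H , q , refl = castF (trans (renFm-comp there (ren e) H) (sym (renFm-comp (liftR (ren e)) there H))) (⊢-⊆ (⊢-wk (hyp-transport e q)) there)

push : ∀ {w w1 w'} (ch : Chain w w1) (e : Ext w w') → Push ch e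
push nil e = mkPush _ nil e (λ v → refl)
push (step d ch) e with push ch (stepPush d e)
... | mkPush pw pch pe pc = mkPush pw (step (transport d e) pch) pe (λ v → pc (there v))

_++ᶜ_ : ∀ {w1 w2 w3} → Chain w1 w2 → Chain w2 w3 → Chain w1 w3
nil ++ᶜ ch = ch
step d ch1 ++ᶜ ch = step d (ch1 ++ᶜ ch)

++ᶜ-ren : ∀ {w1 w2 w3} (ch1 : Chain w1 w2) (ch2 : Chain w2 w3) → ∀ {s} (v : Var (ctx w1) s) →
  ren (chExt (ch1 ++ᶜ ch2)) v ≡ ren (chExt ch2) (ren (chExt ch1) v)
++ᶜ-ren nil ch2 v = refl
++ᶜ-ren (step d ch1) ch2 v = ++ᶜ-ren ch1 ch2 (there v)

Standard-mono : ∀ {s w w'} (x : Val s (ctx w)) → Standard w x → (e : Ext w w') → Standard w' (renV (ren e) x)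
Standard-mono (vω t) (n , d) e = n , castF (trans (renFm-sub (ren e) _) (trans (Num-sub _ n t) (cong (Num n) (sym (renTm-sub (ren e) t))))) (transport d e)
Standard-mono (vO t) ok e = tt
Standard-mono (vS _ _ _ _ _) ok e = tt

RenInvariant : ∀ {j} → MemInterp j → Set
RenInvariant {j} m = ∀ {G G'} (B : Val (ty (suc j)) G) (r : Ren G G') (w : World) (r' : Ren G' (ctx w)) (y : Val (ty j) (ctx w)) →
  renMemPred r (m B) w r' y ⇔ m (renV r B) w r' y

RenInvariantInterp : (∀ j → MemInterp j) → Set
RenInvariantInterp bnd = ∀ j → RenInvariant (bnd j)

renSE-square : ∀ {Γ G0 G1 G2 G3} {η : SEnv Γ G0} → RegularEnv η → {r0 : Ren G0 G1} {r1 : Ren G1 G3} {r2 : Ren G0 G2} {r3 : Ren G2 G3} →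
  (∀ {s} (v : Var G0 s) → r1 (r0 v) ≡ r3 (r2 v)) → EqSE (renSE r1 (renSE r0 η)) (renSE r3 (renSE r2 η))
renSE-square {η = η} g {r0} {r1} {r2} {r3} c = EqSE-trans (EqSE-ren-comp η r0 r1)
  (EqSE-trans (EqSE-ren-cong η c (λ v w x e p → gcong (g v) e p)) (EqSE-sym (EqSE-ren-comp η r2 r3)))

module Kripke (bnd : ∀ j → MemInterp j) (gb : RegularInterp bnd) (ri : RenInvariantInterp bnd) where

  ext-ren : ∀ {Γ G G' s} (η : SEnv Γ G) (r : Ren G G') (x : Val s G) →
    EqSE (renSE r (extSE η x (memPredOf bnd x))) (extSE (renSE r η) (renV r x) (memPredOf bnd (renV r x)))
  elook (ext-ren η r x) here = refl
  elook (ext-ren η r x) (there v) = refl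
  emem (ext-ren η r x) {j} here w r' y p = to (ri j x r w r' y) p
  emem (ext-ren η r x) (there v) w r' y p = p
  emem' (ext-ren η r x) {j} here w r' y p = from (ri j x r w r' y) p
  emem' (ext-ren η r x) (there v) w r' y p = p

  monotone : ∀ {Γ} (A : Fm Γ) {w w'} {η : SEnv Γ (ctx w)} → RegularEnv η → Sat bnd A w η → (e : Ext w w') → Sat bnd A w' (renSE (ren e) η)
  monotone (Ap _ _ _) g p e = tt
  monotone (EqO _ _) g p e = tt
  monotone (EqK _ _ _) g p e = tt
  monotone (Mem j a (var v)) {η = η} g (d , m) e = castF (subOf-ren (ren e) η (Mem j a (var v))) (transport d e) ,
    subst (mem η v _ (ren e)) (sym (valOf-ren (ren e) η a)) (gmono (g v) m e)
  monotone ⊥̇ g p e = transport p e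
  monotone (A ∧̇ B) g (p , q) e = monotone A g p e , monotone B g q e
  monotone (A ∨̇ B) {η = η} g (w1 , ch , q) e with push ch e
  ... | mkPush pw pch pe pc = pw , pch , h q
    where
    cv = renSE-square g pc
    h : _ → _
    h (inj₁ (d , p)) = inj₁ (castF (trans (subOf-ren (ren pe) (renSE (ren (chExt ch)) η) A) (subFm-cong (subOf-EqSE cv) A)) (transport d pe) ,
                             Sat-EqSE bnd A cv (monotone A (RegularEnv-ren {η = η} (ren (chExt ch)) g) p pe))
    h (inj₂ (d , p)) = inj₂ (castF (trans (subOf-ren (ren pe) (renSE (ren (chExt ch)) η) B) (subFm-cong (subOf-EqSE cv) B)) (transport d pe) ,
                             Sat-EqSE bnd B cv (monotone B (RegularEnv-ren {η = η} (ren (chExt ch)) g) p pe))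
  monotone (A ⊃̇ B) {η = η} g f e w'' e' d p =
    Sat-EqSE bnd B (EqSE-sym (EqSE-ren-comp η _ _))
      (f w'' (e ⨾ e') (castF (subFm-cong (subOf-EqSE (EqSE-ren-comp η _ _)) A) d) (Sat-EqSE bnd A (EqSE-ren-comp η _ _) p))
  monotone (All̇ s A) {η = η} g f e w'' e' v ok = Sat-EqSE bnd A (EqSE-ext v _ (EqSE-sym (EqSE-ren-comp η _ _))) (f w'' (e ⨾ e') v ok)
  monotone (Eẋ s A) {η = η} g (w1 , ch , x , ok , d , p) e with push ch e
  ... | mkPush pw pch pe pc = pw , pch , renV (ren pe) x , Standard-mono x ok pe ,
        castF (trans (subOf-ren (ren pe) (extSE (renSE (ren (chExt ch)) η) x (memPredOf bnd x)) A) (subFm-cong (subOf-EqSE cv) A)) (transport d pe) ,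
        Sat-EqSE bnd A cv (monotone A (RegularEnv-ext bnd gb (RegularEnv-ren {η = η} (ren (chExt ch)) g) x) p pe)
    where
    cv = EqSE-trans (ext-ren (renSE (ren (chExt ch)) η) (ren pe) x) (EqSE-ext (renV (ren pe) x) _ (renSE-square g pc))

  renSE-triangle : ∀ {Γ G0 G1 G3} {η : SEnv Γ G0} → RegularEnv η → {r0 : Ren G0 G1} {r1 : Ren G1 G3} {r : Ren G0 G3} →
    (∀ {s} (v : Var G0 s) → r1 (r0 v) ≡ r v) → EqSE (renSE r1 (renSE r0 η)) (renSE r η)
  renSE-triangle {η = η} g {r0} {r1} c = EqSE-trans (EqSE-ren-comp η r0 r1) (EqSE-ren-cong η c (λ v w x e p → gcong (g v) e p))

  local : ∀ {Γ} (A : Fm Γ) {w} {η : SEnv Γ (ctx w)} → RegularEnv η → Cover w (λ w' e → Sat bnd A w' (renSE (ren e) η)) → Sat bnd A w η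
  local (Ap _ _ _) g c = tt
  local (EqO _ _) g c = tt
  local (EqK _ _ _) g c = tt
  local (Mem j a (var v)) {η = η} g (w' , ch , d , m) =
    collapse ch (castF (sym (subOf-ren (ren (chExt ch)) η (Mem j a (var v)))) d) ,
    gloc (g v) (w' , ch , subst (mem η v w' (ren (chExt ch))) (valOf-ren (ren (chExt ch)) η a) m)
  local ⊥̇ g (w' , ch , d) = collapse ch d
  local (A ∧̇ B) g (w' , ch , p , q) = local A g (w' , ch , p) , local B g (w' , ch , q)
  local (A ∨̇ B) {η = η} g (w1 , ch1 , w2 , ch2 , q) = w2 , ch1 ++ᶜ ch2 , h q
    where
    cv = renSE-triangle g (λ v → sym (++ᶜ-ren ch1 ch2 v))
    h : _ → _
    h (inj₁ (d , p)) = inj₁ (castF (subFm-cong (subOf-EqSE cv) A) d , Sat-EqSE bnd A cv p)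
    h (inj₂ (d , p)) = inj₂ (castF (subFm-cong (subOf-EqSE cv) B) d , Sat-EqSE bnd B cv p)
  local (A ⊃̇ B) {η = η} g (w1 , ch , f1) w' e d p with push ch e
  ... | mkPush pw pch pe pc = local B (RegularEnv-ren {η = η} (ren e) g) (pw , pch , Sat-EqSE bnd B cv (f1 pw pe d' p'))
    where
    cv = renSE-square g pc
    cv' = EqSE-sym cv
    d' = castF (trans (subOf-ren (ren (chExt pch)) (renSE (ren e) η) A) (subFm-cong (subOf-EqSE cv') A)) (transport d (chExt pch))
    p' = Sat-EqSE bnd A cv' (monotone A (RegularEnv-ren {η = η} (ren e) g) p (chExt pch))
  local (All̇ s A) {η = η} g (w1 , ch , f1) w' e v ok with push ch e
  ... | mkPush pw pch pe pc = local A (RegularEnv-ext bnd gb (RegularEnv-ren {η = η} (ren e) g) v)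
         (pw , pch , Sat-EqSE bnd A cv (f1 pw pe (renV (ren (chExt pch)) v) (Standard-mono v ok (chExt pch))))
    where
    cv = EqSE-trans (EqSE-ext (renV (ren (chExt pch)) v) _ (renSE-square g pc)) (EqSE-sym (ext-ren (renSE (ren e) η) (ren (chExt pch)) v))
  local (Eẋ s A) {η = η} g (w1 , ch1 , w2 , ch2 , x , ok , d , p) = w2 , ch1 ++ᶜ ch2 , x , ok , castF (subFm-cong (subOf-EqSE cv) A) d , Sat-EqSE bnd A cv p
    where
    cv = EqSE-ext x _ (renSE-triangle g (λ v → sym (++ᶜ-ren ch1 ch2 v)))

  freshV : ∀ s {G} → Val s (s ∷ G)
  freshV ω = vω (var here)
  freshV (ty zero) = vO (var here)
  freshV (ty (suc j)) = vS (var here) [] ⊥̇ tt []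

  Standard-fresh : ∀ s {G Hs} → Standard ⟨ s ∷ G , ⊥̇ ∷ Hs ⟩ (freshV s)
  Standard-fresh ω = 0 , ⊥E (hyp (here refl))
  Standard-fresh (ty zero) = tt
  Standard-fresh (ty (suc j)) = tt

  explode : ∀ {Γ} (A : Fm Γ) {w} {η : SEnv Γ (ctx w)} → RegularEnv η → w ⊢ʷ ⊥̇ → Sat bnd A w η
  explode (Ap _ _ _) g d = tt
  explode (EqO _ _) g d = tt
  explode (EqK _ _ _) g d = tt
  explode (Mem j a (var v)) g d = ⊥E d , gexp (g v) d
  explode ⊥̇ g d = d
  explode (A ∧̇ B) g d = explode A g d , explode B g d
  explode (A ∨̇ B) {η = η} g d = _ , nil , inj₁ (⊥E d , explode A (RegularEnv-ren {η = η} _ g) d)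
  explode (A ⊃̇ B) {η = η} g d w' e _ _ = explode B (RegularEnv-ren {η = η} _ g) (transport d e)
  explode (All̇ s A) {η = η} g d w' e v ok = explode A (RegularEnv-ext bnd gb (RegularEnv-ren {η = η} _ g) v) (transport d e)
  explode (Eẋ s A) {w} {η = η} g d = _ , step {A = ⊥̇} (⊥E d) nil , freshV s , Standard-fresh s , ⊥E (hyp (here refl)) ,
    explode A (RegularEnv-ext bnd gb (RegularEnv-ren {η = η} _ g) (freshV s)) (hyp (here refl))

_∘ˢᵉ_ : ∀ {Γ Δ G} → SEnv Δ G → Sub Γ Δ → SEnv Γ G
look (η ∘ˢᵉ σ) v = valOf η (σ v)
mem (η ∘ˢᵉ σ) v = memOf η (σ v)

termV-valOf : ∀ {Γ G s} (η : SEnv Γ G) (a : Tm Γ s) → termV (valOf η a) ≡ subTm (subOf η) a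
termV-valOf η (var v) = refl
termV-valOf η zer = refl
termV-valOf η (cst c) = refl

subOf-∘ˢᵉ : ∀ {Γ Δ G} (η : SEnv Δ G) (σ : Sub Γ Δ) (A : Fm Γ) → subFm (subOf η) (subFm σ A) ≡ subFm (subOf (η ∘ˢᵉ σ)) A
subOf-∘ˢᵉ η σ A = subFm-subFm (λ v → sym (termV-valOf η (σ v))) A

valOf-sub : ∀ {Γ Δ G s} (η : SEnv Δ G) (σ : Sub Γ Δ) (a : Tm Γ s) → valOf η (subTm σ a) ≡ valOf (η ∘ˢᵉ σ) a
valOf-sub η σ (var v) = refl
valOf-sub η σ zer = refl
valOf-sub η σ (cst c) = refl

renSE-∘ˢᵉ : ∀ {Γ Δ G G'} (η : SEnv Δ G) (σ : Sub Γ Δ) (r : Ren G G') → EqSE (renSE r (η ∘ˢᵉ σ)) (renSE r η ∘ˢᵉ σ)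
elook (renSE-∘ˢᵉ η σ r) v = sym (valOf-ren r η (σ v))
emem (renSE-∘ˢᵉ η σ r) v w r' x p with σ v
... | var u = p
emem' (renSE-∘ˢᵉ η σ r) v w r' x p with σ v
... | var u = p

extSE-∘ˢᵉ : ∀ {Γ Δ G s} (η : SEnv Δ G) (σ : Sub Γ Δ) (x : Val s G) (h : MemPredFor s G) → EqSE (extSE (η ∘ˢᵉ σ) x h) (extSE η x h ∘ˢᵉ liftS σ)
elook (extSE-∘ˢᵉ η σ x h) here = refl
elook (extSE-∘ˢᵉ η σ x h) (there v) with σ v
... | var u = refl
... | zer = refl
... | cst c = refl
emem (extSE-∘ˢᵉ η σ x h) here w r y p = p
emem (extSE-∘ˢᵉ η σ x h) (there v) w r y p with σ v
... | var u = p
emem' (extSE-∘ˢᵉ η σ x h) here w r y p = p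
emem' (extSE-∘ˢᵉ η σ x h) (there v) w r y p with σ v
... | var u = p

module SatSubst (bnd : ∀ j → MemInterp j) where
  Sat-subFm : ∀ {Γ Δ} (A : Fm Γ) (σ : Sub Γ Δ) {w} (η : SEnv Δ (ctx w)) → Sat bnd (subFm σ A) w η ⇔ Sat bnd A w (η ∘ˢᵉ σ)
  Sat-subFm (Ap _ _ _) σ η = mk⇔ (λ _ → tt) (λ _ → tt)
  Sat-subFm (EqO _ _) σ η = mk⇔ (λ _ → tt) (λ _ → tt)
  Sat-subFm (EqK _ _ _) σ η = mk⇔ (λ _ → tt) (λ _ → tt)
  Sat-subFm (Mem j a (var v)) σ {w} η = mk⇔
    (λ { (d , m) → castF (subOf-∘ˢᵉ η σ (Mem j a (var v))) d , subst (memOf η (σ v) w (λ u → u)) (valOf-sub η σ a) m })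
    (λ { (d , m) → castF (sym (subOf-∘ˢᵉ η σ (Mem j a (var v)))) d , subst (memOf η (σ v) w (λ u → u)) (sym (valOf-sub η σ a)) m })
  Sat-subFm ⊥̇ σ η = mk⇔ id id
  Sat-subFm (A ∧̇ B) σ η = mk⇔ (λ { (p , q) → to (Sat-subFm A σ η) p , to (Sat-subFm B σ η) q })
                            (λ { (p , q) → from (Sat-subFm A σ η) p , from (Sat-subFm B σ η) q })
  Sat-subFm (A ∨̇ B) σ {w} η = mk⇔ (λ { (w' , ch , q) → w' , ch , f (chExt ch) q }) (λ { (w' , ch , q) → w' , ch , b (chExt ch) q })
    where
    module _ {w'} (e : Ext w w') where
      cv = EqSE-sym (renSE-∘ˢᵉ η σ (ren e))
      gA = trans (subOf-∘ˢᵉ (renSE (ren e) η) σ A) (subFm-cong (subOf-EqSE cv) A)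
      interpBelow-regular = trans (subOf-∘ˢᵉ (renSE (ren e) η) σ B) (subFm-cong (subOf-EqSE cv) B)
      f : ((w' ⊢ʷ subFm (subOf (renSE (ren e) η)) (subFm σ A)) × Sat bnd (subFm σ A) w' (renSE (ren e) η)) ⊎
          ((w' ⊢ʷ subFm (subOf (renSE (ren e) η)) (subFm σ B)) × Sat bnd (subFm σ B) w' (renSE (ren e) η)) →
          ((w' ⊢ʷ subFm (subOf (renSE (ren e) (η ∘ˢᵉ σ))) A) × Sat bnd A w' (renSE (ren e) (η ∘ˢᵉ σ))) ⊎
          ((w' ⊢ʷ subFm (subOf (renSE (ren e) (η ∘ˢᵉ σ))) B) × Sat bnd B w' (renSE (ren e) (η ∘ˢᵉ σ)))
      f (inj₁ (d , p)) = inj₁ (castF gA d , Sat-EqSE bnd A cv (to (Sat-subFm A σ _) p))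
      f (inj₂ (d , p)) = inj₂ (castF interpBelow-regular d , Sat-EqSE bnd B cv (to (Sat-subFm B σ _) p))
      b : ((w' ⊢ʷ subFm (subOf (renSE (ren e) (η ∘ˢᵉ σ))) A) × Sat bnd A w' (renSE (ren e) (η ∘ˢᵉ σ))) ⊎
          ((w' ⊢ʷ subFm (subOf (renSE (ren e) (η ∘ˢᵉ σ))) B) × Sat bnd B w' (renSE (ren e) (η ∘ˢᵉ σ))) →
          ((w' ⊢ʷ subFm (subOf (renSE (ren e) η)) (subFm σ A)) × Sat bnd (subFm σ A) w' (renSE (ren e) η)) ⊎
          ((w' ⊢ʷ subFm (subOf (renSE (ren e) η)) (subFm σ B)) × Sat bnd (subFm σ B) w' (renSE (ren e) η))
      b (inj₁ (d , p)) = inj₁ (castF (sym gA) d , from (Sat-subFm A σ _) (Sat-EqSE bnd A (EqSE-sym cv) p))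
      b (inj₂ (d , p)) = inj₂ (castF (sym interpBelow-regular) d , from (Sat-subFm B σ _) (Sat-EqSE bnd B (EqSE-sym cv) p))
  Sat-subFm (A ⊃̇ B) σ η = mk⇔
    (λ f w' e d p → Sat-EqSE bnd B (EqSE-sym (renSE-∘ˢᵉ η σ _)) (to (Sat-subFm B σ _)
        (f w' e (castF (sym (trans (subOf-∘ˢᵉ _ σ A) (subFm-cong (subOf-EqSE (EqSE-sym (renSE-∘ˢᵉ η σ _))) A))) d)
                (from (Sat-subFm A σ _) (Sat-EqSE bnd A (renSE-∘ˢᵉ η σ _) p)))))
    (λ f w' e d p → from (Sat-subFm B σ _) (Sat-EqSE bnd B (renSE-∘ˢᵉ η σ _)
        (f w' e (castF (trans (subOf-∘ˢᵉ _ σ A) (subFm-cong (subOf-EqSE (EqSE-sym (renSE-∘ˢᵉ η σ _))) A)) d)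
                (Sat-EqSE bnd A (EqSE-sym (renSE-∘ˢᵉ η σ _)) (to (Sat-subFm A σ _) p)))))
  Sat-subFm (All̇ s A) σ η = mk⇔
    (λ f w' e v ok → Sat-EqSE bnd A (cv w' e v) (to (Sat-subFm A (liftS σ) _) (f w' e v ok)))
    (λ f w' e v ok → from (Sat-subFm A (liftS σ) _) (Sat-EqSE bnd A (EqSE-sym (cv w' e v)) (f w' e v ok)))
    where
    cv : ∀ w' (e : Ext _ w') v → EqSE (extSE (renSE (ren e) η) v (memPredOf bnd v) ∘ˢᵉ liftS σ) (extSE (renSE (ren e) (η ∘ˢᵉ σ)) v (memPredOf bnd v))
    cv w' e v = EqSE-trans (EqSE-sym (extSE-∘ˢᵉ (renSE (ren e) η) σ v _)) (EqSE-ext v _ (EqSE-sym (renSE-∘ˢᵉ η σ (ren e))))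
  Sat-subFm (Eẋ s A) σ η = mk⇔
    (λ { (w' , ch , v , ok , d , p) → w' , ch , v , ok ,
          castF (trans (subOf-∘ˢᵉ _ (liftS σ) A) (subFm-cong (subOf-EqSE (cv w' (chExt ch) v)) A)) d ,
          Sat-EqSE bnd A (cv w' (chExt ch) v) (to (Sat-subFm A (liftS σ) _) p) })
    (λ { (w' , ch , v , ok , d , p) → w' , ch , v , ok ,
          castF (sym (trans (subOf-∘ˢᵉ _ (liftS σ) A) (subFm-cong (subOf-EqSE (cv w' (chExt ch) v)) A))) d ,
          from (Sat-subFm A (liftS σ) _) (Sat-EqSE bnd A (EqSE-sym (cv w' (chExt ch) v)) p) })
    where
    cv : ∀ w' (e : Ext _ w') v → EqSE (extSE (renSE (ren e) η) v (memPredOf bnd v) ∘ˢᵉ liftS σ) (extSE (renSE (ren e) (η ∘ˢᵉ σ)) v (memPredOf bnd v))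
    cv w' e v = EqSE-trans (EqSE-sym (extSE-∘ˢᵉ (renSE (ren e) η) σ v _)) (EqSE-ext v _ (EqSE-sym (renSE-∘ˢᵉ η σ (ren e))))

RenInvariantMemSem : Set
RenInvariantMemSem = ∀ j → RenInvariant (memSem j)

ValEq-refl : ∀ s {w} (x : Val s (ctx w)) → ValEq s w x x
ValEq-refl ω x = EqN-refl _
ValEq-refl (ty zero) x = EqK₀-refl _
ValEq-refl (ty (suc j)) x = EqT-refl (suc j) _ , (λ w' e y d m → m) , (λ w' e y d m → m)

ValEq-sym : ∀ s {w} {x x' : Val s (ctx w)} → ValEq s w x x' → ValEq s w x' x
ValEq-sym ω q = EqN-sym q
ValEq-sym (ty zero) q = EqK₀-sym q
ValEq-sym (ty (suc j)) (q , a , b) = EqT-sym (suc j) q , b , a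

ValEq-syn : ∀ s {w} {x x' : Val s (ctx w)} → ValEq s w x x' → w ⊢ʷ EqS s (termV x) (termV x')
ValEq-syn ω q = q
ValEq-syn (ty zero) q = q
ValEq-syn (ty (suc j)) q = proj₁ q

EqN-ren : ∀ {G G'} (r : Ren G G') (a b : Tm G ω) → renFm r (EqN a b) ≡ EqN (renTm r a) (renTm r b)
EqN-ren r (var u) (var u') = refl
EqN-ren r (var u) zer = refl
EqN-ren r zer (var u') = refl
EqN-ren r zer zer = refl

EqT-ren : ∀ {G G'} k (r : Ren G G') (a b : Tm G (ty k)) → renFm r (EqT k a b) ≡ EqT k (renTm r a) (renTm r b)
EqT-ren k r a b = trans (renFm-sub r _) (trans (EqT-sub k (ren⇒sub r) a b) (sym (cong₂ (EqT k) (renTm-sub r a) (renTm-sub r b))))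

module _ (rim : RenInvariantMemSem) where
  MemSim-mono : ∀ j {w w'} {x x' : Val (ty (suc j)) (ctx w)} → MemSim j w x x' → (e : Ext w w') → MemSim j w' (renV (ren e) x) (renV (ren e) x')
  MemSim-mono j {x = x} {x'} ms e w'' e' y d m =
    to (rim j x' (ren e) w'' (ren e') y)
      (ms w'' (e ⨾ e') y (castF (cong (Mem j (termV y)) (trans (cong (renTm (ren e')) (termV-ren (ren e) x)) (renTm-comp (ren e') (ren e) (termV x)))) d)
          (from (rim j x (ren e) w'' (ren e') y) m))

  ValEq-mono : ∀ s {w w'} {x x' : Val s (ctx w)} → ValEq s w x x' → (e : Ext w w') → ValEq s w' (renV (ren e) x) (renV (ren e) x')
  ValEq-mono ω {x = x} {x'} q e = castF (trans (EqN-ren (ren e) _ _) (sym (cong₂ EqN (termV-ren (ren e) x) (termV-ren (ren e) x')))) (transport q e)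
  ValEq-mono (ty zero) {x = x} {x'} q e = castF (sym (cong₂ (EqK 0) (termV-ren (ren e) x) (termV-ren (ren e) x'))) (transport q e)
  ValEq-mono (ty (suc j)) {x = x} {x'} (q , a , b) e =
    castF (trans (EqT-ren (suc j) (ren e) _ _) (sym (cong₂ (EqT (suc j)) (termV-ren (ren e) x) (termV-ren (ren e) x')))) (transport q e) ,
    MemSim-mono j {x = x} {x'} a e , MemSim-mono j {x = x'} {x} b e

  record EnvRel {Γ} (w : World) (η η' : SEnv Γ (ctx w)) : Set where
    field
      rval : ∀ {s} (v : Var Γ s) → ValEq s w (look η v) (look η' v)
      rmem : ∀ {j} (v : Var Γ (ty (suc j))) w' (e : Ext w w') (y : Val (ty j) (ctx w')) →
             w' ⊢ʷ Mem j (termV y) (renTm (ren e) (termV (look η v))) → mem η v w' (ren e) y → mem η' v w' (ren e) y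
      rmem' : ∀ {j} (v : Var Γ (ty (suc j))) w' (e : Ext w w') (y : Val (ty j) (ctx w')) →
             w' ⊢ʷ Mem j (termV y) (renTm (ren e) (termV (look η' v))) → mem η' v w' (ren e) y → mem η v w' (ren e) y
  open EnvRel public

  EnvRel-sym : ∀ {Γ w} {η η' : SEnv Γ (ctx w)} → EnvRel w η η' → EnvRel w η' η
  rval (EnvRel-sym q) {s} v = ValEq-sym s (rval q v)
  rmem (EnvRel-sym q) = rmem' q
  rmem' (EnvRel-sym q) = rmem q

  memconv : ∀ {j w w' w''} (e : Ext w w') (e' : Ext w' w'') (y : Val (ty j) (ctx w'')) (x : Val (ty (suc j)) (ctx w)) →
    w'' ⊢ʷ Mem j (termV y) (renTm (ren e') (termV (renV (ren e) x))) → w'' ⊢ʷ Mem j (termV y) (renTm (ren (e ⨾ e')) (termV x))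
  memconv {j} e e' y x d = castF (cong (Mem j (termV y)) (trans (cong (renTm (ren e')) (termV-ren (ren e) x)) (renTm-comp (ren e') (ren e) (termV x)))) d

  EnvRel-ren : ∀ {Γ w w'} {η η' : SEnv Γ (ctx w)} → EnvRel w η η' → (e : Ext w w') → EnvRel w' (renSE (ren e) η) (renSE (ren e) η')
  rval (EnvRel-ren q e) {s} v = ValEq-mono s (rval q v) e
  rmem (EnvRel-ren {η = η} q e) v w'' e' y d m = rmem q v w'' (e ⨾ e') y (memconv e e' y (look η v) d) m
  rmem' (EnvRel-ren {η' = η'} q e) v w'' e' y d m = rmem' q v w'' (e ⨾ e') y (memconv e e' y (look η' v) d) m

  EnvRel-ext : ∀ {Γ w s} {η η' : SEnv Γ (ctx w)} (x : Val s (ctx w)) (h : MemPredFor s (ctx w)) → EnvRel w η η' → EnvRel w (extSE η x h) (extSE η' x h)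
  rval (EnvRel-ext {s = s} x h q) here = ValEq-refl s x
  rval (EnvRel-ext x h q) (there v) = rval q v
  rmem (EnvRel-ext x h q) here w' e y d m = m
  rmem (EnvRel-ext x h q) (there v) = rmem q v
  rmem' (EnvRel-ext x h q) here w' e y d m = m
  rmem' (EnvRel-ext x h q) (there v) = rmem' q v

  EnvRel-R : ∀ {Γ w} {η η' : SEnv Γ (ctx w)} → EnvRel w η η' → EqSubs (hyps w) (subOf η) (subOf η')
  EnvRel-R q {s} v = ValEq-syn s (rval q v)

  valOf-rel : ∀ {Γ w s} {η η' : SEnv Γ (ctx w)} → EnvRel w η η' → (a : Tm Γ s) → ValEq s w (valOf η a) (valOf η' a)
  valOf-rel q (var v) = rval q v
  valOf-rel q zer = ValEq-refl ω (vω zer)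
  valOf-rel q (cst c) = ValEq-refl (ty 0) (vO (cst c))

  module SatLeibniz (bnd : ∀ j → MemInterp j) (gb : RegularInterp bnd) where
    Sat-leibniz : ∀ {Γ} (A : Fm Γ) {w} {η η' : SEnv Γ (ctx w)} → RegularEnv η → RegularEnv η' → EnvRel w η η' → Sat bnd A w η → Sat bnd A w η'
    Sat-leibniz (Ap _ _ _) g g' q p = tt
    Sat-leibniz (EqO _ _) g g' q p = tt
    Sat-leibniz (EqK _ _ _) g g' q p = tt
    Sat-leibniz (Mem j a (var v)) {w} {η} {η'} g g' q (d , m) =
      leibniz (Mem j a (var v)) (EnvRel-R q) d ,
      gleib (g' v) (valOf-rel q a)
        (rmem q v w Ext-refl (valOf η a) (castF (sym (cong₂ (Mem j) (termV-valOf η a) (renTm-id _))) d) m)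
    Sat-leibniz ⊥̇ g g' q p = p
    Sat-leibniz (A ∧̇ B) g g' q (p , p') = Sat-leibniz A g g' q p , Sat-leibniz B g g' q p'
    Sat-leibniz (A ∨̇ B) {η = η} {η'} g g' q (w' , ch , inj₁ (d , p)) =
      w' , ch , inj₁ (leibniz A (EnvRel-R (EnvRel-ren q (chExt ch))) d ,
                       Sat-leibniz A (RegularEnv-ren {η = η} _ g) (RegularEnv-ren {η = η'} _ g') (EnvRel-ren q (chExt ch)) p)
    Sat-leibniz (A ∨̇ B) {η = η} {η'} g g' q (w' , ch , inj₂ (d , p)) =
      w' , ch , inj₂ (leibniz B (EnvRel-R (EnvRel-ren q (chExt ch))) d ,
                       Sat-leibniz B (RegularEnv-ren {η = η} _ g) (RegularEnv-ren {η = η'} _ g') (EnvRel-ren q (chExt ch)) p)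
    Sat-leibniz (A ⊃̇ B) {η = η} {η'} g g' q f w' e d p =
      Sat-leibniz B (RegularEnv-ren {η = η} _ g) (RegularEnv-ren {η = η'} _ g') (EnvRel-ren q e)
        (f w' e (leibniz A (EnvRel-R (EnvRel-sym (EnvRel-ren q e))) d)
                (Sat-leibniz A (RegularEnv-ren {η = η'} _ g') (RegularEnv-ren {η = η} _ g) (EnvRel-sym (EnvRel-ren q e)) p))
    Sat-leibniz (All̇ s A) {η = η} {η'} g g' q f w' e v ok =
      Sat-leibniz A (RegularEnv-ext bnd gb (RegularEnv-ren {η = η} _ g) v) (RegularEnv-ext bnd gb (RegularEnv-ren {η = η'} _ g') v)
        (EnvRel-ext v _ (EnvRel-ren q e)) (f w' e v ok)
    Sat-leibniz (Eẋ s A) {η = η} {η'} g g' q (w' , ch , v , ok , d , p) =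
      w' , ch , v , ok , leibniz A (EnvRel-R (EnvRel-ext v _ (EnvRel-ren q (chExt ch)))) d ,
      Sat-leibniz A (RegularEnv-ext bnd gb (RegularEnv-ren {η = η} _ g) v) (RegularEnv-ext bnd gb (RegularEnv-ren {η = η'} _ g') v)
        (EnvRel-ext v _ (EnvRel-ren q (chExt ch))) p

mutual
  memUpTo-coherent : ∀ k j (q : j ≤′ k) {G} (B : Val (ty (suc j)) G) (w : World) (r : Ren G (ctx w)) (y : Val (ty j) (ctx w)) → memUpTo k j q B w r y ≡ memSem j B w r y
  memUpTo-coherent k .k ≤′-refl B w r y = refl
  memUpTo-coherent (suc k) j (≤′-step q) B w r y = memUpTo-coherent k j q B w r y

memBelow-coherent : ∀ k j (p : j < k) {G} (B : Val (ty (suc j)) G) (w : World) (r : Ren G (ctx w)) (y : Val (ty j) (ctx w)) → memBelow k j p B w r y ≡ memSem j B w r y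
memBelow-coherent (suc k) j p B w r y = memUpTo-coherent k j (≤⇒≤′ (s≤s⁻¹ p)) B w r y

RenInvariant-trivial : ∀ {j} → RenInvariant (memTrivial {j})
RenInvariant-trivial B r w r' y = mk⇔ (λ _ → tt) (λ _ → tt)

module StratumRenInvariant (k : ℕ) (L : ∀ j → j < k → MemInterp j) (riL : ∀ j p → RenInvariant (L j p)) where
  open Stratum k L

  interpBelowDec-renInvariant : ∀ j d → RenInvariant (interpBelowDec j d)
  interpBelowDec-renInvariant j (yes p) = riL j p
  interpBelowDec-renInvariant j (no _) = RenInvariant-trivial

  interpBelow-renInvariant : RenInvariantInterp interpBelow
  interpBelow-renInvariant j = interpBelowDec-renInvariant j (j <? k)

  mutual
    memAt-renInvariant : RenInvariant memAt
    memAt-renInvariant (vS t Δ φ el e) r w r' y = mk⇔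
      (Sat-EqSE interpBelow φ (EqSE-ext y _ (EqSE-sym (envSE-ren e r r'))))
      (Sat-EqSE interpBelow φ (EqSE-ext y _ (envSE-ren e r r')))

    envSE-ren : ∀ {G G' G'' Δ} (e : Env G Δ) (r : Ren G G') (r' : Ren G' G'') → EqSE (renSE r' (envSE (renE r e))) (renSE (λ v → r' (r v)) (envSE e))
    elook (envSE-ren e r r') v = trans (cong (renV r') (lookE-ren r e v)) (renV-comp r' r (lookE e v))
    emem (envSE-ren e r r') v w r'' z p = from (envMem-renInvariant e v r w (λ u → r'' (r' u)) z) p
    emem' (envSE-ren e r r') v w r'' z p = to (envMem-renInvariant e v r w (λ u → r'' (r' u)) z) p

    envMem-renInvariant : ∀ {G G' Δ j} (e : Env G Δ) (v : Var Δ (ty (suc j))) (r : Ren G G') (w : World) (r' : Ren G' (ctx w)) (y : Val (ty j) (ctx w)) →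
      envMem e v w (λ u → r' (r u)) y ⇔ envMem (renE r e) v w r' y
    envMem-renInvariant {j = j} (B ∷ e) here r w r' y = memDispatch-renInvariant (j ≟ k) B r w r' y
    envMem-renInvariant (B ∷ e) (there v) r w r' y = envMem-renInvariant e v r w r' y

    memDispatch-renInvariant : ∀ {G G' j} (d : Dec (j ≡ k)) (B : Val (ty (suc j)) G) (r : Ren G G') (w : World) (r' : Ren G' (ctx w)) (y : Val (ty j) (ctx w)) →
      memDispatch d B w (λ u → r' (r u)) y ⇔ memDispatch d (renV r B) w r' y
    memDispatch-renInvariant (yes refl) B r w r' y = memAt-renInvariant B r w r' y
    memDispatch-renInvariant {j = j} (no _) B r w r' y = interpBelow-renInvariant j B r w r' y

mutual
  memUpTo-renInvariant : ∀ k j (q : j ≤′ k) → RenInvariant (memUpTo k j q)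
  memUpTo-renInvariant k .k ≤′-refl = StratumRenInvariant.memAt-renInvariant k (memBelow k) (memBelow-renInvariant k)
  memUpTo-renInvariant (suc k) j (≤′-step q) = memUpTo-renInvariant k j q

  memBelow-renInvariant : ∀ k j (p : j < k) → RenInvariant (memBelow k j p)
  memBelow-renInvariant (suc k) j p = memUpTo-renInvariant k j (≤⇒≤′ (s≤s⁻¹ p))

memSem-renInvariant : ∀ j → RenInvariant (memSem j)
memSem-renInvariant j = memUpTo-renInvariant j j ≤′-refl

Regular-trivial : ∀ {j G} (B : Val (ty (suc j)) G) → Regular (memTrivial B)
gcong (Regular-trivial B) _ _ = tt
gmono (Regular-trivial B) _ _ = tt
gloc (Regular-trivial B) _ = tt
gexp (Regular-trivial B) _ = tt
gleib (Regular-trivial B) _ _ = tt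

module StratumRegular (k : ℕ) (L : ∀ j → j < k → MemInterp j) (gL : ∀ j p {G} (B : Val (ty (suc j)) G) → Regular (L j p B))
          (riL : ∀ j p → RenInvariant (L j p))
          (Lc : ∀ j p {G} (B : Val (ty (suc j)) G) (w : World) (r : Ren G (ctx w)) (y : Val (ty j) (ctx w)) → L j p B w r y ≡ memSem j B w r y) where
  open Stratum k L
  open StratumRenInvariant k L riL using (interpBelow-renInvariant)

  interpBelowDec-regular : ∀ j d {G} (B : Val (ty (suc j)) G) → Regular (interpBelowDec j d B)
  interpBelowDec-regular j (yes p) B = gL j p B
  interpBelowDec-regular j (no _) B = Regular-trivial B

  interpBelow-regular : RegularInterp interpBelow
  interpBelow-regular j B = interpBelowDec-regular j (j <? k) B

  open Kripke interpBelow interpBelow-regular interpBelow-renInvariant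
  open SatLeibniz memSem-renInvariant interpBelow interpBelow-regular

  hrelD : ∀ j (d : Dec (j < k)) {w} (x x' : Val (ty (suc j)) (ctx w)) → MemSim j w x x' →
     ∀ w' (e : Ext w w') (y : Val (ty j) (ctx w')) → w' ⊢ʷ Mem j (termV y) (renTm (ren e) (termV x)) →
     interpBelowDec j d x w' (ren e) y → interpBelowDec j d x' w' (ren e) y
  hrelD j (yes p) x x' ms w' e y d m =
    subst id (sym (Lc j p x' w' (ren e) y)) (ms w' e y d (subst id (Lc j p x w' (ren e) y) m))
  hrelD j (no _) x x' ms w' e y d m = tt

  relExt : ∀ k' {Γ w} {η : SEnv Γ (ctx w)} (x x' : Val (ty k') (ctx w)) → ValEq (ty k') w x x' →
     EnvRel memSem-renInvariant w (extSE η x (memPredOf interpBelow x)) (extSE η x' (memPredOf interpBelow x'))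
  rval (relExt k' x x' q) here = q
  rval (relExt k' {η = η} x x' q) {s} (there v) = ValEq-refl s (look η v)
  rmem (relExt (suc j) x x' q) here w' e y d m = hrelD j (j <? k) x x' (proj₁ (proj₂ q)) w' e y d m
  rmem (relExt k' x x' q) (there v) w' e y d m = m
  rmem' (relExt (suc j) x x' q) here w' e y d m = hrelD j (j <? k) x' x (proj₂ (proj₂ q)) w' e y d m
  rmem' (relExt k' x x' q) (there v) w' e y d m = m

  mutual
    memAt-regular : ∀ {G} (B : Val (ty (suc k)) G) → Regular (memAt B)
    memAt-regular {G} (vS t Δ φ el e) = record
      { gcong = λ {w} {r} {r'} {x} c p → Sat-EqSE interpBelow φ (EqSE-ext x _ (EqSE-ren-cong (envSE e) c (λ v w x c' p → gcong (envSE-regular e v) c' p))) p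
      ; gmono = λ {w} {w'} {r} {x} p e' → Sat-EqSE interpBelow φ (cv {w} {w'} r x e') (monotone φ (gSE {w} r x) p e')
      ; gloc = λ { {w} {r} {x} (w' , ch , p) → local φ (gSE {w} r x) (w' , ch , Sat-EqSE interpBelow φ (EqSE-sym (cv {w} {w'} r x (chExt ch))) p) }
      ; gexp = λ {w} {r} {x} d → explode φ (gSE {w} r x) d
      ; gleib = λ {w} {r} {x} {x'} q p → Sat-leibniz φ (gSE {w} r x) (gSE {w} r x') (relExt k {η = renSE r (envSE e)} x x' q) p
      }
      where
      gSE : ∀ {w} (r : Ren G (ctx w)) (x : Val (ty k) (ctx w)) → RegularEnv (extSE (renSE r (envSE e)) x (memPredOf interpBelow x))
      gSE r x = RegularEnv-ext interpBelow interpBelow-regular (RegularEnv-ren {η = envSE e} r (envSE-regular e)) x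
      cv : ∀ {w w'} (r : Ren G (ctx w)) (x : Val (ty k) (ctx w)) (e' : Ext w w') →
           EqSE (renSE (ren e') (extSE (renSE r (envSE e)) x (memPredOf interpBelow x)))
                (extSE (renSE (λ v → ren e' (r v)) (envSE e)) (renV (ren e') x) (memPredOf interpBelow (renV (ren e') x)))
      cv r x e' = EqSE-trans (ext-ren (renSE r (envSE e)) (ren e') x) (EqSE-ext _ _ (EqSE-ren-comp (envSE e) r (ren e')))

    envSE-regular : ∀ {G Δ} (e : Env G Δ) → RegularEnv (envSE e)
    envSE-regular {Δ = ty (suc j) ∷ Δ} (B ∷ e) here = memDispatch-regular (j ≟ k) B
    envSE-regular (B ∷ e) (there v) = envSE-regular e v

    memDispatch-regular : ∀ {G j} (d : Dec (j ≡ k)) (B : Val (ty (suc j)) G) → Regular (memDispatch d B)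
    memDispatch-regular (yes refl) B = memAt-regular B
    memDispatch-regular {j = j} (no _) B = interpBelow-regular j B

mutual
  memUpTo-regular : ∀ k j (q : j ≤′ k) {G} (B : Val (ty (suc j)) G) → Regular (memUpTo k j q B)
  memUpTo-regular k .k ≤′-refl B = StratumRegular.memAt-regular k (memBelow k) (memBelow-regular k) (memBelow-renInvariant k) (memBelow-coherent k) B
  memUpTo-regular (suc k) j (≤′-step q) B = memUpTo-regular k j q B

  memBelow-regular : ∀ k j (p : j < k) {G} (B : Val (ty (suc j)) G) → Regular (memBelow k j p B)
  memBelow-regular (suc k) j p B = memUpTo-regular k j (≤⇒≤′ (s≤s⁻¹ p)) B

memSem-regular : RegularInterp memSem
memSem-regular j B = memUpTo-regular j j ≤′-refl B

open Kripke memSem memSem-regular memSem-renInvariant public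
open SatLeibniz memSem-renInvariant memSem memSem-regular public
open SatSubst memSem public

⟦_⟧ : ∀ {Γ} → Fm Γ → (w : World) → SEnv Γ (ctx w) → Set
⟦ A ⟧ = Sat memSem A

-- Quantifiers bind set values to their canonical membership memSem; environments keep that invariant.
Coherent : ∀ {Γ G} → SEnv Γ G → Set
Coherent {Γ} {G} η = ∀ {j} (v : Var Γ (ty (suc j))) (w : World) (r : Ren G (ctx w)) (y : Val (ty j) (ctx w)) →
  mem η v w r y ⇔ memSem j (look η v) w r y

StandardEnv : ∀ {Γ} (w : World) → SEnv Γ (ctx w) → Set
StandardEnv {Γ} w η = ∀ {s} (v : Var Γ s) → Standard w (look η v)

Regular-⇔ : ∀ {j G} {h h' : MemPred j G} → Regular h → (∀ (w : World) (r : Ren G (ctx w)) (x : Val (ty j) (ctx w)) → h w r x ⇔ h' w r x) → Regular h'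
gcong (Regular-⇔ g f) c p = to (f _ _ _) (gcong g c (from (f _ _ _) p))
gmono (Regular-⇔ g f) p e = to (f _ _ _) (gmono g (from (f _ _ _) p) e)
gloc (Regular-⇔ g f) (w' , ch , p) = to (f _ _ _) (gloc g (w' , ch , from (f _ _ _) p))
gexp (Regular-⇔ g f) d = to (f _ _ _) (gexp g d)
gleib (Regular-⇔ g f) q p = to (f _ _ _) (gleib g q (from (f _ _ _) p))

Coherent⇒Regular : ∀ {Γ G} {η : SEnv Γ G} → Coherent η → RegularEnv η
Coherent⇒Regular {η = η} c v = Regular-⇔ (memSem-regular _ (look η v)) (λ w r x → ⇔-sym (c v w r x))

Coherent-ren : ∀ {Γ G G'} {η : SEnv Γ G} (r : Ren G G') → Coherent η → Coherent (renSE r η)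
Coherent-ren {η = η} r c {j} v w r' y = memSem-renInvariant j (look η v) r w r' y ⇔-∘ c v w _ y

Coherent-ext : ∀ {Γ G s} {η : SEnv Γ G} (x : Val s G) → Coherent η → Coherent (extSE η x (memPredOf memSem x))
Coherent-ext x c here w r y = mk⇔ id id
Coherent-ext x c (there v) = c v

StandardEnv-ren : ∀ {Γ w w'} {η : SEnv Γ (ctx w)} → StandardEnv w η → (e : Ext w w') → StandardEnv w' (renSE (ren e) η)
StandardEnv-ren {η = η} ok e v = Standard-mono (look η v) (ok v) e

StandardEnv-ext : ∀ {Γ w s} {η : SEnv Γ (ctx w)} (x : Val s (ctx w)) (h : MemPredFor s (ctx w)) → Standard w x → StandardEnv w η → StandardEnv w (extSE η x h)
StandardEnv-ext x h o ok here = o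
StandardEnv-ext x h o ok (there v) = ok v

renSE-id : ∀ {Γ G} (η : SEnv Γ G) → EqSE (renSE (λ v → v) η) η
elook (renSE-id η) v = renV-id (look η v)
emem (renSE-id η) v w r x p = p
emem' (renSE-id η) v w r x p = p

Standard-valOf : ∀ {Γ w s} (η : SEnv Γ (ctx w)) → StandardEnv w η → (t : Tm Γ s) → Standard w (valOf η t)
Standard-valOf η ok (var v) = ok v
Standard-valOf η ok zer = 0 , Num-zero
Standard-valOf η ok (cst c) = tt

Standard-ty : ∀ {w} j (y : Val (ty j) (ctx w)) → Standard w y
Standard-ty zero (vO t) = tt
Standard-ty (suc j) (vS _ _ _ _ _) = tt

Sat-subFm′ : ∀ {Γ Δ} (A : Fm Γ) (σ : Sub Γ Δ) {w} (η : SEnv Δ (ctx w)) (η'' : SEnv Γ (ctx w)) → EqSE (η ∘ˢᵉ σ) η'' →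
  (⟦ subFm σ A ⟧ w η ⇔ ⟦ A ⟧ w η'') × (subFm (subOf η) (subFm σ A) ≡ subFm (subOf η'') A)
Sat-subFm′ A σ η η'' q = mk⇔ (λ p → Sat-EqSE memSem A q (to (Sat-subFm A σ η) p)) (λ p → from (Sat-subFm A σ η) (Sat-EqSE memSem A (EqSE-sym q) p)) ,
  trans (subOf-∘ˢᵉ η σ A) (subFm-cong (subOf-EqSE q) A)

extSE-wk : ∀ {Γ G s} (η : SEnv Γ G) (x : Val s G) (h : MemPredFor s G) → EqSE (extSE η x h ∘ˢᵉ ren⇒sub there) η
elook (extSE-wk η x h) v = refl
emem (extSE-wk η x h) v w r y p = p
emem' (extSE-wk η x h) v w r y p = p

Sat-wkFm : ∀ {Γ s} (H : Fm Γ) {w} (η : SEnv Γ (ctx w)) (x : Val s (ctx w)) (h : MemPredFor s (ctx w)) →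
  (⟦ wkFm H ⟧ w (extSE η x h) ⇔ ⟦ H ⟧ w η) × (subFm (subOf (extSE η x h)) (wkFm H) ≡ subFm (subOf η) H)
Sat-wkFm H η x h with Sat-subFm′ H (ren⇒sub there) (extSE η x h) η (extSE-wk η x h)
... | e , g = mk⇔ (λ p → to e (subst (λ X → ⟦ X ⟧ _ _) (renFm-sub there H) p))
                  (λ p → subst (λ X → ⟦ X ⟧ _ _) (sym (renFm-sub there H)) (from e p)) ,
              trans (cong (subFm _) (renFm-sub there H)) g

extSE-singleSub : ∀ {Γ w s} (η : SEnv Γ (ctx w)) → Coherent η → (t : Tm Γ s) → EqSE (η ∘ˢᵉ singleSub t) (extSE η (valOf η t) (memPredOf memSem (valOf η t)))
elook (extSE-singleSub η c t) here = refl
elook (extSE-singleSub η c t) (there v) = refl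
emem (extSE-singleSub η c (var x)) here w r y p = to (c x w r y) p
emem (extSE-singleSub η c t) (there v) w r y p = p
emem' (extSE-singleSub η c (var x)) here w r y p = from (c x w r y) p
emem' (extSE-singleSub η c t) (there v) w r y p = p

Sat-sub1 : ∀ {Γ s} (A : Fm (s ∷ Γ)) (t : Tm Γ s) {w} (η : SEnv Γ (ctx w)) → Coherent η →
  (⟦ sub1 A t ⟧ w η ⇔ ⟦ A ⟧ w (extSE η (valOf η t) (memPredOf memSem (valOf η t)))) ×
  (subFm (subOf η) (sub1 A t) ≡ subFm (subOf (extSE η (valOf η t) (memPredOf memSem (valOf η t)))) A)
Sat-sub1 A t {w} η c with Sat-subFm′ A (singleSub t) η (extSE η (valOf η t) (memPredOf memSem (valOf η t))) (extSE-singleSub {w = w} η c t)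
... | e , g = mk⇔ (λ p → to e (subst (λ X → ⟦ X ⟧ _ _) (sub1≡ A t) p))
                  (λ p → subst (λ X → ⟦ X ⟧ _ _) (sym (sub1≡ A t)) (from e p)) ,
              trans (cong (subFm _) (sub1≡ A t)) g

HypsHold : ∀ {Γ} (w : World) → SEnv Γ (ctx w) → List (Fm Γ) → Set
HypsHold w η Hs = (∀ {H} → H ∈ Hs → w ⊢ʷ subFm (subOf η) H) × (∀ {H} → H ∈ Hs → ⟦ H ⟧ w η)

⊢-subOf : ∀ {Γ Hs A} → Γ ∣ Hs ⊢ A → ∀ {w} (η : SEnv Γ (ctx w)) → (∀ {H} → H ∈ Hs → w ⊢ʷ subFm (subOf η) H) → w ⊢ʷ subFm (subOf η) A
⊢-subOf {Hs = Hs} d η hs = ⊢-cut (⊢-sub d (subOf η)) f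
  where
  f : ∀ {B} → B ∈ map (subFm (subOf η)) Hs → _ ⊢ʷ B
  f p with ∈-map⁻ (subFm (subOf η)) p
  ... | H , q , refl = hs q

HypsHold-ren : ∀ {Γ w w' Hs} {η : SEnv Γ (ctx w)} → Coherent η → HypsHold w η Hs → (e : Ext w w') → HypsHold w' (renSE (ren e) η) Hs
HypsHold-ren {η = η} c (hs , hm) e = (λ {H} p → castF (subOf-ren (ren e) η H) (transport (hs p) e)) , (λ {H} p → monotone H (Coherent⇒Regular {η = η} c) (hm p) e)

HypsHold-∷ : ∀ {Γ w Hs A} {η : SEnv Γ (ctx w)} → w ⊢ʷ subFm (subOf η) A → ⟦ A ⟧ w η → HypsHold w η Hs → HypsHold w η (A ∷ Hs)
HypsHold-∷ d p (hs , hm) = (λ { (here refl) → d ; (there q) → hs q }) , (λ { (here refl) → p ; (there q) → hm q })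

HypsHold-wk : ∀ {Γ w s Hs} {η : SEnv Γ (ctx w)} (x : Val s (ctx w)) (h : MemPredFor s (ctx w)) → HypsHold w η Hs → HypsHold w (extSE η x h) (map wkFm Hs)
HypsHold-wk {w = w} {Hs = Hs} {η} x h (hs , hm) = f , g
  where
  f : ∀ {H} → H ∈ map wkFm Hs → _ ⊢ʷ subFm (subOf (extSE η x h)) H
  f p with ∈-map⁻ wkFm p
  ... | H , q , refl = castF (sym (proj₂ (Sat-wkFm H {w} η x h))) (hs {H} q)
  g : ∀ {H} → H ∈ map wkFm Hs → ⟦ H ⟧ _ (extSE η x h)
  g p with ∈-map⁻ wkFm p
  ... | H , q , refl = from (proj₁ (Sat-wkFm H {w} η x h)) (hm q)

Num-ren : ∀ {G G'} (r : Ren G G') n (t : Tm G ω) → renFm r (Num n t) ≡ Num n (renTm r t)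
Num-ren r n t = trans (renFm-sub r _) (trans (Num-sub (ren⇒sub r) n t) (cong (Num n) (sym (renTm-sub r t))))

tailSE : ∀ {Γ G s} → SEnv (s ∷ Γ) G → SEnv Γ G
tailSE η = η ∘ˢᵉ (λ v → var (there v))

Coherent-tail : ∀ {Γ G s} {η : SEnv (s ∷ Γ) G} → Coherent η → Coherent (tailSE η)
Coherent-tail c v = c (there v)

StandardEnv-tail : ∀ {Γ w s} {η : SEnv (s ∷ Γ) (ctx w)} → StandardEnv w η → StandardEnv w (tailSE η)
StandardEnv-tail ok v = ok (there v)

HypsHold-[] : ∀ {Γ w} {η : SEnv Γ (ctx w)} → HypsHold w η []
HypsHold-[] = (λ ()) , (λ ())

module Soundness (valid : ∀ {A} → Axiom A → ∀ {w} (η : SEnv [] (ctx w)) → ⟦ A ⟧ w η) where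

  mutual
    sound : ∀ {Γ Hs A} → Γ ∣ Hs ⊢ A → ∀ {w} (η : SEnv Γ (ctx w)) → Coherent η → StandardEnv w η → HypsHold w η Hs → ⟦ A ⟧ w η
    sound (hyp p) η c ok ho = proj₂ ho p
    sound (ax {A = A} a) η c ok ho =
      subst (λ X → ⟦ X ⟧ _ η) (sym (renFm-sub (λ ()) A)) (from (Sat-subFm A (ren⇒sub (λ ())) η) (valid a (η ∘ˢᵉ ren⇒sub (λ ()))))
    sound (⊥E {A = A} d) η c ok ho = explode A (Coherent⇒Regular {η = η} c) (sound d η c ok ho)
    sound (∧I d e) η c ok ho = sound d η c ok ho , sound e η c ok ho
    sound (∧E₁ d) η c ok ho = proj₁ (sound d η c ok ho)
    sound (∧E₂ d) η c ok ho = proj₂ (sound d η c ok ho)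
    sound (∨I₁ {A = A} d) η c ok ho =
      _ , nil , inj₁ (castF (subFm-cong (subOf-EqSE (EqSE-sym (renSE-id η))) A) (⊢-subOf d η (proj₁ ho)) ,
                      Sat-EqSE memSem A (EqSE-sym (renSE-id η)) (sound d η c ok ho))
    sound (∨I₂ {B = B} d) η c ok ho =
      _ , nil , inj₂ (castF (subFm-cong (subOf-EqSE (EqSE-sym (renSE-id η))) B) (⊢-subOf d η (proj₁ ho)) ,
                      Sat-EqSE memSem B (EqSE-sym (renSE-id η)) (sound d η c ok ho))
    sound (∨E {C = C} d e f) {w} η c ok ho with sound d η c ok ho
    ... | w' , ch , inj₁ (dA , pA) = local C (Coherent⇒Regular {η = η} c) (w' , ch ,
            sound e (renSE (ren (chExt ch)) η) (Coherent-ren {η = η} _ c) (StandardEnv-ren {η = η} ok (chExt ch)) (HypsHold-∷ dA pA (HypsHold-ren c ho (chExt ch))))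
    ... | w' , ch , inj₂ (dB , pB) = local C (Coherent⇒Regular {η = η} c) (w' , ch ,
            sound f (renSE (ren (chExt ch)) η) (Coherent-ren {η = η} _ c) (StandardEnv-ren {η = η} ok (chExt ch)) (HypsHold-∷ dB pB (HypsHold-ren c ho (chExt ch))))
    sound (⊃I d) η c ok ho w' e dA pA =
      sound d (renSE (ren e) η) (Coherent-ren {η = η} _ c) (StandardEnv-ren {η = η} ok e) (HypsHold-∷ dA pA (HypsHold-ren c ho e))
    sound (⊃E {A = A} {B} d e) η c ok ho =
      Sat-EqSE memSem B (renSE-id η) (sound d η c ok ho _ Ext-refl
        (castF (subFm-cong (subOf-EqSE (EqSE-sym (renSE-id η))) A) (⊢-subOf e η (proj₁ ho)))
        (Sat-EqSE memSem A (EqSE-sym (renSE-id η)) (sound e η c ok ho)))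
    sound (∀I d) η c ok ho w' e v okv =
      sound d (extSE (renSE (ren e) η) v (memPredOf memSem v)) (Coherent-ext v (Coherent-ren {η = η} _ c)) (StandardEnv-ext v _ okv (StandardEnv-ren {η = η} ok e))
        (HypsHold-wk v _ (HypsHold-ren c ho e))
    sound (∀E {A = A} d t) η c ok ho =
      from (proj₁ (Sat-sub1 A t η c)) (Sat-EqSE memSem A (EqSE-ext _ _ (renSE-id η)) (sound d η c ok ho _ Ext-refl (valOf η t) (Standard-valOf η ok t)))
    sound (∃I {A = A} t d) {w} η c ok ho =
      _ , nil , valOf η t , Standard-valOf η ok t ,
      castF (trans (proj₂ (Sat-sub1 A t {w} η c)) (subFm-cong (subOf-EqSE (EqSE-sym (EqSE-ext (valOf η t) (memPredOf memSem (valOf η t)) (renSE-id η)))) A))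
            (⊢-subOf d η (proj₁ ho)) ,
      Sat-EqSE memSem A (EqSE-sym (EqSE-ext (valOf η t) (memPredOf memSem (valOf η t)) (renSE-id η))) (to (proj₁ (Sat-sub1 A t {w} η c)) (sound d η c ok ho))
    sound (∃E {B = B} d e) η c ok ho with sound d η c ok ho
    ... | w' , ch , v , okv , dA , pA = local B (Coherent⇒Regular {η = η} c) (w' , ch ,
            to (proj₁ (Sat-wkFm B (renSE (ren (chExt ch)) η) v (memPredOf memSem v)))
              (sound e (extSE (renSE (ren (chExt ch)) η) v (memPredOf memSem v)) (Coherent-ext v (Coherent-ren {η = η} _ c))
                 (StandardEnv-ext v _ okv (StandardEnv-ren {η = η} ok (chExt ch))) (HypsHold-∷ dA pA (HypsHold-wk v _ (HypsHold-ren c ho (chExt ch))))))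
    sound (ind φ d e) η c ok ho = indSem φ d e η c ok

    -- The induction variable is provably a numeral n, so the step can be iterated n times,
    -- each iteration inside a further cover.
    indSem : ∀ {Γ} (φ : Fm (ω ∷ Γ)) → Γ ∣ [] ⊢ sub1 φ zer →
           (ω ∷ Γ) ∣ [] ⊢ (φ ⊃̇ Eẋ ω (((P · tm v1 · tm zer) ≃̇ tm v0) ∧̇ renFm (liftR there) φ)) →
           ∀ {w} (η : SEnv (ω ∷ Γ) (ctx w)) → Coherent η → StandardEnv w η → ⟦ φ ⟧ w η
    indSem {Γ} φ d e {w} η c ok with look η here in eq | ok here
    ... | vω t | n , nt = local φ (Coherent⇒Regular {η = η} c) (final (iter n))
      where
      η' : SEnv Γ (ctx w)
      η' = tailSE η
      c' : Coherent η'
      c' = Coherent-tail {η = η} c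
      ok' : StandardEnv w η'
      ok' = StandardEnv-tail {η = η} ok
      E : ∀ {w2} (e2 : Ext w w2) (u : Tm (ctx w2) ω) → SEnv (ω ∷ Γ) (ctx w2)
      E e2 u = extSE (renSE (ren e2) η') (vω u) tt₁
      cohE : ∀ {w2} (e2 : Ext w w2) u → Coherent (E e2 u)
      cohE e2 u = Coherent-ext (vω u) (Coherent-ren {η = η'} (ren e2) c')
      okE : ∀ {w2} (e2 : Ext w w2) u j → w2 ⊢ʷ Num j u → StandardEnv w2 (E e2 u)
      okE e2 u j nu = StandardEnv-ext (vω u) tt₁ (j , nu) (StandardEnv-ren {η = η'} ok' e2)
      Pj : ℕ → Set
      Pj j = Cover w (λ w2 e2 → Σ (Tm (ctx w2) ω) λ u → (w2 ⊢ʷ Num j u) × (w2 ⊢ʷ subFm (subOf (E e2 u)) φ) × ⟦ φ ⟧ w2 (E e2 u))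
      η₀ : SEnv Γ (ctx w)
      η₀ = renSE (λ v → v) η'
      c0 : Coherent η₀
      c0 = Coherent-ren {η = η'} (λ v → v) c'
      ok0 : StandardEnv w η₀
      ok0 = StandardEnv-ren {η = η'} ok' Ext-refl
      shift : ∀ {w2 w3} (ch : Chain w w2) (u : Tm (ctx w2) ω) (ch3 : Chain w2 w3) (u' : Tm (ctx w3) ω) →
        EqSE (extSE (renSE (ren (chExt ch3)) (renSE (λ v → v) (E (chExt ch) u))) (vω u') tt₁ ∘ˢᵉ ren⇒sub (liftR there))
             (E (chExt (ch ++ᶜ ch3)) u')
      elook (shift ch u ch3 u') here = refl
      elook (shift ch u ch3 u') (there v) =
        trans (cong (renV (ren (chExt ch3))) (renV-comp (λ a → a) (ren (chExt ch)) (look η' v)))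
        (trans (renV-comp (ren (chExt ch3)) (λ a → ren (chExt ch) a) (look η' v))
               (renV-cong (λ a → sym (++ᶜ-ren ch ch3 a)) (look η' v)))
      emem (shift ch u ch3 u') (there v) w4 r y p = gcong (Coherent⇒Regular {η = η'} c' v) (λ a → cong r (sym (++ᶜ-ren ch ch3 a))) p
      emem' (shift ch u ch3 u') (there v) w4 r y p = gcong (Coherent⇒Regular {η = η'} c' v) (λ a → cong r (++ᶜ-ren ch ch3 a)) p
      iter : ∀ j → Pj j
      iter zero = w , nil , zer , Num-zero ,
                  castF (proj₂ (Sat-sub1 φ zer {w} η₀ c0)) (⊢-subOf d η₀ (λ ())) ,
                  to (proj₁ (Sat-sub1 φ zer {w} η₀ c0)) (sound d η₀ c0 ok0 HypsHold-[])
      iter (suc j) with iter j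
      ... | w2 , ch , u , nu , gφ , pφ
          with sound e (E (chExt ch) u) (cohE (chExt ch) u) (okE (chExt ch) u j nu) HypsHold-[] w2 Ext-refl
                 (castF (subFm-cong (subOf-EqSE (EqSE-sym (renSE-id (E (chExt ch) u)))) φ) gφ)
                 (Sat-EqSE memSem φ (EqSE-sym (renSE-id (E (chExt ch) u))) pφ)
      ... | w3 , ch3 , vω u' , ok3 , gS , (_ , pφ3) =
          w3 , ch ++ᶜ ch3 , u' , Num-suc j numj succ , glue3 , sem3
        where
        E3 = extSE (renSE (ren (chExt ch3)) (renSE (λ v → v) (E (chExt ch) u))) (vω u') tt₁
        succ : w3 ⊢ʷ Succ (renTm (ren (chExt ch3)) (renTm (λ v → v) u)) u'
        succ = castF (Succ-sub (subOf E3) v1 v0) (∧E₁ gS)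
        numj : w3 ⊢ʷ Num j (renTm (ren (chExt ch3)) (renTm (λ v → v) u))
        numj = castF (Num-ren (ren (chExt ch3)) j _) (transport (castF (Num-ren (λ v → v) j u) (transport nu Ext-refl)) (chExt ch3))
        se = Sat-subFm′ φ (ren⇒sub (liftR there)) E3 (E (chExt (ch ++ᶜ ch3)) u') (shift ch u ch3 u')
        glue3 = castF (trans (cong (subFm (subOf E3)) (renFm-sub (liftR there) φ)) (proj₂ se)) (∧E₂ gS)
        sem3 = to (proj₁ se) (subst (λ X → ⟦ X ⟧ w3 E3) (renFm-sub (liftR there) φ) pφ3)
      final : Pj n → Cover w (λ w2 e2 → ⟦ φ ⟧ w2 (renSE (ren e2) η))
      final (w2 , ch , u , nu , gφ , pφ) = w2 , ch , Sat-EqSE memSem φ q2 (Sat-leibniz φ (Coherent⇒Regular {η = E (chExt ch) u} (cohE (chExt ch) u))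
            (Coherent⇒Regular {η = η2} (Coherent-ext (vω (renTm r t)) (Coherent-ren {η = η'} r c'))) rel pφ)
        where
        r = ren (chExt ch)
        η2 = extSE (renSE r η') (vω (renTm r t)) tt₁
        q2 : EqSE η2 (renSE r η)
        elook q2 here = cong (renV r) (sym eq)
        elook q2 (there v) = refl
        emem q2 (there v) w4 r' y p = p
        emem' q2 (there v) w4 r' y p = p
        nt2 : w2 ⊢ʷ Num n (renTm r t)
        nt2 = castF (Num-ren r n t) (transport nt (chExt ch))
        rel : EnvRel memSem-renInvariant w2 (E (chExt ch) u) η2
        rval rel here = Num-functional n nu nt2
        rval rel {s} (there v) = ValEq-refl s (look (renSE r η') v)
        rmem rel (there v) w4 e4 y dd m = m
        rmem' rel (there v) w4 e4 y dd m = m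

-- Formulas whose forcing follows from their derivability.
reflectable : ∀ {Γ} → Fm Γ → Bool
reflectable (Ap _ _ _) = true
reflectable (EqO _ _) = true
reflectable (EqK _ _ _) = true
reflectable (Mem _ _ _) = false
reflectable ⊥̇ = true
reflectable (A ∧̇ B) = reflectable A ∧ reflectable B
reflectable (A ∨̇ B) = false
reflectable (A ⊃̇ B) = reflectable B
reflectable (All̇ s A) = reflectable A
reflectable (Eẋ ω A) = false
reflectable (Eẋ (ty k) A) = reflectable A

allInst : ∀ {Γ s w} (A : Fm (s ∷ Γ)) (η : SEnv Γ (ctx w)) (v : Val s (ctx w)) (h : MemPredFor s (ctx w)) →
  sub1 (subFm (liftS (subOf η)) A) (termV v) ≡ subFm (subOf (extSE η v h)) A
allInst A η v h = trans (sub1≡ _ _) (subFm-subFm (λ { here → refl ; (there u) → trans (subTm-wkTm {σ = idS} (λ _ → refl) (termV (look η u))) (subTm-id _) }) A)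

fresh-term : ∀ k {G} → termV (freshV (ty k) {G}) ≡ var here
fresh-term zero = refl
fresh-term (suc k) = refl

stepInst : ∀ {Γ s w} (A : Fm (s ∷ Γ)) (η : SEnv Γ (ctx w)) (v : Val s (s ∷ ctx w)) (h : MemPredFor s (s ∷ ctx w)) → termV v ≡ var here →
  subFm (liftS (subOf η)) A ≡ subFm (subOf (extSE (renSE there η) v h)) A
stepInst A η v h e = subFm-cong (λ { here → sym e ; (there u) → sym (termV-ren there (look η u)) }) A

reflect : ∀ {Γ} (A : Fm Γ) → T (reflectable A) → ∀ {w} (η : SEnv Γ (ctx w)) → Coherent η → w ⊢ʷ subFm (subOf η) A → ⟦ A ⟧ w η
reflect (Ap _ _ _) t η c d = tt
reflect (EqO _ _) t η c d = tt
reflect (EqK _ _ _) t η c d = tt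
reflect (Mem _ _ _) () η c d
reflect ⊥̇ t η c d = d
reflect (A ∧̇ B) t η c d = reflect A (proj₁ (to (T-∧ {reflectable A}) t)) η c (∧E₁ d) , reflect B (proj₂ (to (T-∧ {reflectable A}) t)) η c (∧E₂ d)
reflect (A ∨̇ B) () η c d
reflect (A ⊃̇ B) t η c d w' e d' p = reflect B t (renSE (ren e) η) (Coherent-ren {η = η} _ c) (⊃E (castF (subOf-ren (ren e) η (A ⊃̇ B)) (transport d e)) d')
reflect (All̇ s A) t η c d w' e v ok =
  reflect A t (extSE (renSE (ren e) η) v (memPredOf memSem v)) (Coherent-ext v (Coherent-ren {η = η} _ c))
    (castF (allInst {w = w'} A (renSE (ren e) η) v (memPredOf memSem v)) (∀E (castF (subOf-ren (ren e) η (All̇ s A)) (transport d e)) (termV v)))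
reflect (Eẋ ω A) () η c d
reflect (Eẋ (ty k) A) t {w} η c d =
  _ , step d nil , freshV (ty k) , Standard-ty k (freshV (ty k)) , g ,
  reflect A t (extSE (renSE there η) (freshV (ty k)) (memPredOf memSem (freshV (ty k)))) (Coherent-ext (freshV (ty k)) (Coherent-ren {η = η} there c)) g
  where
  g = castF (stepInst {w = w} A η (freshV (ty k)) (memPredOf memSem (freshV (ty k))) (fresh-term k)) (hyp (here refl))

Valid : ∀ {Γ} → Fm Γ → Set₁
Valid {Γ} A = ∀ {w} (η : SEnv Γ (ctx w)) → Coherent η → StandardEnv w η → ⟦ A ⟧ w η

Valid-Close : ∀ (Γ : Ctx) (A : Fm Γ) → Valid A → Valid (Close Γ A)
Valid-Close [] A b = b
Valid-Close (s ∷ Γ) A b = Valid-Close Γ (All̇ s A) (λ η c ok w' e v okv →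
  b (extSE (renSE (ren e) η) v (memPredOf memSem v)) (Coherent-ext v (Coherent-ren {η = η} _ c)) (StandardEnv-ext v _ okv (StandardEnv-ren {η = η} ok e)))

Coherent-[] : ∀ {G} (η : SEnv [] G) → Coherent η
Coherent-[] η ()

StandardEnv-[] : ∀ {w} (η : SEnv [] (ctx w)) → StandardEnv w η
StandardEnv-[] η ()

reflectableAxiom-valid : ∀ (Γ : Ctx) (A : Fm Γ) → Axiom (Close Γ A) → T (reflectable A) → Valid (Close Γ A)
reflectableAxiom-valid Γ A a t = Valid-Close Γ A (λ η c ok → reflect A t η c (axiomSub a (subOf η)))

appAll : ∀ {Γ s} {A : Fm (s ∷ Γ)} {w} {η : SEnv Γ (ctx w)} → ⟦ All̇ s A ⟧ w η → (v : Val s (ctx w)) → Standard w v → ⟦ A ⟧ w (extSE η v (memPredOf memSem v))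
appAll {A = A} {w} {η} f v ok = Sat-EqSE memSem A (EqSE-ext v _ (renSE-id η)) (f w Ext-refl v ok)

appImp : ∀ {Γ} {A B : Fm Γ} {w} {η : SEnv Γ (ctx w)} → ⟦ A ⊃̇ B ⟧ w η → w ⊢ʷ subFm (subOf η) A → ⟦ A ⟧ w η → ⟦ B ⟧ w η
appImp {A = A} {B} {w} {η} f d p = Sat-EqSE memSem B (renSE-id η)
  (f w Ext-refl (castF (subFm-cong (subOf-EqSE (EqSE-sym (renSE-id η))) A) d) (Sat-EqSE memSem A (EqSE-sym (renSE-id η)) p))

ax-suc-body : Valid (Eẋ ω ((P · tm v1 · tm zer) ≃̇ tm (v0 {Γ = ω ∷ []})))
ax-suc-body {w} η c ok = helper (look η here) refl (ok here)
  where
  helper : (x : Val ω (ctx w)) → look η here ≡ x → Standard w (look η here) → ⟦ Eẋ ω ((P · tm v1 · tm zer) ≃̇ tm (v0 {Γ = ω ∷ []})) ⟧ w η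
  helper (vω t) eq o with subst (Standard w) eq o
  ... | n , nt = _ , step D0 nil , vω (var here) , (suc n , Num-suc n numn succ) , g ,
      reflect Sx tt (extSE (renSE there η) (vω (var here)) tt₁) (Coherent-ext (vω (var here)) (Coherent-ren {η = η} there c)) g
    where
    Sx : Fm (ω ∷ ω ∷ [])
    Sx = (P · tm v1 · tm zer) ≃̇ tm v0
    D0 : w ⊢ʷ Eẋ ω (subFm (liftS (subOf η)) Sx)
    D0 = axiomSub ax-suc (subOf η)
    g = castF (stepInst {w = w} Sx η (vω (var here)) tt₁ refl) (hyp (here refl))
    numn : ⟨ ω ∷ ctx w , subFm (liftS (subOf η)) Sx ∷ map wkFm (hyps w) ⟩ ⊢ʷ Num n (wkTm t)
    numn = castF (Num-ren there n t) (wk∃ nt)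
    succ : ⟨ ω ∷ ctx w , subFm (liftS (subOf η)) Sx ∷ map wkFm (hyps w) ⟩ ⊢ʷ Succ (wkTm t) (var here)
    succ = castF (trans (Succ-sub (liftS (subOf η)) v1 v0) (cong (λ z → Succ (wkTm (termV z)) (var here)) eq)) (hyp (here refl))

ax-suc-valid : Valid (Close (ω ∷ []) (Eẋ ω ((P · tm v1 · tm zer) ≃̇ tm v0)))
ax-suc-valid = Valid-Close (ω ∷ []) (Eẋ ω ((P · tm v1 · tm zer) ≃̇ tm v0)) ax-suc-body

Sat-⊆⇒MemSim : ∀ {Γ j w} {η : SEnv Γ (ctx w)} → Coherent η → (a b : Var Γ (ty (suc j))) →
  (∀ w' (e : Ext w w') (y : Val (ty j) (ctx w')) → Standard w' y →
     ⟦ Mem j v0 (var (there a)) ⊃̇ Mem j v0 (var (there b)) ⟧ w' (extSE (renSE (ren e) η) y (memPredOf memSem y))) →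
  MemSim j w (look η a) (look η b)
Sat-⊆⇒MemSim {j = j} {η = η} c a b f w' e y dm m =
  to (c b w' (ren e) y)
    (proj₂ (appImp {A = Mem j v0 (var (there a))} {B = Mem j v0 (var (there b))} {η = extSE (renSE (ren e) η) y (memPredOf memSem y)}
                   (f w' e y (Standard-ty j y)) dm' (dm' , from (c a w' (ren e) y) m)))
  where
  dm' = castF (cong (Mem j (termV y)) (sym (termV-ren (ren e) (look η a)))) dm

Sat-EqT⇒ValEq : ∀ k {Γ w} {η : SEnv Γ (ctx w)} → Coherent η → (a b : Var Γ (ty k)) →
  w ⊢ʷ subFm (subOf η) (EqT k (var a) (var b)) → ⟦ EqT k (var a) (var b) ⟧ w η → ValEq (ty k) w (look η a) (look η b)
Sat-EqT⇒ValEq zero c a b d p = d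
Sat-EqT⇒ValEq (suc j) {η = η} c a b d p =
  d , Sat-⊆⇒MemSim {η = η} c a b (λ w' e y ok → proj₁ (p w' e y ok)) , Sat-⊆⇒MemSim {η = η} c b a (λ w' e y ok → proj₂ (p w' e y ok))

eq-mem-body : ∀ k → Valid {Γ = ty (suc k) ∷ ty k ∷ ty (suc k) ∷ ty k ∷ []} ((Mem k v3 v2 ∧̇ EqT k v3 v1 ∧̇ EqT (suc k) v2 v0) ⊃̇ Mem k v1 v0)
eq-mem-body k {w} η c ok w' e d (pM , pX , pY) =
  ⊃E (axiomSub (eq-mem k) (subOf η')) d ,
  gleib (Coherent⇒Regular {η = η'} c' here) {r = λ a → a} (Sat-EqT⇒ValEq k c' X U (∧E₁ (∧E₂ d)) pX) X∈Z
  where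
  η' = renSE (ren e) η
  c' : Coherent η'
  c' = Coherent-ren {η = η} (ren e) c
  X = there (there (there here))
  U = there here
  X∈Z : mem η' here w' (λ a → a) (look η' X)
  X∈Z = proj₂ (appImp {A = Mem k v0 (wkTm v2)} {B = Mem k v0 (wkTm v0)} {η = extSE η' (look η' X) (memPredOf memSem (look η' X))}
                      (proj₁ (appAll {A = Mem k v0 (wkTm v2) ⇔̇ Mem k v0 (wkTm v0)} {η = η'} pY (look η' X) (Standard-ty k (look η' X))))
                      (proj₁ pM) pM)

eq-mem-valid : ∀ k → Valid (Close (ty (suc k) ∷ ty k ∷ ty (suc k) ∷ ty k ∷ []) ((Mem k v3 v2 ∧̇ EqT k v3 v1 ∧̇ EqT (suc k) v2 v0) ⊃̇ Mem k v1 v0))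
eq-mem-valid k = Valid-Close (ty (suc k) ∷ ty k ∷ ty (suc k) ∷ ty k ∷ []) ((Mem k v3 v2 ∧̇ EqT k v3 v1 ∧̇ EqT (suc k) v2 v0) ⊃̇ Mem k v1 v0) (eq-mem-body k)

AgreeBelow : ℕ → (∀ j → MemInterp j) → (∀ j → MemInterp j) → Set
AgreeBelow k I I' = ∀ j → j < k → ∀ {G} (B : Val (ty (suc j)) G) (w : World) (r : Ren G (ctx w)) (y : Val (ty j) (ctx w)) →
  I j B w r y ⇔ I' j B w r y

AgreeBelow-sym : ∀ {k I I'} → AgreeBelow k I I' → AgreeBelow k I' I
AgreeBelow-sym a j lt B w r y = ⇔-sym (a j lt B w r y)

record EnvAgree (k : ℕ) {Γ G} (η η' : SEnv Γ G) : Set where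
  field
    look-≡ : ∀ {s} (v : Var Γ s) → look η v ≡ look η' v
    mem-⇔  : ∀ {j} → j ≤ k → (v : Var Γ (ty (suc j))) (w : World) (r : Ren G (ctx w)) (y : Val (ty j) (ctx w)) →
             mem η v w r y ⇔ mem η' v w r y
open EnvAgree public

module _ {k : ℕ} where
  EnvAgree-sym : ∀ {Γ G} {η η' : SEnv Γ G} → EnvAgree k η η' → EnvAgree k η' η
  look-≡ (EnvAgree-sym q) v = sym (look-≡ q v)
  mem-⇔ (EnvAgree-sym q) le v w r y = ⇔-sym (mem-⇔ q le v w r y)

  EnvAgree-ren : ∀ {Γ G G'} {η η' : SEnv Γ G} (r : Ren G G') → EnvAgree k η η' → EnvAgree k (renSE r η) (renSE r η')
  look-≡ (EnvAgree-ren r q) v = cong (renV r) (look-≡ q v)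
  mem-⇔ (EnvAgree-ren r q) le v w r' y = mem-⇔ q le v w _ y

  EnvAgree-ext : ∀ {I I' Γ G s} {η η' : SEnv Γ G} → AgreeBelow k I I' → (x : Val s G) → s <ᵀ suc k → EnvAgree k η η' →
    EnvAgree k (extSE η x (memPredOf I x)) (extSE η' x (memPredOf I' x))
  look-≡ (EnvAgree-ext a x lt q) here = refl
  look-≡ (EnvAgree-ext a x lt q) (there v) = look-≡ q v
  mem-⇔ (EnvAgree-ext {s = ty (suc j)} a x lt q) le here w r y = a j (s≤s⁻¹ lt) x w r y
  mem-⇔ (EnvAgree-ext a x lt q) le (there v) w r y = mem-⇔ q le v w r y

  subOf-agree : ∀ {Γ G} {η η' : SEnv Γ G} → EnvAgree k η η' → subOf η ≗ˢ subOf η'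
  subOf-agree q v = cong termV (look-≡ q v)

  valOf-agree : ∀ {Γ G s} {η η' : SEnv Γ G} → EnvAgree k η η' → (a : Tm Γ s) → valOf η a ≡ valOf η' a
  valOf-agree q (var v) = look-≡ q v
  valOf-agree q zer = refl
  valOf-agree q (cst c) = refl

Sat-agree : ∀ {k I I'} → AgreeBelow k I I' → ∀ {Γ} (A : Fm Γ) → Elem (suc k) A →
  ∀ {w} {η η' : SEnv Γ (ctx w)} → EnvAgree k η η' → Sat I A w η → Sat I' A w η'
Sat-agree a (Ap _ _ _) el q p = tt
Sat-agree a (EqO _ _) el q p = tt
Sat-agree a (EqK _ _ _) el q p = tt
Sat-agree a (Mem j b (var v)) el {w} {η} q (d , m) =
  castF (subFm-cong (subOf-agree q) (Mem j b (var v))) d ,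
  to (mem-⇔ q (s≤s⁻¹ el) v w (λ u → u) _) (subst (mem η v w (λ u → u)) (valOf-agree q b) m)
Sat-agree a ⊥̇ el q p = p
Sat-agree a (A ∧̇ B) (ea , eb) q (p , p') = Sat-agree a A ea q p , Sat-agree a B eb q p'
Sat-agree a (A ∨̇ B) (ea , eb) q (w' , ch , inj₁ (d , p)) =
  w' , ch , inj₁ (castF (subFm-cong (subOf-agree q') A) d , Sat-agree a A ea q' p)
  where q' = EnvAgree-ren (ren (chExt ch)) q
Sat-agree a (A ∨̇ B) (ea , eb) q (w' , ch , inj₂ (d , p)) =
  w' , ch , inj₂ (castF (subFm-cong (subOf-agree q') B) d , Sat-agree a B eb q' p)
  where q' = EnvAgree-ren (ren (chExt ch)) q
Sat-agree a (A ⊃̇ B) (ea , eb) q f w' e d p =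
  Sat-agree a B eb q' (f w' e (castF (subFm-cong (subOf-agree (EnvAgree-sym q')) A) d)
                              (Sat-agree (AgreeBelow-sym a) A ea (EnvAgree-sym q') p))
  where q' = EnvAgree-ren (ren e) q
Sat-agree a (All̇ s A) (lt , ea) q f w' e v ok = Sat-agree a A ea (EnvAgree-ext a v lt (EnvAgree-ren (ren e) q)) (f w' e v ok)
Sat-agree a (Eẋ s A) (lt , ea) q (w' , ch , v , ok , d , p) =
  w' , ch , v , ok , castF (subFm-cong (subOf-agree q') A) d , Sat-agree a A ea q' p
  where q' = EnvAgree-ext a v lt (EnvAgree-ren (ren (chExt ch)) q)

Sat-agree-⇔ : ∀ {k I I'} → AgreeBelow k I I' → ∀ {Γ} (A : Fm Γ) → Elem (suc k) A →
  ∀ {w} {η η' : SEnv Γ (ctx w)} → EnvAgree k η η' → Sat I A w η ⇔ Sat I' A w η'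
Sat-agree-⇔ a A el q = mk⇔ (Sat-agree a A el q) (Sat-agree (AgreeBelow-sym a) A el (EnvAgree-sym q))

interpBelow-memSem : ∀ k → AgreeBelow k (Stratum.interpBelow k (memBelow k)) memSem
interpBelow-memSem k j lt B w r y with j <? k
... | yes p = ≡⇒ (memBelow-coherent k j p B w r y)
... | no np = ⊥-elim (np lt)

renFm-cong : ∀ {Γ Δ} {r r' : Ren Γ Δ} → (∀ {s} (v : Var Γ s) → r v ≡ r' v) → (A : Fm Γ) → renFm r A ≡ renFm r' A
renFm-cong {r = r} {r'} e A = trans (renFm-sub r A) (trans (subFm-cong (λ v → cong var (e v)) A) (sym (renFm-sub r' A)))

compBodyRen : ∀ {k Δ} → Ren (ty k ∷ Δ) (ty k ∷ ty (suc k) ∷ Δ)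
compBodyRen here = here
compBodyRen (there v) = there (there v)

toEnv : ∀ {G} (Δ : Ctx) → SEnv Δ G → Env G Δ
toEnv [] η = []
toEnv (s ∷ Δ) η = look η here ∷ toEnv Δ (η ∘ˢᵉ (λ v → var (there v)))

toEnv-look : ∀ {G} (Δ : Ctx) (η : SEnv Δ G) {s} (v : Var Δ s) → lookE (toEnv Δ η) v ≡ look η v
toEnv-look (s ∷ Δ) η here = refl
toEnv-look (s ∷ Δ) η (there v) = toEnv-look Δ (η ∘ˢᵉ (λ v → var (there v))) v

simR-reflectable : ∀ {Γ Δ} (ρ : Ren Γ Δ) (t : ET Γ) (x : Tm Δ (ty 0)) → T (reflectable (simR ρ t x))
simR-reflectable ρ (tm {ω} a) x = tt
simR-reflectable ρ (tm {ty k} a) x = tt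
simR-reflectable ρ (t₁ · t₂) x = from T-∧ (simR-reflectable _ t₁ _ , from T-∧ (simR-reflectable _ t₂ _ , tt))

≃̇-reflectable : ∀ {Γ} (t τ : ET Γ) → T (reflectable (t ≃̇ τ))
≃̇-reflectable t τ = from T-∧ (simR-reflectable _ (wkET t) _ , simR-reflectable _ (wkET τ) _)

envMem-dispatch : ∀ k {G Δ j} (e : Env G Δ) (v : Var Δ (ty (suc j))) (w : World) (r : Ren G (ctx w)) (y : Val (ty j) (ctx w)) →
  Stratum.envMem k (memBelow k) e v w r y ≡ Stratum.memDispatch k (memBelow k) (j ≟ k) (lookE e v) w r y
envMem-dispatch k (B ∷ e) here w r y = refl
envMem-dispatch k (B ∷ e) (there v) w r y = envMem-dispatch k e v w r y

module Comprehension (k : ℕ) (Δ : Ctx) (φ : Fm (ty k ∷ Δ)) (el : Elem (suc k) φ) (t : ET (ty (suc k) ∷ Δ)) (ψ : Fm (ty k ∷ ty (suc k) ∷ Δ))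
          (eqψ : ψ ≡ renFm compBodyRen φ)
          (ax0 : ∀ {w} (η : SEnv Δ (ctx w)) → w ⊢ʷ subFm (subOf η) (Eẋ (ty (suc k)) ((t ≃̇ tm v0) ∧̇ All̇ (ty k) (Mem k v0 v1 ⇔̇ ψ)))) where
  open Stratum k (memBelow k) using (interpBelow; envSE; envMem; memDispatch; memAt)

  memDispatch-memSem : ∀ {G j} → j ≤ k → (d : Dec (j ≡ k)) (B : Val (ty (suc j)) G) (w : World) (r : Ren G (ctx w)) (y : Val (ty j) (ctx w)) →
    memDispatch d B w r y ⇔ memSem j B w r y
  memDispatch-memSem le (yes refl) B w r y = mk⇔ id id
  memDispatch-memSem {j = j} le (no ne) B w r y = interpBelow-memSem k j (≤∧≢⇒< le ne) B w r y

  body : Valid (Eẋ (ty (suc k)) ((t ≃̇ tm v0) ∧̇ All̇ (ty k) (Mem k v0 v1 ⇔̇ ψ)))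
  body {w} η c ok = _ , step (ax0 η) nil , U , tt , gU , reflect (t ≃̇ tm v0) (≃̇-reflectable t (tm v0)) E1 c1 (∧E₁ gU) , semΨ
    where
    ηw = renSE there η
    U : Val (ty (suc k)) (ty (suc k) ∷ ctx w)
    U = vS (var here) Δ φ el (toEnv Δ ηw)
    E1 = extSE ηw U (memSem k U)
    c1 : Coherent E1
    c1 = Coherent-ext U (Coherent-ren {η = η} there c)
    gU = castF (stepInst {w = w} ((t ≃̇ tm v0) ∧̇ All̇ (ty k) (Mem k v0 v1 ⇔̇ ψ)) η U (memSem k U) refl) (hyp (here refl))
    w1 : World
    w1 = ⟨ ty (suc k) ∷ ctx w , subFm (liftS (subOf η)) ((t ≃̇ tm v0) ∧̇ All̇ (ty k) (Mem k v0 v1 ⇔̇ ψ)) ∷ map wkFm (hyps w) ⟩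
    semΨ : ⟦ All̇ (ty k) (Mem k v0 v1 ⇔̇ ψ) ⟧ w1 E1
    semΨ w2 e2 z okz = imp1 , imp2
      where
      E2 = extSE (renSE (ren e2) E1) z (memPredOf memSem z)
      module _ {w3} (e3 : Ext w2 w3) where
        Rr : Ren (ty (suc k) ∷ ctx w) (ctx w3)
        Rr a = ren e3 (ren e2 a)
        Z = renV (ren e3) z
        E3 = renSE (ren e3) E2
        X3 = renSE (ren e3) (renSE (ren e2) E1)
        ηA = extSE (renSE Rr (envSE (toEnv Δ ηw))) Z (memPredOf interpBelow Z)
        ηB' = extSE (X3 ∘ˢᵉ (λ v → var (there v))) Z (memPredOf memSem Z)
        qB : EqSE E3 (extSE X3 Z (memPredOf memSem Z))
        qB = ext-ren (renSE (ren e2) E1) (ren e3) z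
        qB2 : EqSE (extSE X3 Z (memPredOf memSem Z) ∘ˢᵉ ren⇒sub compBodyRen) ηB'
        elook qB2 here = refl
        elook qB2 (there v) = refl
        emem qB2 here w4 r y p = p
        emem qB2 (there v) w4 r y p = p
        emem' qB2 here w4 r y p = p
        emem' qB2 (there v) w4 r y p = p
        qB3 : EqSE (E3 ∘ˢᵉ ren⇒sub compBodyRen) ηB'
        qB3 = EqSE-trans q' qB2
          where
          q' : EqSE (E3 ∘ˢᵉ ren⇒sub compBodyRen) (extSE X3 Z (memPredOf memSem Z) ∘ˢᵉ ren⇒sub compBodyRen)
          elook q' v = elook qB (compBodyRen v)
          emem q' v = emem qB (compBodyRen v)
          emem' q' v = emem' qB (compBodyRen v)
        agreeΔ : EnvAgree k (renSE Rr (envSE (toEnv Δ ηw))) (X3 ∘ˢᵉ (λ v → var (there v)))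
        look-≡ agreeΔ u = trans (cong (renV Rr) (toEnv-look Δ ηw u)) (sym (renV-comp (ren e3) (ren e2) _))
        mem-⇔ agreeΔ {j} le u w4 r y =
          ⇔-sym (c u w4 _ y)
          ⇔-∘ (⇔-sym (memSem-renInvariant j (look η u) there w4 (λ a → r (Rr a)) y)
          ⇔-∘ (≡⇒ (cong (λ B → memSem j B w4 (λ a → r (Rr a)) y) (toEnv-look Δ ηw u))
          ⇔-∘ (memDispatch-memSem le (j ≟ k) (lookE (toEnv Δ ηw) u) w4 _ y
          ⇔-∘ ≡⇒ (envMem-dispatch k (toEnv Δ ηw) u w4 _ y))))
        corrU : memAt U w3 Rr Z ⇔ ⟦ φ ⟧ w3 (E3 ∘ˢᵉ ren⇒sub compBodyRen)
        corrU = mk⇔ (Sat-EqSE memSem φ (EqSE-sym qB3)) (Sat-EqSE memSem φ qB3)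
          ⇔-∘ Sat-agree-⇔ (interpBelow-memSem k) φ el (EnvAgree-ext (interpBelow-memSem k) Z (n<1+n k) agreeΔ)
        ψφ : ⟦ ψ ⟧ w3 E3 ⇔ ⟦ φ ⟧ w3 (E3 ∘ˢᵉ ren⇒sub compBodyRen)
        ψφ = Sat-subFm φ (ren⇒sub compBodyRen) E3 ⇔-∘ ≡⇒ (cong (λ X → ⟦ X ⟧ w3 E3) (trans eqψ (renFm-sub compBodyRen φ)))
        E4 = extSE (renSE (ren (e2 ⨾ e3)) E1) Z (memPredOf memSem Z)
        sb : subOf E3 ≗ˢ subOf E4
        sb here = refl
        sb (there u) = cong termV (renV-comp (ren e3) (ren e2) (look E1 u))
        memGlue : w3 ⊢ʷ subFm (subOf E3) ψ → w3 ⊢ʷ subFm (subOf E3) (Mem k v0 v1)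
        memGlue dψ = castF (sym (subFm-cong sb (Mem k v0 v1)))
          (⊃E (∧E₂ (castF (allInst {w = w3} (Mem k v0 v1 ⇔̇ ψ) (renSE (ren (e2 ⨾ e3)) E1) Z (memPredOf memSem Z))
                 (∀E (castF (subOf-ren (ren (e2 ⨾ e3)) E1 (All̇ (ty k) (Mem k v0 v1 ⇔̇ ψ))) (transport (∧E₂ gU) (e2 ⨾ e3))) (termV Z))))
              (castF (subFm-cong sb ψ) dψ))
      imp1 : ⟦ Mem k v0 v1 ⊃̇ ψ ⟧ w2 E2
      imp1 w3 e3 dm (dm' , mU) = from (ψφ e3) (to (corrU e3) mU)
      imp2 : ⟦ ψ ⊃̇ Mem k v0 v1 ⟧ w2 E2
      imp2 w3 e3 dψ pψ = memGlue e3 dψ , from (corrU e3) (to (ψφ e3) pψ)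

comp-valid : ∀ k (Δ : Ctx) (φ : Fm (ty k ∷ Δ)) → All (λ s → s ≤ᵀ suc k) Δ → Elem (suc k) φ → Valid (Close Δ (compBody k Δ φ))
comp-valid k Δ φ al el = Valid-Close Δ (compBody k Δ φ)
  (Comprehension.body k Δ φ el _ _ (renFm-cong (λ { here → refl ; (there v) → refl }) φ)
     (λ η → axiomSub {Γ = Δ} {A = compBody k Δ φ} (comp k Δ φ al el) (subOf η)))

validAxiom : ∀ {A} → Axiom A → Valid A
validAxiom eq-refl = reflectableAxiom-valid (ty 0 ∷ []) _ eq-refl tt
validAxiom (eq-names k n) = reflectableAxiom-valid (ty n ∷ ty k ∷ ty 0 ∷ ty 0 ∷ []) _ (eq-names k n) tt
validAxiom eq-num1 = reflectableAxiom-valid (ty 0 ∷ ty 0 ∷ ω ∷ []) _ eq-num1 tt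
validAxiom eq-num2 = reflectableAxiom-valid (ty 0 ∷ ty 0 ∷ ω ∷ []) _ eq-num2 tt
validAxiom eq-ap = reflectableAxiom-valid (ty 0 ∷ ty 0 ∷ ty 0 ∷ ty 0 ∷ ty 0 ∷ ty 0 ∷ []) _ eq-ap tt
validAxiom (eq-mem k) = eq-mem-valid k
validAxiom ap-fun = reflectableAxiom-valid (ty 0 ∷ ty 0 ∷ ty 0 ∷ ty 0 ∷ []) _ ap-fun tt
validAxiom ax-k = reflectableAxiom-valid (ty 0 ∷ ty 0 ∷ []) _ ax-k tt
validAxiom ax-s1 = reflectableAxiom-valid (ty 0 ∷ ty 0 ∷ []) _ ax-s1 tt
validAxiom ax-s2 = reflectableAxiom-valid (ty 0 ∷ ty 0 ∷ ty 0 ∷ []) _ ax-s2 tt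
validAxiom ax-p1 = reflectableAxiom-valid (ty 0 ∷ ty 0 ∷ []) _ ax-p1 tt
validAxiom ax-p2 = reflectableAxiom-valid (ty 0 ∷ ty 0 ∷ []) _ ax-p2 tt
validAxiom ax-pi1 = reflectableAxiom-valid (ty 0 ∷ []) _ ax-pi1 tt
validAxiom ax-pi2 = reflectableAxiom-valid (ty 0 ∷ []) _ ax-pi2 tt
validAxiom ax-pi1' = reflectableAxiom-valid (ty 0 ∷ ty 0 ∷ []) _ ax-pi1' tt
validAxiom ax-pi2' = reflectableAxiom-valid (ty 0 ∷ ty 0 ∷ []) _ ax-pi2' tt
validAxiom ax-suc = ax-suc-valid
validAxiom (ax-pk k) = reflectableAxiom-valid (ty k ∷ ty 0 ∷ []) _ (ax-pk k) tt
validAxiom ax-d1 = reflectableAxiom-valid (ω ∷ ω ∷ ty 0 ∷ ty 0 ∷ []) _ ax-d1 tt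
validAxiom ax-d2 = reflectableAxiom-valid (ω ∷ ω ∷ ty 0 ∷ ty 0 ∷ []) _ ax-d2 tt
validAxiom name-ω = reflectableAxiom-valid (ω ∷ []) _ name-ω tt
validAxiom (name-k k) = reflectableAxiom-valid (ty k ∷ []) _ (name-k k) tt
validAxiom (comp k Δ φ al el) = comp-valid k Δ φ al el

axiom-valid : ∀ {A} → Axiom A → ∀ {w} (η : SEnv [] (ctx w)) → ⟦ A ⟧ w η
axiom-valid a η = validAxiom a η (Coherent-[] η) (StandardEnv-[] η)

emptyEnv : SEnv [] []
look emptyEnv ()
mem emptyEnv ()

BT-sound : ∀ {A} → BT⊢ A → ⟦ A ⟧ ⟨ [] , [] ⟩ emptyEnv
BT-sound d = Soundness.sound axiom-valid d emptyEnv (Coherent-[] emptyEnv) (StandardEnv-[] emptyEnv) HypsHold-[]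

subFm-closed : ∀ {G} (σ : Sub [] G) (r : Ren [] G) (A : Fm []) → subFm σ A ≡ renFm r A
subFm-closed σ r A = trans (subFm-cong (λ ()) A) (sym (renFm-sub r A))

theorem4 : (φ ψ : Fm []) → BT⊢ (φ ∨̇ ψ) → BT⊢ φ ⊎ BT⊢ ψ
theorem4 φ ψ d with BT-sound d
... | _ , ch , inj₁ (dφ , _) = inj₁ (collapse ch (castF (subFm-closed _ _ φ) dφ))
... | _ , ch , inj₂ (dψ , _) = inj₂ (collapse ch (castF (subFm-closed _ _ ψ) dψ))
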